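{- Fix $m\ge 1$ and define \[F(\mathbf v;t)=F(v_1,\dots,v_m,v_{m+1};t)=\sum_{\pi\in\Pi^{(m)}} v_1^{a_1(\pi)}v_2^{a_2(\pi)-a_1(\pi)}\cdots v_m^{a_m(\pi)-a_{m-1}(\pi)}v_{m+1}^{|\pi|-a_m(\pi)}t^{|\pi|}.\] Then \begin{multline*} F(\mathbf v;t)=\frac{v_1}{v_{m+1}}+tv_1\Bigl(F(\mathbf v;t)+v_{m+1}\sum_{j=1}^m\frac{F(\mathbf v;t)}{v_j-v_{j+1}}\Bigr)\\ -v_{m+1}tv_1\Bigl(\frac{v_1}{v_2}\,\frac{F(v_2,v_2,v_3,\dots,v_{m+1};t)}{v_1-v_2}+\sum_{j=2}^m\frac{F(v_1,\dots,v_{j-1},v_{j+1},v_{j+1},v_{j+2},\dots,v_{m+1};t)}{v_j-v_{j+1}}\Bigr), \end{multline*} and $F(1,1,\dots,1;t)=\sum_{\pi\in\Pi^{(m)}}t^{|\pi|}$ is the generating function, by size, of the set partitions containing no $(m+1)$-nesting.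
   Context: A set partition of $[n]=\{1,\dots,n\}$ ($n\ge0$) is a collection of nonempty pairwise disjoint blocks with union $[n]$; $|\pi|=n$. Its arcs are the pairs $(i,j)$, $i<j$, of consecutive elements (in numerical order) of a same block. A $k$-nesting is a set of $k$ arcs $(i_1,j_1),\dots,(i_k,j_k)$ with $i_1<\dots<i_k<j_k<\dots<j_1$ (a single arc is a $1$-nesting); a partition is $k$-nonnesting if it has no $k$-nesting. $\Pi^{(m)}$ denotes the set of all set partitions (of all sizes $n\ge0$) containing no $(m+1)$-nesting. Blocks are ordered by decreasing maximal element. For $1\le j\le m$, $a_j(\pi)$ is $1+$(number of blocks of $\pi$) if $\pi$ is $j$-nonnesting, and otherwise $1+$ the number of blocks whose maximal element is strictly greater than the largest value, over all $j$-nestings of $\pi$, of the smallest vertex of the $j$-nesting. The empty partition has $a_j=1$ for all $j$. $F$ is a formal power series in $t$ whose coefficients are Laurent polynomials in $v_1,\dots,v_{m+1}$. -}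

module Defs where

open import Data.Bool using (Bool; true; false; _∧_; _∨_; not; if_then_else_)
open import Data.Nat as ℕ using (ℕ; zero; suc; _<ᵇ_)
open import Data.Fin as Fin using (Fin; zero; suc; toℕ; inject₁; fromℕ)
open import Data.Fin.Properties using () renaming (_≟_ to _≟ᶠ_)
open import Data.List using (List; []; _∷_; map; foldr; length; concatMap; allFin; null; filterᵇ; tabulate)
open import Data.Product using (_×_; _,_)
open import Data.Integer as ℤ using (ℤ; +_; -[1+_])
open import Data.Rational using (ℚ; 0ℚ; 1ℚ; _+_; _*_; _-_; 1/_; ≢-nonZero)
open import Data.Rational.Properties using (_≟_)
open import Relation.Nullary using (yes; no)

all : ∀ {A : Set} → (A → Bool) → List A → Bool
all p = foldr (λ x b → p x ∧ b) true

allFuns : ∀ {A : Set} (k : ℕ) → List A → List (Fin k → A)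
allFuns zero    xs = (λ ()) ∷ []
allFuns (suc k) xs =
  concatMap (λ x → map (λ f → λ { zero → x ; (suc i) → f i }) (allFuns k xs)) xs

_<ᶠ_ : ∀ {n} → Fin n → Fin n → Bool
i <ᶠ j = toℕ i <ᵇ toℕ j

maxℕ : List ℕ → ℕ
maxℕ = foldr ℕ._⊔_ 0

-- Set partitions of [n] = {1,…,n}, with [n] encoded as Fin n (element
-- i+1 is encoded as i; order is preserved).  A set partition is given
-- by its equivalence relation "i and j lie in the same block".

BRel : ℕ → Set
BRel n = Fin n → Fin n → Bool

IsEquivᵇ : ∀ {n} → BRel n → Bool
IsEquivᵇ {n} R =
  all (λ i → R i i) fs ∧
  all (λ i → all (λ j → not (R i j) ∨ R j i) fs) fs ∧
  all (λ i → all (λ j → all (λ k → not (R i j ∧ R j k) ∨ R i k) fs) fs) fs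
  where fs = allFin n

setPartitions : (n : ℕ) → List (BRel n)
setPartitions n = filterᵇ IsEquivᵇ (allFuns n (allFuns n (true ∷ false ∷ [])))

Arc : ℕ → Set
Arc n = Fin n × Fin n

IsArcᵇ : ∀ {n} → BRel n → Arc n → Bool
IsArcᵇ {n} R (i , j) =
  (i <ᶠ j) ∧ R i j ∧ all (λ k → not ((i <ᶠ k) ∧ (k <ᶠ j) ∧ R i k)) (allFin n)

arcs : ∀ {n} → BRel n → List (Arc n)
arcs {n} R = filterᵇ (IsArcᵇ R)
  (concatMap (λ i → map (λ j → (i , j)) (allFin n)) (allFin n))

NestedChainᵇ : ∀ {n} → List (Arc n) → Bool
NestedChainᵇ []                               = true
NestedChainᵇ (_ ∷ [])                         = true
NestedChainᵇ ((i , j) ∷ (i' , j') ∷ rest) =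
  (i <ᶠ i') ∧ (j' <ᶠ j) ∧ NestedChainᵇ ((i' , j') ∷ rest)

nestings : ∀ {n} → ℕ → BRel n → List (List (Arc n))
nestings k R = filterᵇ NestedChainᵇ (map tabulate (allFuns k (arcs R)))

-- smallest vertex i₁ of a nesting listed outermost first
smallestVertex : ∀ {n} → List (Arc n) → ℕ
smallestVertex []            = 0
smallestVertex ((i , _) ∷ _) = toℕ i

IsBlockMaxᵇ : ∀ {n} → BRel n → Fin n → Bool
IsBlockMaxᵇ {n} R i = all (λ k → not (R i k ∧ (i <ᶠ k))) (allFin n)

numBlocks : ∀ {n} → BRel n → ℕ
numBlocks {n} R = length (filterᵇ (IsBlockMaxᵇ R) (allFin n))

aStat : ∀ {n} → ℕ → BRel n → ℕ
aStat {n} j R with null (nestings j R)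
... | true  = suc (numBlocks R)
... | false = suc (length (filterᵇ (λ i → IsBlockMaxᵇ R i ∧ (M <ᵇ toℕ i)) (allFin n)))
  where M = maxℕ (map smallestVertex (nestings j R))

NoNestingᵇ : ∀ {n} → ℕ → BRel n → Bool
NoNestingᵇ m R = null (nestings (suc m) R)

PiM : (m n : ℕ) → List (BRel n)
PiM m n = filterᵇ (NoNestingᵇ m) (setPartitions n)

-- Rational arithmetic helpers (total inverse: inv 0 = 0; only ever used
-- at nonzero arguments under the hypotheses of the theorem)

inv : ℚ → ℚ
inv q with q ≟ 0ℚ
... | yes _ = 0ℚ
... | no q≢0 = 1/_ q {{≢-nonZero q≢0}}

_÷_ : ℚ → ℚ → ℚ
p ÷ q = p * inv q

infixl 7 _÷_

powℕ : ℚ → ℕ → ℚ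
powℕ q zero    = 1ℚ
powℕ q (suc k) = q * powℕ q k

zpow : ℚ → ℤ → ℚ
zpow q (+ k)     = powℕ q k
zpow q -[1+ k ]  = inv (powℕ q (suc k))

sumℚ : List ℚ → ℚ
sumℚ = foldr _+_ 0ℚ

-- The generating function F, coefficientwise, evaluated at a point
-- v = (v₁,…,v_{m+1}) encoded as v : Fin (suc m) → ℚ  (v_{i+1} = v i).

aExt : ∀ {n} → BRel n → ℕ → ℕ
aExt R zero    = 0
aExt R (suc j) = aStat (suc j) R

expo : (m n : ℕ) → BRel n → Fin (suc m) → ℤ
expo m n R i with toℕ i <ᵇ m
... | true  = (+ aExt R (suc (toℕ i))) ℤ.- (+ aExt R (toℕ i))
... | false = (+ n) ℤ.- (+ aExt R m)

weight : (m n : ℕ) → (Fin (suc m) → ℚ) → BRel n → ℚ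
weight m n v R = foldr _*_ 1ℚ (map (λ i → zpow (v i) (expo m n R i)) (allFin (suc m)))

-- Formal power series in t with rational coefficients: coefficient sequences
Series : Set
Series = ℕ → ℚ

F : (m : ℕ) → (Fin (suc m) → ℚ) → Series
F m v n = sumℚ (map (weight m n v) (PiM m n))

countSeries : (m : ℕ) → Series
countSeries m n = (+ length (PiM m n)) Data.Rational./ 1

constS : ℚ → Series
constS c zero    = c
constS c (suc _) = 0ℚ

_⊕_ : Series → Series → Series
(f ⊕ g) n = f n + g n

_⊖_ : Series → Series → Series
(f ⊖ g) n = f n - g n

infixl 6 _⊕_ _⊖_

_·_ : ℚ → Series → Series
(c · f) n = c * f n

infixr 7 _·_

tMul : Series → Series
tMul f zero    = 0ℚ
tMul f (suc n) = f n

sumS : ∀ {k} → (Fin k → Series) → Series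
sumS {k} f n = sumℚ (map (λ j → f j n) (allFin k))

-- the point (v₁,…,v_{j-1},v_{j+1},v_{j+1},…,v_{m+1}) for 1 ≤ j ≤ m
-- (j encoded 0-based as j : Fin m, i.e. coordinate j replaced by coordinate j+1)
substNext : ∀ {m} → (Fin (suc m) → ℚ) → Fin m → (Fin (suc m) → ℚ)
substNext v j i with i ≟ᶠ inject₁ j
... | yes _ = v (suc j)
... | no  _ = v i

-- the j-th summand (j = 1,…,m, 0-based) of the last bracket:
-- j = 1 : (v₁/v₂) F(v₂,v₂,v₃,…)/(v₁-v₂);  j ≥ 2 : F(…)/(v_j - v_{j+1})
lastTerm : (m : ℕ) → (Fin (suc m) → ℚ) → Fin m → Series
lastTerm m v zero    = ((v zero ÷ v (suc zero)) ÷ (v zero - v (suc zero))) · F m (substNext v zero)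
lastTerm m v (suc j) = inv (v (inject₁ (suc j)) - v (suc (suc j))) · F m (substNext v (suc j))

RHS : (m : ℕ) → (Fin (suc m) → ℚ) → Series
RHS m v =
  constS (v₁ ÷ vₘ₊₁)
  ⊕ tMul (v₁ · (F m v ⊕ vₘ₊₁ · sumS (λ j → inv (v (inject₁ j) - v (suc j)) · F m v)))
  ⊖ vₘ₊₁ · tMul (v₁ · sumS (lastTerm m v))
  where
    v₁ = v zero
    vₘ₊₁ = v (fromℕ m)

{-# OPTIONS --safe #-}
-- Removing the largest element n+1 from a partition in Π^(m) of [n+1] leaves a partition π in Π^(m) of [n],
-- so F is computed by summing over the children of each π: n+1 either forms a new block or is appended to the
-- block with maximum b. Let s_j be the largest smallest vertex of a j-nesting of π (0 if there is none), so that
-- a_j = 1 + #{block maxima > s_j} and s_1 ≥ s_2 ≥ …. The new arc (b, n+1) nests over exactly the nestings to the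
-- right of b, so if s_{K+1} < b ≤ s_K (with s_0 = n) the child has statistics a_j + 1 for j ≤ K,
-- 1 + #{block maxima ≥ b} in place of a_{K+1}, and a_j for j > K + 1, while b ≤ s_m creates an (m+1)-nesting;
-- the new block raises every a_j by one. For fixed π and K the rank of b runs over an interval, so the children
-- of type K contribute a geometric sum in v_K / v_{K+1}. Its lower end is the weight of π at the point where v_K
-- is replaced by v_{K+1}, which is where the substituted series on the right-hand side come from. At v = (1,…,1)
-- every weight is 1, so F counts Π^(m).
module Submission where

module Booleans where

  open import Data.Bool using (Bool; true; false; _∧_; _∨_; not; T)
  open import Data.Bool.Properties using (T-≡)
  open import Data.Nat as ℕ using (zero; suc; _<ᵇ_; _≤ᵇ_; _≡ᵇ_; _<_; _≤_)
  import Data.Nat.Properties as NP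
  open import Data.Product using (_×_; _,_)
  open import Function.Bundles using (Equivalence)
  open import Relation.Binary.PropositionalEquality
  open import Relation.Nullary using (¬_)
  open import Data.Empty using (⊥-elim)

  true≢false : true ≢ false
  true≢false ()

  ≢true⇒≡false : ∀ {a} → a ≢ true → a ≡ false
  ≢true⇒≡false {true}  a≢true = ⊥-elim (a≢true refl)
  ≢true⇒≡false {false} _      = refl

  ≡false⇒≢true : ∀ {a} → a ≡ false → a ≢ true
  ≡false⇒≢true refl ()

  ∧-elim : ∀ {a b} → (a ∧ b) ≡ true → (a ≡ true) × (b ≡ true)
  ∧-elim {true} {true} _ = refl , refl

  ∧-intro : ∀ {a b} → a ≡ true → b ≡ true → (a ∧ b) ≡ true
  ∧-intro refl refl = refl

  not-true : ∀ {a} → not a ≡ true → a ≡ false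
  not-true {false} _ = refl

  impl-elim : ∀ a b → (not a ∨ b) ≡ true → a ≡ true → b ≡ true
  impl-elim true b e refl = e

  impl-intro : ∀ a b → (a ≡ true → b ≡ true) → (not a ∨ b) ≡ true
  impl-intro true  b f = f refl
  impl-intro false b f = refl

  Bool-ext : ∀ {a b : Bool} → (a ≡ true → b ≡ true) → (b ≡ true → a ≡ true) → a ≡ b
  Bool-ext {true}  {true}  f g = refl
  Bool-ext {true}  {false} f g = sym (f refl)
  Bool-ext {false} {true}  f g = g refl
  Bool-ext {false} {false} f g = refl

  T⇒≡true : ∀ {a} → T a → a ≡ true
  T⇒≡true = Equivalence.to T-≡

  ≡true⇒T : ∀ {a} → a ≡ true → T a
  ≡true⇒T = Equivalence.from T-≡

  <ᵇ-true : ∀ {a b} → a < b → (a <ᵇ b) ≡ true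
  <ᵇ-true a<b = T⇒≡true (NP.<⇒<ᵇ a<b)

  <ᵇ-true⇒ : ∀ a b → (a <ᵇ b) ≡ true → a < b
  <ᵇ-true⇒ a b e = NP.<ᵇ⇒< a b (≡true⇒T e)

  <ᵇ-false : ∀ {a b} → ¬ (a < b) → (a <ᵇ b) ≡ false
  <ᵇ-false {a} {b} a≮b = ≢true⇒≡false (λ e → a≮b (<ᵇ-true⇒ a b e))

  <ᵇ-false⇒ : ∀ {a b} → (a <ᵇ b) ≡ false → ¬ (a < b)
  <ᵇ-false⇒ e a<b = ≡false⇒≢true e (<ᵇ-true a<b)

  ≤ᵇ-true : ∀ {a b} → a ≤ b → (a ≤ᵇ b) ≡ true
  ≤ᵇ-true a≤b = T⇒≡true (NP.≤⇒≤ᵇ a≤b)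

  ≤ᵇ-true⇒ : ∀ a b → (a ≤ᵇ b) ≡ true → a ≤ b
  ≤ᵇ-true⇒ a b e = NP.≤ᵇ⇒≤ a b (≡true⇒T e)

  ≤ᵇ-false : ∀ {a b} → ¬ (a ≤ b) → (a ≤ᵇ b) ≡ false
  ≤ᵇ-false {a} {b} a≰b = ≢true⇒≡false (λ e → a≰b (≤ᵇ-true⇒ a b e))

  ≡ᵇ-refl : ∀ a → (a ≡ᵇ a) ≡ true
  ≡ᵇ-refl a = T⇒≡true (NP.≡⇒≡ᵇ a a refl)

  ≡ᵇ-false : ∀ {a b} → a ≢ b → (a ≡ᵇ b) ≡ false
  ≡ᵇ-false {a} {b} a≢b = ≢true⇒≡false (λ e → a≢b (NP.≡ᵇ⇒≡ a b (≡true⇒T e)))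

  n≢1+n : ∀ n → n ≢ suc n
  n≢1+n n e = NP.1+n≢n (sym e)

  <ᵇ-self : ∀ p → (p <ᵇ p) ≡ false
  <ᵇ-self p = <ᵇ-false (NP.n≮n p)

  <ᵇ-suc-self : ∀ p → (p <ᵇ suc p) ≡ true
  <ᵇ-suc-self p = <ᵇ-true (NP.n<1+n p)

  <ᵇ-suc-≢ : ∀ k p → k ≢ p → (k <ᵇ suc p) ≡ (k <ᵇ p)
  <ᵇ-suc-≢ zero    zero    k≢p = ⊥-elim (k≢p refl)
  <ᵇ-suc-≢ zero    (suc p) k≢p = refl
  <ᵇ-suc-≢ (suc k) zero    k≢p = refl
  <ᵇ-suc-≢ (suc k) (suc p) k≢p = <ᵇ-suc-≢ k p (λ e → k≢p (cong suc e))

module ℚAlgebra where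

  open import Defs
  open import Data.Nat as ℕ using (ℕ; zero; suc)
  open import Data.Integer as ℤ using (ℤ; +_; -[1+_])
  import Data.Integer.Properties as ℤP
  open import Data.Integer.Tactic.RingSolver as ℤSolver using ()
  open import Data.Rational using (0ℚ; 1ℚ; _*_; ≢-nonZero)
  open import Data.Rational.Properties
  open import Relation.Binary.PropositionalEquality
  open import Relation.Nullary using (yes; no)
  open import Data.Empty using (⊥-elim)
  open import Data.Maybe using (Maybe; just; nothing)
  open import Tactic.RingSolver using (solve-∀)
  open import Tactic.RingSolver.Core.AlmostCommutativeRing using (AlmostCommutativeRing; fromCommutativeRing)

  ℚring : AlmostCommutativeRing _ _
  ℚring = fromCommutativeRing +-*-commutativeRing zero?
    where
    zero? : ∀ x → Maybe (0ℚ ≡ x)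
    zero? x with 0ℚ ≟ x
    ... | yes e = just e
    ... | no _ = nothing

  *-interchange : ∀ a b c d → (a * b) * (c * d) ≡ (a * c) * (b * d)
  *-interchange = solve-∀ ℚring

  inv-inverseˡ : ∀ q → q ≢ 0ℚ → inv q * q ≡ 1ℚ
  inv-inverseˡ q q≢0 with q ≟ 0ℚ
  ... | yes q≡0 = ⊥-elim (q≢0 q≡0)
  ... | no q≢0′ = *-inverseˡ q {{≢-nonZero q≢0′}}

  inv-inverseʳ : ∀ q → q ≢ 0ℚ → q * inv q ≡ 1ℚ
  inv-inverseʳ q q≢0 = trans (*-comm q (inv q)) (inv-inverseˡ q q≢0)

  *-≢0 : ∀ p q → p ≢ 0ℚ → q ≢ 0ℚ → p * q ≢ 0ℚ
  *-≢0 p q p≢0 q≢0 pq≡0 = p≢0 (begin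
    p                   ≡⟨ sym (*-identityʳ p) ⟩
    p * 1ℚ              ≡⟨ cong (p *_) (sym (inv-inverseʳ q q≢0)) ⟩
    p * (q * inv q)     ≡⟨ sym (*-assoc p q (inv q)) ⟩
    (p * q) * inv q     ≡⟨ cong (_* inv q) pq≡0 ⟩
    0ℚ * inv q          ≡⟨ *-zeroˡ (inv q) ⟩
    0ℚ                  ∎)
    where open ≡-Reasoning

  inv-unique : ∀ q r → q * r ≡ 1ℚ → inv q ≡ r
  inv-unique q r qr≡1 = begin
    inv q               ≡⟨ sym (*-identityʳ (inv q)) ⟩
    inv q * 1ℚ          ≡⟨ cong (inv q *_) (sym qr≡1) ⟩
    inv q * (q * r)     ≡⟨ sym (*-assoc (inv q) q r) ⟩
    (inv q * q) * r     ≡⟨ cong (_* r) (inv-inverseˡ q q≢0) ⟩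
    1ℚ * r              ≡⟨ *-identityˡ r ⟩
    r                   ∎
    where
    open ≡-Reasoning
    q≢0 : q ≢ 0ℚ
    q≢0 q≡0 = 1≢0 (trans (sym qr≡1) (trans (cong (_* r) q≡0) (*-zeroˡ r)))

  inv-distrib-* : ∀ p q → p ≢ 0ℚ → q ≢ 0ℚ → inv (p * q) ≡ inv p * inv q
  inv-distrib-* p q p≢0 q≢0 = inv-unique (p * q) (inv p * inv q) (begin
    (p * q) * (inv p * inv q)   ≡⟨ *-interchange p q (inv p) (inv q) ⟩
    (p * inv p) * (q * inv q)   ≡⟨ cong₂ _*_ (inv-inverseʳ p p≢0) (inv-inverseʳ q q≢0) ⟩
    1ℚ                          ∎)
    where open ≡-Reasoning

  powℕ-distribˡ-+ : ∀ q a b → powℕ q (a ℕ.+ b) ≡ powℕ q a * powℕ q b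
  powℕ-distribˡ-+ q zero    b = sym (*-identityˡ _)
  powℕ-distribˡ-+ q (suc a) b = trans (cong (q *_) (powℕ-distribˡ-+ q a b)) (sym (*-assoc q _ _))

  powℕ-≢0 : ∀ q a → q ≢ 0ℚ → powℕ q a ≢ 0ℚ
  powℕ-≢0 q zero    q≢0 = 1≢0
  powℕ-≢0 q (suc a) q≢0 = *-≢0 q _ q≢0 (powℕ-≢0 q a q≢0)

  inv-powℕ : ∀ q a → q ≢ 0ℚ → inv (powℕ q a) ≡ powℕ (inv q) a
  inv-powℕ q zero    q≢0 = refl
  inv-powℕ q (suc a) q≢0 =
    trans (inv-distrib-* q _ q≢0 (powℕ-≢0 q a q≢0)) (cong (inv q *_) (inv-powℕ q a q≢0))

  zpow-difference : ∀ q a b → q ≢ 0ℚ → zpow q (+ a ℤ.- + b) ≡ powℕ q a * powℕ (inv q) b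
  zpow-difference q a zero q≢0 =
    trans (cong (zpow q) (ℤP.+-identityʳ (+ a))) (sym (*-identityʳ _))
  zpow-difference q zero (suc b) q≢0 = trans (inv-powℕ q (suc b) q≢0) (sym (*-identityˡ _))
  zpow-difference q (suc a) (suc b) q≢0 = begin
    zpow q (+ suc a ℤ.- + suc b)                ≡⟨ cong (zpow q) (ℤP.[1+m]⊖[1+n]≡m⊖n a b) ⟩
    zpow q (a ℤ.⊖ b)                            ≡⟨ cong (zpow q) (sym (ℤP.m-n≡m⊖n a b)) ⟩
    zpow q (+ a ℤ.- + b)                        ≡⟨ zpow-difference q a b q≢0 ⟩
    powℕ q a * powℕ (inv q) b                   ≡⟨ sym (*-identityˡ _) ⟩
    1ℚ * (powℕ q a * powℕ (inv q) b)            ≡⟨ cong (_* (powℕ q a * powℕ (inv q) b)) (sym (inv-inverseʳ q q≢0)) ⟩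
    (q * inv q) * (powℕ q a * powℕ (inv q) b)   ≡⟨ *-interchange q (inv q) (powℕ q a) (powℕ (inv q) b) ⟩
    (q * powℕ q a) * (inv q * powℕ (inv q) b)   ∎
    where open ≡-Reasoning

  posPart negPart : ℤ → ℕ
  posPart (+ a)    = a
  posPart -[1+ b ] = 0
  negPart (+ a)    = 0
  negPart -[1+ b ] = suc b

  posPart-negPart : ∀ z → z ≡ + posPart z ℤ.- + negPart z
  posPart-negPart (+ a)    = sym (ℤP.+-identityʳ (+ a))
  posPart-negPart -[1+ b ] = refl

  zpow-parts : ∀ q z → q ≢ 0ℚ → zpow q z ≡ powℕ q (posPart z) * powℕ (inv q) (negPart z)
  zpow-parts q z q≢0 = trans (cong (zpow q) (posPart-negPart z)) (zpow-difference q (posPart z) (negPart z) q≢0)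

  zpow-distribˡ-+ : ∀ q z w → q ≢ 0ℚ → zpow q (z ℤ.+ w) ≡ zpow q z * zpow q w
  zpow-distribˡ-+ q z w q≢0 = begin
    zpow q (z ℤ.+ w)
      ≡⟨ cong (zpow q) (cong₂ ℤ._+_ (posPart-negPart z) (posPart-negPart w)) ⟩
    zpow q ((+ z⁺ ℤ.- + z⁻) ℤ.+ (+ w⁺ ℤ.- + w⁻))
      ≡⟨ cong (zpow q) (regroup (+ z⁺) (+ z⁻) (+ w⁺) (+ w⁻)) ⟩
    zpow q (+ (z⁺ ℕ.+ w⁺) ℤ.- + (z⁻ ℕ.+ w⁻))
      ≡⟨ zpow-difference q (z⁺ ℕ.+ w⁺) (z⁻ ℕ.+ w⁻) q≢0 ⟩
    powℕ q (z⁺ ℕ.+ w⁺) * powℕ (inv q) (z⁻ ℕ.+ w⁻)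
      ≡⟨ cong₂ _*_ (powℕ-distribˡ-+ q z⁺ w⁺) (powℕ-distribˡ-+ (inv q) z⁻ w⁻) ⟩
    (powℕ q z⁺ * powℕ q w⁺) * (powℕ (inv q) z⁻ * powℕ (inv q) w⁻)
      ≡⟨ *-interchange (powℕ q z⁺) (powℕ q w⁺) (powℕ (inv q) z⁻) (powℕ (inv q) w⁻) ⟩
    (powℕ q z⁺ * powℕ (inv q) z⁻) * (powℕ q w⁺ * powℕ (inv q) w⁻)
      ≡⟨ sym (cong₂ _*_ (zpow-parts q z q≢0) (zpow-parts q w q≢0)) ⟩
    zpow q z * zpow q w ∎
    where
    open ≡-Reasoning
    z⁺ = posPart z
    z⁻ = negPart z
    w⁺ = posPart w
    w⁻ = negPart w
    regroup : ∀ (a b c d : ℤ) → (a ℤ.- b) ℤ.+ (c ℤ.- d) ≡ (a ℤ.+ c) ℤ.- (b ℤ.+ d)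
    regroup = ℤSolver.solve-∀

module StatisticWeights where

  open Booleans
  open ℚAlgebra
  open import Defs
  open import Data.Nat as ℕ using (ℕ; zero; suc; _<ᵇ_; _≡ᵇ_; _<_; _≤_)
  import Data.Nat.Properties as NP
  open import Data.Fin as Fin using (Fin; zero; suc; toℕ; inject₁; fromℕ)
  import Data.Fin.Properties as FP
  open import Data.Integer as ℤ using (ℤ; +_)
  open import Data.Integer.Tactic.RingSolver as ℤSolver using ()
  open import Data.Rational using (ℚ; 0ℚ; 1ℚ; _*_)
  open import Data.Rational.Properties using (*-identityʳ; *-identityˡ; *-comm; *-assoc)
  open import Data.List using (foldr; tabulate)
  open import Data.List.Properties using (map-tabulate; tabulate-cong)
  open import Data.Bool using (true; false; if_then_else_)
  open import Data.Sum using (_⊎_; inj₁; inj₂)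
  open import Relation.Binary.PropositionalEquality
  open import Relation.Nullary using (yes; no)
  open import Data.Empty using (⊥-elim)
  open import Function using (_∘_)
  open import Tactic.RingSolver using (solve-∀)

  prodFin : ∀ {k} → (Fin k → ℚ) → ℚ
  prodFin f = foldr _*_ 1ℚ (tabulate f)

  prodFin-cong : ∀ {k} {f g : Fin k → ℚ} → (∀ i → f i ≡ g i) → prodFin f ≡ prodFin g
  prodFin-cong h = cong (foldr _*_ 1ℚ) (tabulate-cong h)

  prodFin-single : ∀ {k} (f g : Fin k → ℚ) (K : Fin k) x →
    (∀ i → i ≢ K → f i ≡ g i) → f K ≡ x * g K → prodFin f ≡ x * prodFin g
  prodFin-single {suc k} f g zero x f≡g fK =
    trans (cong₂ _*_ fK (prodFin-cong (λ i → f≡g (suc i) (λ ())))) (*-assoc x (g zero) _)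
  prodFin-single {suc k} f g (suc K) x f≡g fK =
    trans (cong₂ _*_ (f≡g zero (λ ())) (prodFin-single (f ∘ suc) (g ∘ suc) K x f≡g′ fK)) (swap (g zero) x _)
    where
    f≡g′ : ∀ i → i ≢ K → f (suc i) ≡ g (suc i)
    f≡g′ i i≢K = f≡g (suc i) (i≢K ∘ FP.suc-injective)
    swap : ∀ a b c → a * (b * c) ≡ b * (a * c)
    swap = solve-∀ ℚring

  prodFin-pair : ∀ {k} (f g : Fin k → ℚ) (K₁ K₂ : Fin k) x y → K₁ ≢ K₂ →
    (∀ i → i ≢ K₁ → i ≢ K₂ → f i ≡ g i) → f K₁ ≡ x * g K₁ → f K₂ ≡ y * g K₂ →
    prodFin f ≡ (x * y) * prodFin g
  prodFin-pair {k} f g K₁ K₂ x y K₁≢K₂ f≡g fK₁ fK₂ = begin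
    prodFin f              ≡⟨ prodFin-single f h K₁ x f≡h (trans fK₁ (cong (x *_) (sym hK₁))) ⟩
    x * prodFin h          ≡⟨ cong (x *_) (prodFin-single h g K₂ y h≡g (trans hK₂ fK₂)) ⟩
    x * (y * prodFin g)    ≡⟨ sym (*-assoc x y _) ⟩
    (x * y) * prodFin g    ∎
    where
    open ≡-Reasoning
    h : Fin k → ℚ
    h i with i FP.≟ K₁
    ... | yes _ = g i
    ... | no  _ = f i
    hK₁ : h K₁ ≡ g K₁
    hK₁ with K₁ FP.≟ K₁
    ... | yes _ = refl
    ... | no K₁≢K₁ = ⊥-elim (K₁≢K₁ refl)
    hK₂ : h K₂ ≡ f K₂
    hK₂ with K₂ FP.≟ K₁
    ... | yes K₂≡K₁ = ⊥-elim (K₁≢K₂ (sym K₂≡K₁))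
    ... | no  _     = refl
    f≡h : ∀ i → i ≢ K₁ → f i ≡ h i
    f≡h i i≢K₁ with i FP.≟ K₁
    ... | yes i≡K₁ = ⊥-elim (i≢K₁ i≡K₁)
    ... | no  _    = refl
    h≡g : ∀ i → i ≢ K₂ → h i ≡ g i
    h≡g i i≢K₂ with i FP.≟ K₁
    ... | yes _    = refl
    ... | no i≢K₁  = f≡g i i≢K₁ i≢K₂

  -- `expo` as a function of a statistics vector: A k stands for a_k, and A 0 = 0.
  statExponent : (m n : ℕ) → (ℕ → ℕ) → Fin (suc m) → ℤ
  statExponent m n A i with toℕ i <ᵇ m
  ... | true  = (+ A (suc (toℕ i))) ℤ.- (+ A (toℕ i))
  ... | false = (+ n) ℤ.- (+ A m)

  statWeight : (m n : ℕ) → (Fin (suc m) → ℚ) → (ℕ → ℕ) → ℚ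
  statWeight m n v A = prodFin (λ i → zpow (v i) (statExponent m n A i))

  expo≡statExponent : ∀ m n R i → expo m n R i ≡ statExponent m n (aExt R) i
  expo≡statExponent m n R i with toℕ i <ᵇ m
  ... | true  = refl
  ... | false = refl

  weight≡statWeight : ∀ m n v R → weight m n v R ≡ statWeight m n v (aExt R)
  weight≡statWeight m n v R = cong (foldr _*_ 1ℚ)
    (trans (map-tabulate (λ i → i) (λ i → zpow (v i) (expo m n R i)))
           (tabulate-cong (λ i → cong (zpow (v i)) (expo≡statExponent m n R i))))

  statExponent-inner : ∀ m n A i → (toℕ i <ᵇ m) ≡ true →
    statExponent m n A i ≡ (+ A (suc (toℕ i))) ℤ.- (+ A (toℕ i))
  statExponent-inner m n A i e rewrite e = refl

  statExponent-last : ∀ m n A i → (toℕ i <ᵇ m) ≡ false → statExponent m n A i ≡ (+ n) ℤ.- (+ A m)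
  statExponent-last m n A i e rewrite e = refl

  inner-or-last : ∀ {m} (i : Fin (suc m)) → ((toℕ i <ᵇ m) ≡ true) ⊎ (i ≡ fromℕ m)
  inner-or-last {m} i with toℕ i <ᵇ m in eq
  ... | true  = inj₁ refl
  ... | false = inj₂ (FP.toℕ-injective (trans i≡m (sym (FP.toℕ-fromℕ m))))
    where
    i≡m : toℕ i ≡ m
    i≡m = NP.≤-antisym (ℕ.s≤s⁻¹ (FP.toℕ<n i)) (NP.≮⇒≥ (<ᵇ-false⇒ eq))

  last-<ᵇ-false : ∀ m → (toℕ (fromℕ m) <ᵇ m) ≡ false
  last-<ᵇ-false m rewrite FP.toℕ-fromℕ m = <ᵇ-false (NP.n≮n m)

  statWeight-cong≤ : ∀ m n v {A B : ℕ → ℕ} → (∀ k → k ≤ m → A k ≡ B k) →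
    statWeight m n v A ≡ statWeight m n v B
  statWeight-cong≤ m n v {A} {B} A≡B = prodFin-cong (λ i → cong (zpow (v i)) (exponent≡ i))
    where
    exponent≡ : ∀ i → statExponent m n A i ≡ statExponent m n B i
    exponent≡ i with toℕ i <ᵇ m in eq
    ... | true  = cong₂ (λ a b → (+ a) ℤ.- (+ b)) (A≡B _ i<m) (A≡B _ (NP.<⇒≤ i<m))
      where i<m = <ᵇ-true⇒ (toℕ i) m eq
    ... | false = cong (λ a → (+ n) ℤ.- (+ a)) (A≡B m NP.≤-refl)

  statWeight-cong : ∀ m n v {A B} → (∀ k → A k ≡ B k) → statWeight m n v A ≡ statWeight m n v B
  statWeight-cong m n v A≡B = statWeight-cong≤ m n v (λ k _ → A≡B k)

  update : (ℕ → ℕ) → ℕ → ℕ → (ℕ → ℕ)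
  update A k c x = if x ≡ᵇ k then c else A x

  update-here : ∀ A k c → update A k c k ≡ c
  update-here A k c rewrite ≡ᵇ-refl k = refl

  update-at : ∀ A k c x → k ≡ x → update A k c x ≡ c
  update-at A k c x refl = update-here A k c

  update-there : ∀ A k c x → x ≢ k → update A k c x ≡ A x
  update-there A k c x x≢k rewrite ≡ᵇ-false x≢k = refl

  zpow-sucˡ : ∀ q x y → q ≢ 0ℚ → zpow q ((+ suc x) ℤ.- y) ≡ q * zpow q ((+ x) ℤ.- y)
  zpow-sucˡ q x y q≢0 = begin
    zpow q ((+ suc x) ℤ.- y)              ≡⟨ cong (zpow q) (shift (+ x) y) ⟩
    zpow q (((+ x) ℤ.- y) ℤ.+ + 1)        ≡⟨ zpow-distribˡ-+ q ((+ x) ℤ.- y) (+ 1) q≢0 ⟩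
    zpow q ((+ x) ℤ.- y) * (q * 1ℚ)       ≡⟨ cong (zpow q ((+ x) ℤ.- y) *_) (*-identityʳ q) ⟩
    zpow q ((+ x) ℤ.- y) * q              ≡⟨ *-comm _ q ⟩
    q * zpow q ((+ x) ℤ.- y)              ∎
    where
    open ≡-Reasoning
    shift : ∀ (x y : ℤ) → (+ 1 ℤ.+ x) ℤ.- y ≡ (x ℤ.- y) ℤ.+ + 1
    shift = ℤSolver.solve-∀

  zpow-sucʳ : ∀ q x y → q ≢ 0ℚ → zpow q (x ℤ.- (+ suc y)) ≡ inv q * zpow q (x ℤ.- (+ y))
  zpow-sucʳ q x y q≢0 = begin
    zpow q (x ℤ.- (+ suc y))                  ≡⟨ cong (zpow q) (shift x (+ y)) ⟩
    zpow q ((x ℤ.- + y) ℤ.+ (ℤ.- + 1))        ≡⟨ zpow-distribˡ-+ q (x ℤ.- + y) (ℤ.- + 1) q≢0 ⟩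
    zpow q (x ℤ.- + y) * inv (q * 1ℚ)         ≡⟨ cong (λ r → zpow q (x ℤ.- + y) * inv r) (*-identityʳ q) ⟩
    zpow q (x ℤ.- + y) * inv q                ≡⟨ *-comm _ (inv q) ⟩
    inv q * zpow q (x ℤ.- (+ y))              ∎
    where
    open ≡-Reasoning
    shift : ∀ (x y : ℤ) → x ℤ.- (+ 1 ℤ.+ y) ≡ (x ℤ.- y) ℤ.+ (ℤ.- + 1)
    shift = ℤSolver.solve-∀

  statWeight-size-suc : ∀ m n v A → v (fromℕ m) ≢ 0ℚ →
    statWeight m (suc n) v A ≡ v (fromℕ m) * statWeight m n v A
  statWeight-size-suc m n v A v≢0 = prodFin-single _ _ (fromℕ m) (v (fromℕ m)) others last
    where
    others : ∀ i → i ≢ fromℕ m → zpow (v i) (statExponent m (suc n) A i) ≡ zpow (v i) (statExponent m n A i)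
    others i i≢last with inner-or-last i
    ... | inj₂ i≡last = ⊥-elim (i≢last i≡last)
    ... | inj₁ e rewrite statExponent-inner m (suc n) A i e | statExponent-inner m n A i e = refl
    last : zpow (v (fromℕ m)) (statExponent m (suc n) A (fromℕ m))
         ≡ v (fromℕ m) * zpow (v (fromℕ m)) (statExponent m n A (fromℕ m))
    last rewrite statExponent-last m (suc n) A (fromℕ m) (last-<ᵇ-false m)
               | statExponent-last m n A (fromℕ m) (last-<ᵇ-false m) = zpow-sucˡ (v (fromℕ m)) n (+ A m) v≢0

  inject₁≢suc : ∀ {m} (J : Fin m) → inject₁ J ≢ suc J
  inject₁≢suc J e = NP.<-irrefl (trans (sym (FP.toℕ-inject₁ J)) (cong toℕ e)) (NP.n<1+n (toℕ J))

  inject₁-<ᵇ : ∀ {m} (J : Fin m) → (toℕ (inject₁ J) <ᵇ m) ≡ true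
  inject₁-<ᵇ J = <ᵇ-true (subst (_< _) (sym (FP.toℕ-inject₁ J)) (FP.toℕ<n J))

  suc-<ᵇ-false⇒last : ∀ {m} (J : Fin m) → (suc (toℕ J) <ᵇ m) ≡ false → suc (toℕ J) ≡ m
  suc-<ᵇ-false⇒last {m} J eq = NP.≤-antisym (FP.toℕ<n J) (NP.≮⇒≥ (<ᵇ-false⇒ eq))

  statExponent-inject₁ : ∀ m n B (J : Fin m) →
    statExponent m n B (inject₁ J) ≡ (+ B (suc (toℕ J))) ℤ.- (+ B (toℕ J))
  statExponent-inject₁ m n B J rewrite statExponent-inner m n B (inject₁ J) (inject₁-<ᵇ J) | FP.toℕ-inject₁ J = refl

  statExponent-update-other : ∀ m n A (J : Fin m) c i → i ≢ inject₁ J → i ≢ suc J →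
    statExponent m n (update A (suc (toℕ J)) c) i ≡ statExponent m n A i
  statExponent-update-other m n A J c i i≢J i≢J+1 with inner-or-last i
  ... | inj₁ e
    rewrite statExponent-inner m n (update A (suc (toℕ J)) c) i e | statExponent-inner m n A i e
          | update-there A (suc (toℕ J)) c (suc (toℕ i))
              (λ e → i≢J (FP.toℕ-injective (trans (NP.suc-injective e) (sym (FP.toℕ-inject₁ J)))))
          | update-there A (suc (toℕ J)) c (toℕ i) (i≢J+1 ∘ FP.toℕ-injective) = refl
  ... | inj₂ refl
    rewrite statExponent-last m n (update A (suc (toℕ J)) c) (fromℕ m) (last-<ᵇ-false m)
          | statExponent-last m n A (fromℕ m) (last-<ᵇ-false m)
          | update-there A (suc (toℕ J)) c m (λ e → i≢J+1 (FP.toℕ-injective (trans (FP.toℕ-fromℕ m) e))) = refl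

  statWeight-update-suc : ∀ m n v A (J : Fin m) c → v (inject₁ J) ≢ 0ℚ → v (suc J) ≢ 0ℚ →
    statWeight m n v (update A (suc (toℕ J)) (suc c))
      ≡ (v (inject₁ J) * inv (v (suc J))) * statWeight m n v (update A (suc (toℕ J)) c)
  statWeight-update-suc m n v A J c vJ≢0 vJ+1≢0 =
    prodFin-pair _ _ (inject₁ J) (suc J) (v (inject₁ J)) (inv (v (suc J))) (inject₁≢suc J) others atJ atJ+1
    where
    k = suc (toℕ J)
    A₁ = update A k (suc c)
    A₀ = update A k c
    others : ∀ i → i ≢ inject₁ J → i ≢ suc J → zpow (v i) (statExponent m n A₁ i) ≡ zpow (v i) (statExponent m n A₀ i)
    others i a b = cong (zpow (v i))
      (trans (statExponent-update-other m n A J (suc c) i a b) (sym (statExponent-update-other m n A J c i a b)))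
    atJ : zpow (v (inject₁ J)) (statExponent m n A₁ (inject₁ J))
        ≡ v (inject₁ J) * zpow (v (inject₁ J)) (statExponent m n A₀ (inject₁ J))
    atJ rewrite statExponent-inject₁ m n A₁ J | statExponent-inject₁ m n A₀ J | update-here A k (suc c) | update-here A k c
              | update-there A k (suc c) (toℕ J) (n≢1+n (toℕ J)) | update-there A k c (toℕ J) (n≢1+n (toℕ J)) =
      zpow-sucˡ (v (inject₁ J)) c (+ A (toℕ J)) vJ≢0
    atJ+1 : zpow (v (suc J)) (statExponent m n A₁ (suc J)) ≡ inv (v (suc J)) * zpow (v (suc J)) (statExponent m n A₀ (suc J))
    atJ+1 with suc (toℕ J) <ᵇ m in eq
    ... | true rewrite update-here A k (suc c) | update-here A k c
                     | update-there A k (suc c) (suc k) (n≢1+n k ∘ sym) | update-there A k c (suc k) (n≢1+n k ∘ sym) =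
      zpow-sucʳ (v (suc J)) (+ A (suc k)) c vJ+1≢0
    ... | false rewrite update-at A k (suc c) m (suc-<ᵇ-false⇒last J eq) | update-at A k c m (suc-<ᵇ-false⇒last J eq) =
      zpow-sucʳ (v (suc J)) (+ n) c vJ+1≢0

  substNext-here : ∀ {m} (v : Fin (suc m) → ℚ) (J : Fin m) → substNext v J (inject₁ J) ≡ v (suc J)
  substNext-here v J with inject₁ J FP.≟ inject₁ J
  ... | yes _ = refl
  ... | no J≢J = ⊥-elim (J≢J refl)

  substNext-there : ∀ {m} (v : Fin (suc m) → ℚ) (J : Fin m) i → i ≢ inject₁ J → substNext v J i ≡ v i
  substNext-there v J i i≢J with i FP.≟ inject₁ J
  ... | yes i≡J = ⊥-elim (i≢J i≡J)
  ... | no  _   = refl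

  statWeight-substNext : ∀ m n v A (J : Fin m) → v (suc J) ≢ 0ℚ →
    statWeight m n (substNext v J) A ≡ statWeight m n v (update A (suc (toℕ J)) (A (toℕ J)))
  statWeight-substNext m n v A J vJ+1≢0 = begin
    statWeight m n (substNext v J) A   ≡⟨ prodFin-pair _ _ (inject₁ J) (suc J) x y (inject₁≢suc J) others atJ atJ+1 ⟩
    (x * y) * statWeight m n v A′      ≡⟨ cong (_* statWeight m n v A′) xy≡1 ⟩
    1ℚ * statWeight m n v A′           ≡⟨ *-identityˡ _ ⟩
    statWeight m n v A′                ∎
    where
    open ≡-Reasoning
    k = suc (toℕ J)
    A′ = update A k (A (toℕ J))
    w = v (suc J)
    d = (+ A k) ℤ.- (+ A (toℕ J))
    x = zpow w d
    y = zpow w (ℤ.- d)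
    cancel : ∀ (d : ℤ) → d ℤ.+ (ℤ.- d) ≡ + 0
    cancel = ℤSolver.solve-∀
    self : ∀ (a : ℤ) → a ℤ.- a ≡ + 0
    self = ℤSolver.solve-∀
    split : ∀ (X a b : ℤ) → X ℤ.- a ≡ (ℤ.- (a ℤ.- b)) ℤ.+ (X ℤ.- b)
    split = ℤSolver.solve-∀
    xy≡1 : x * y ≡ 1ℚ
    xy≡1 = trans (sym (zpow-distribˡ-+ w d (ℤ.- d) vJ+1≢0)) (cong (zpow w) (cancel d))
    others : ∀ i → i ≢ inject₁ J → i ≢ suc J →
      zpow (substNext v J i) (statExponent m n A i) ≡ zpow (v i) (statExponent m n A′ i)
    others i a b = cong₂ zpow (substNext-there v J i a) (sym (statExponent-update-other m n A J (A (toℕ J)) i a b))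
    atJ : zpow (substNext v J (inject₁ J)) (statExponent m n A (inject₁ J))
        ≡ x * zpow (v (inject₁ J)) (statExponent m n A′ (inject₁ J))
    atJ rewrite substNext-here v J | statExponent-inject₁ m n A J | statExponent-inject₁ m n A′ J
              | update-here A k (A (toℕ J)) | update-there A k (A (toℕ J)) (toℕ J) (n≢1+n (toℕ J))
              | self (+ A (toℕ J)) = sym (*-identityʳ _)
    atJ+1 : zpow (substNext v J (suc J)) (statExponent m n A (suc J)) ≡ y * zpow (v (suc J)) (statExponent m n A′ (suc J))
    atJ+1 with suc (toℕ J) <ᵇ m in eq
    ... | true rewrite substNext-there v J (suc J) (inject₁≢suc J ∘ sym)
                     | update-here A k (A (toℕ J)) | update-there A k (A (toℕ J)) (suc k) (n≢1+n k ∘ sym) =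
      trans (cong (zpow w) (split (+ A (suc k)) (+ A k) (+ A (toℕ J)))) (zpow-distribˡ-+ w (ℤ.- d) _ vJ+1≢0)
    ... | false rewrite substNext-there v J (suc J) (inject₁≢suc J ∘ sym)
                      | update-at A k (A (toℕ J)) m (suc-<ᵇ-false⇒last J eq) =
      trans (cong (λ z → zpow w ((+ n) ℤ.- (+ A z))) (sym (suc-<ᵇ-false⇒last J eq)))
        (trans (cong (zpow w) (split (+ n) (+ A k) (+ A (toℕ J)))) (zpow-distribˡ-+ w (ℤ.- d) _ vJ+1≢0))

module ListSums where

  open ℚAlgebra
  open import Defs
  open import Data.Nat as ℕ using (zero; suc)
  open import Data.Fin as Fin using (Fin; zero; suc; inject₁; fromℕ)
  import Data.Fin.Properties as FP
  open import Data.Rational using (ℚ; 0ℚ; _+_; _*_; _-_)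
  open import Data.Rational.Properties using (+-identityʳ; +-identityˡ; +-assoc; *-zeroʳ; *-distribˡ-+)
  open import Data.List using (List; []; _∷_; map; concatMap; filterᵇ; _++_; tabulate; allFin)
  open import Data.Bool using (Bool; true; false; if_then_else_)
  open import Relation.Binary.PropositionalEquality
  open import Data.Empty using (⊥-elim)
  open import Function using (_∘_)
  open import Tactic.RingSolver using (solve-∀)

  Σl : ∀ {A : Set} → List A → (A → ℚ) → ℚ
  Σl xs f = sumℚ (map f xs)

  ite : Bool → ℚ → ℚ
  ite b q = if b then q else 0ℚ

  Σ-cong : ∀ {A : Set} (xs : List A) {f g : A → ℚ} → (∀ x → f x ≡ g x) → Σl xs f ≡ Σl xs g
  Σ-cong []       f≡g = refl
  Σ-cong (x ∷ xs) f≡g = cong₂ _+_ (f≡g x) (Σ-cong xs f≡g)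

  Σ-0 : ∀ {A : Set} (xs : List A) → Σl xs (λ _ → 0ℚ) ≡ 0ℚ
  Σ-0 []       = refl
  Σ-0 (x ∷ xs) = trans (+-identityˡ _) (Σ-0 xs)

  Σ-+ : ∀ {A : Set} (xs : List A) (f g : A → ℚ) → Σl xs (λ x → f x + g x) ≡ Σl xs f + Σl xs g
  Σ-+ []       f g = refl
  Σ-+ (x ∷ xs) f g = trans (cong (f x + g x +_) (Σ-+ xs f g)) (medial (f x) (g x) (Σl xs f) (Σl xs g))
    where
    medial : ∀ a b c d → (a + b) + (c + d) ≡ (a + c) + (b + d)
    medial = solve-∀ ℚring

  Σ-- : ∀ {A : Set} (xs : List A) (f g : A → ℚ) → Σl xs (λ x → f x - g x) ≡ Σl xs f - Σl xs g
  Σ-- []       f g = refl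
  Σ-- (x ∷ xs) f g = trans (cong (f x - g x +_) (Σ-- xs f g)) (medial (f x) (g x) (Σl xs f) (Σl xs g))
    where
    medial : ∀ a b c d → (a - b) + (c - d) ≡ (a + c) - (b + d)
    medial = solve-∀ ℚring

  Σ-* : ∀ {A : Set} (xs : List A) c (f : A → ℚ) → Σl xs (λ x → c * f x) ≡ c * Σl xs f
  Σ-* []       c f = sym (*-zeroʳ c)
  Σ-* (x ∷ xs) c f = trans (cong (c * f x +_) (Σ-* xs c f)) (sym (*-distribˡ-+ c (f x) (Σl xs f)))

  Σ-++ : ∀ {A : Set} (xs ys : List A) f → Σl (xs ++ ys) f ≡ Σl xs f + Σl ys f
  Σ-++ []       ys f = sym (+-identityˡ _)
  Σ-++ (x ∷ xs) ys f = trans (cong (f x +_) (Σ-++ xs ys f)) (sym (+-assoc (f x) (Σl xs f) (Σl ys f)))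

  Σ-map : ∀ {A B : Set} (xs : List A) (g : A → B) f → Σl (map g xs) f ≡ Σl xs (f ∘ g)
  Σ-map []       g f = refl
  Σ-map (x ∷ xs) g f = cong (f (g x) +_) (Σ-map xs g f)

  Σ-concatMap : ∀ {A B : Set} (xs : List A) (g : A → List B) f →
    Σl (concatMap g xs) f ≡ Σl xs (λ x → Σl (g x) f)
  Σ-concatMap []       g f = refl
  Σ-concatMap (x ∷ xs) g f =
    trans (Σ-++ (g x) (concatMap g xs) f) (cong (Σl (g x) f +_) (Σ-concatMap xs g f))

  Σ-swap : ∀ {A B : Set} (xs : List A) (ys : List B) (f : A → B → ℚ) →
    Σl xs (λ x → Σl ys (f x)) ≡ Σl ys (λ y → Σl xs (λ x → f x y))
  Σ-swap []       ys f = sym (Σ-0 ys)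
  Σ-swap (x ∷ xs) ys f =
    trans (cong (Σl ys (f x) +_) (Σ-swap xs ys f)) (sym (Σ-+ ys (f x) (λ y → Σl xs (λ x′ → f x′ y))))

  Σ-filter : ∀ {A : Set} (p : A → Bool) (xs : List A) f →
    Σl (filterᵇ p xs) f ≡ Σl xs (λ x → ite (p x) (f x))
  Σ-filter p []       f = refl
  Σ-filter p (x ∷ xs) f with p x
  ... | true  = cong (f x +_) (Σ-filter p xs f)
  ... | false = trans (Σ-filter p xs f) (sym (+-identityˡ _))

  Σ-tabulate : ∀ {X : Set} n (g : Fin n → X) (f : X → ℚ) → Σl (tabulate g) f ≡ Σl (allFin n) (f ∘ g)
  Σ-tabulate zero    g f = refl
  Σ-tabulate (suc n) g f =
    cong (f (g zero) +_) (trans (Σ-tabulate n (g ∘ suc) f) (sym (Σ-tabulate n suc (f ∘ g))))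

  Σ-allFin-suc : ∀ n (f : Fin (suc n) → ℚ) → Σl (allFin (suc n)) f ≡ f zero + Σl (allFin n) (f ∘ suc)
  Σ-allFin-suc n f = cong (f zero +_) (Σ-tabulate n suc f)

  Σ-tabulate-last : ∀ {X : Set} n (g : Fin (suc n) → X) (f : X → ℚ) →
    Σl (tabulate g) f ≡ Σl (tabulate (g ∘ inject₁)) f + f (g (fromℕ n))
  Σ-tabulate-last zero    g f = trans (+-identityʳ (f (g zero))) (sym (+-identityˡ (f (g zero))))
  Σ-tabulate-last (suc n) g f =
    trans (cong (f (g zero) +_) (Σ-tabulate-last n (g ∘ suc) f))
          (sym (+-assoc (f (g zero)) (Σl (tabulate (g ∘ suc ∘ inject₁)) f) (f (g (fromℕ (suc n))))))

  Σ-allFin-last : ∀ n (f : Fin (suc n) → ℚ) → Σl (allFin (suc n)) f ≡ Σl (allFin n) (f ∘ inject₁) + f (fromℕ n)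
  Σ-allFin-last n f = trans (Σ-tabulate-last n (λ i → i) f) (cong (_+ f (fromℕ n)) (Σ-tabulate n inject₁ f))

  Σ-ite-none : ∀ n (P : Fin n → Bool) (y : Fin n → ℚ) → (∀ b → P b ≡ false) →
    Σl (allFin n) (λ b → ite (P b) (y b)) ≡ 0ℚ
  Σ-ite-none n P y none = trans (Σ-cong (allFin n) (λ b → cong (λ z → ite z (y b)) (none b))) (Σ-0 (allFin n))

  Σ-ite-unique : ∀ n (P : Fin n → Bool) (y : Fin n → ℚ) b₀ → P b₀ ≡ true → (∀ b → P b ≡ true → b ≡ b₀) →
    Σl (allFin n) (λ b → ite (P b) (y b)) ≡ y b₀
  Σ-ite-unique (suc n) P y zero P₀ unique = begin
    Σl (allFin (suc n)) (λ b → ite (P b) (y b))         ≡⟨ Σ-allFin-suc n (λ b → ite (P b) (y b)) ⟩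
    ite (P zero) (y zero) + Σl (allFin n) (λ b → ite (P (suc b)) (y (suc b)))
      ≡⟨ cong₂ _+_ (cong (λ z → ite z (y zero)) P₀) (Σ-ite-none n (P ∘ suc) (y ∘ suc) rest) ⟩
    y zero + 0ℚ                                         ≡⟨ +-identityʳ (y zero) ⟩
    y zero                                              ∎
    where
    open ≡-Reasoning
    rest : ∀ b → P (suc b) ≡ false
    rest b with P (suc b) in eq
    ... | true  = ⊥-elim (FP.0≢1+n (sym (unique (suc b) eq)))
    ... | false = refl
  Σ-ite-unique (suc n) P y (suc b₀) P₀ unique = begin
    Σl (allFin (suc n)) (λ b → ite (P b) (y b))         ≡⟨ Σ-allFin-suc n (λ b → ite (P b) (y b)) ⟩
    ite (P zero) (y zero) + Σl (allFin n) (λ b → ite (P (suc b)) (y (suc b)))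
      ≡⟨ cong₂ _+_ (cong (λ z → ite z (y zero)) first)
                   (Σ-ite-unique n (P ∘ suc) (y ∘ suc) b₀ P₀ (λ b e → FP.suc-injective (unique (suc b) e))) ⟩
    0ℚ + y (suc b₀)                                     ≡⟨ +-identityˡ (y (suc b₀)) ⟩
    y (suc b₀)                                          ∎
    where
    open ≡-Reasoning
    first : P zero ≡ false
    first with P zero in eq
    ... | true  = ⊥-elim (FP.0≢1+n (unique zero eq))
    ... | false = refl

module FinPredicates where

  open Booleans
  open import Defs
  open import Data.Nat as ℕ using (ℕ; zero; suc; _≤_)
  import Data.Nat.Properties as NP
  open import Data.Fin as Fin using (Fin; zero; suc; inject₁; fromℕ)
  import Data.Fin.Properties as FP
  open import Data.List using (List; []; _∷_; tabulate; allFin; filterᵇ; length)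
  open import Data.Bool using (Bool; true; false; _∧_; not)
  open import Data.Bool.Properties using (∧-assoc; ∧-identityʳ; ∧-zeroʳ)
  open import Data.Product using (_,_; proj₁; proj₂; ∃-syntax)
  open import Relation.Binary.PropositionalEquality
  open import Relation.Nullary using (yes; no; does)
  open import Data.Empty using (⊥-elim)
  open import Function using (_∘_)

  all-cong : ∀ {X : Set} {p q : X → Bool} (xs : List X) → (∀ x → p x ≡ q x) → all p xs ≡ all q xs
  all-cong []       p≡q = refl
  all-cong (x ∷ xs) p≡q = cong₂ _∧_ (p≡q x) (all-cong xs p≡q)

  all-tabulate-true : ∀ {X : Set} {n} (p : X → Bool) (g : Fin n → X) →
    all p (tabulate g) ≡ true → ∀ i → p (g i) ≡ true
  all-tabulate-true {n = suc n} p g e zero    = proj₁ (∧-elim e)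
  all-tabulate-true {n = suc n} p g e (suc i) = all-tabulate-true p (g ∘ suc) (proj₂ (∧-elim {p (g zero)} e)) i

  all-tabulate-intro : ∀ {X : Set} {n} (p : X → Bool) (g : Fin n → X) →
    (∀ i → p (g i) ≡ true) → all p (tabulate g) ≡ true
  all-tabulate-intro {n = zero}  p g h = refl
  all-tabulate-intro {n = suc n} p g h = ∧-intro (h zero) (all-tabulate-intro p (g ∘ suc) (h ∘ suc))

  all-tabulate-false : ∀ {X : Set} {n} (p : X → Bool) (g : Fin n → X) →
    all p (tabulate g) ≡ false → ∃[ i ] p (g i) ≡ false
  all-tabulate-false {n = suc n} p g e with p (g zero) in eq
  ... | false = zero , eq
  ... | true with all-tabulate-false p (g ∘ suc) e
  ...   | i , h = suc i , h

  all-tabulate : ∀ {X : Set} n (p : X → Bool) (g : Fin n → X) → all p (tabulate g) ≡ all (p ∘ g) (allFin n)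
  all-tabulate zero    p g = refl
  all-tabulate (suc n) p g =
    cong (p (g zero) ∧_) (trans (all-tabulate n p (g ∘ suc)) (sym (all-tabulate n (p ∘ g) suc)))

  all-tabulate-last : ∀ {X : Set} n (p : X → Bool) (g : Fin (suc n) → X) →
    all p (tabulate g) ≡ (all p (tabulate (g ∘ inject₁)) ∧ p (g (fromℕ n)))
  all-tabulate-last zero    p g = ∧-identityʳ (p (g zero))
  all-tabulate-last (suc n) p g =
    trans (cong (p (g zero) ∧_) (all-tabulate-last n p (g ∘ suc))) (sym (∧-assoc (p (g zero)) _ _))

  all-allFin-true : ∀ {n} (p : Fin n → Bool) → all p (allFin n) ≡ true → ∀ i → p i ≡ true
  all-allFin-true p = all-tabulate-true p (λ i → i)

  all-allFin-intro : ∀ {n} (p : Fin n → Bool) → (∀ i → p i ≡ true) → all p (allFin n) ≡ true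
  all-allFin-intro p = all-tabulate-intro p (λ i → i)

  all-allFin-false : ∀ {n} (p : Fin n → Bool) → all p (allFin n) ≡ false → ∃[ i ] p i ≡ false
  all-allFin-false p = all-tabulate-false p (λ i → i)

  all-allFin-last : ∀ n (p : Fin (suc n) → Bool) →
    all p (allFin (suc n)) ≡ (all (p ∘ inject₁) (allFin n) ∧ p (fromℕ n))
  all-allFin-last n p = trans (all-tabulate-last n p (λ i → i)) (cong (_∧ p (fromℕ n)) (all-tabulate n p inject₁))

  boolToℕ : Bool → ℕ
  boolToℕ true  = 1
  boolToℕ false = 0

  count : ∀ {n} → (Fin n → Bool) → ℕ
  count {n} p = length (filterᵇ p (allFin n))

  length-filter-tabulate : ∀ {X : Set} n (g : Fin n → X) (p : X → Bool) →
    length (filterᵇ p (tabulate g)) ≡ count (p ∘ g)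
  length-filter-tabulate zero    g p = refl
  length-filter-tabulate (suc n) g p with p (g zero)
  ... | true  = cong suc (trans (length-filter-tabulate n (g ∘ suc) p) (sym (length-filter-tabulate n suc (p ∘ g))))
  ... | false = trans (length-filter-tabulate n (g ∘ suc) p) (sym (length-filter-tabulate n suc (p ∘ g)))

  length-filter-tabulate-last : ∀ {X : Set} n (g : Fin (suc n) → X) (p : X → Bool) →
    length (filterᵇ p (tabulate g)) ≡ length (filterᵇ p (tabulate (g ∘ inject₁))) ℕ.+ boolToℕ (p (g (fromℕ n)))
  length-filter-tabulate-last zero g p with p (g zero)
  ... | true  = refl
  ... | false = refl
  length-filter-tabulate-last (suc n) g p with p (g zero)
  ... | true  = cong suc (length-filter-tabulate-last n (g ∘ suc) p)
  ... | false = length-filter-tabulate-last n (g ∘ suc) p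

  count-cong : ∀ {n} {p q : Fin n → Bool} → (∀ i → p i ≡ q i) → count p ≡ count q
  count-cong {n} {p} {q} p≡q =
    trans (sym (length-filter-tabulate n (λ i → i) p))
          (trans (cong length (filter≡ (allFin n))) (length-filter-tabulate n (λ i → i) q))
    where
    filter≡ : ∀ xs → filterᵇ p xs ≡ filterᵇ q xs
    filter≡ [] = refl
    filter≡ (x ∷ xs) rewrite p≡q x with q x
    ... | true  = cong (x ∷_) (filter≡ xs)
    ... | false = filter≡ xs

  count-head : ∀ n (p : Fin (suc n) → Bool) → count p ≡ boolToℕ (p zero) ℕ.+ count (p ∘ suc)
  count-head n p with p zero
  ... | true  = cong suc (length-filter-tabulate n suc p)
  ... | false = length-filter-tabulate n suc p

  count-last : ∀ n (p : Fin (suc n) → Bool) → count p ≡ count (p ∘ inject₁) ℕ.+ boolToℕ (p (fromℕ n))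
  count-last n p =
    trans (length-filter-tabulate-last n (λ i → i) p) (cong (ℕ._+ boolToℕ (p (fromℕ n))) (length-filter-tabulate n inject₁ p))

  count-none : ∀ {n} (p : Fin n → Bool) → (∀ i → p i ≡ false) → count p ≡ 0
  count-none {zero}  p none = refl
  count-none {suc n} p none =
    trans (count-head n p) (cong₂ ℕ._+_ (cong boolToℕ (none zero)) (count-none (p ∘ suc) (none ∘ suc)))

  count-mono : ∀ {n} (p q : Fin n → Bool) → (∀ i → p i ≡ true → q i ≡ true) → count p ≤ count q
  count-mono {zero}  p q p⇒q = ℕ.z≤n
  count-mono {suc n} p q p⇒q rewrite count-head n p | count-head n q with p zero in e₁ | q zero in e₂
  ... | true  | true  = ℕ.s≤s (count-mono (p ∘ suc) (q ∘ suc) (p⇒q ∘ suc))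
  ... | true  | false = ⊥-elim (true≢false (trans (sym (p⇒q zero e₁)) e₂))
  ... | false | true  = NP.m≤n⇒m≤1+n (count-mono (p ∘ suc) (q ∘ suc) (p⇒q ∘ suc))
  ... | false | false = count-mono (p ∘ suc) (q ∘ suc) (p⇒q ∘ suc)

  _==ᶠ_ : ∀ {n} → Fin n → Fin n → Bool
  i ==ᶠ j = does (i FP.≟ j)

  ==ᶠ-suc : ∀ {n} (i j : Fin n) → (suc i ==ᶠ suc j) ≡ (i ==ᶠ j)
  ==ᶠ-suc i j with i FP.≟ j
  ... | yes _ = refl
  ... | no  _ = refl

  count-remove : ∀ n (p : Fin n → Bool) b → count p ≡ count (λ i → p i ∧ not (i ==ᶠ b)) ℕ.+ boolToℕ (p b)
  count-remove (suc n) p zero = begin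
    count p                                                   ≡⟨ count-head n p ⟩
    boolToℕ (p zero) ℕ.+ count (p ∘ suc)                      ≡⟨ NP.+-comm (boolToℕ (p zero)) _ ⟩
    count (p ∘ suc) ℕ.+ boolToℕ (p zero)
      ≡⟨ cong₂ (λ a c → boolToℕ a ℕ.+ c ℕ.+ boolToℕ (p zero)) (sym (∧-zeroʳ (p zero)))
               (count-cong (λ i → sym (∧-identityʳ (p (suc i))))) ⟩
    (boolToℕ (p zero ∧ false) ℕ.+ count (λ i → p (suc i) ∧ true)) ℕ.+ boolToℕ (p zero)
      ≡⟨ cong (ℕ._+ boolToℕ (p zero)) (sym (count-head n (λ i → p i ∧ not (i ==ᶠ zero)))) ⟩
    count (λ i → p i ∧ not (i ==ᶠ zero)) ℕ.+ boolToℕ (p zero) ∎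
    where open ≡-Reasoning
  count-remove (suc n) p (suc b) = begin
    count p                                                   ≡⟨ count-head n p ⟩
    boolToℕ (p zero) ℕ.+ count (p ∘ suc)                      ≡⟨ cong (boolToℕ (p zero) ℕ.+_) (count-remove n (p ∘ suc) b) ⟩
    boolToℕ (p zero) ℕ.+ (count (λ i → p (suc i) ∧ not (i ==ᶠ b)) ℕ.+ boolToℕ (p (suc b)))
      ≡⟨ sym (NP.+-assoc (boolToℕ (p zero)) _ _) ⟩
    (boolToℕ (p zero) ℕ.+ count (λ i → p (suc i) ∧ not (i ==ᶠ b))) ℕ.+ boolToℕ (p (suc b))
      ≡⟨ cong₂ (λ a c → boolToℕ a ℕ.+ c ℕ.+ boolToℕ (p (suc b))) (sym (∧-identityʳ (p zero)))
               (count-cong (λ i → cong (λ z → p (suc i) ∧ not z) (sym (==ᶠ-suc i b)))) ⟩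
    (boolToℕ (p zero ∧ true) ℕ.+ count (λ i → p (suc i) ∧ not (suc i ==ᶠ suc b))) ℕ.+ boolToℕ (p (suc b))
      ≡⟨ cong (ℕ._+ boolToℕ (p (suc b))) (sym (count-head n (λ i → p i ∧ not (i ==ᶠ suc b)))) ⟩
    count (λ i → p i ∧ not (i ==ᶠ suc b)) ℕ.+ boolToℕ (p (suc b)) ∎
    where open ≡-Reasoning

module FunctionSums where

  open Booleans
  open ListSums
  open import Defs
  open import Data.Nat as ℕ using (zero; suc)
  open import Data.Fin as Fin using (Fin; zero; suc; inject₁; fromℕ)
  open import Data.Rational using (ℚ; 0ℚ; _+_)
  open import Data.Rational.Properties using (+-identityʳ; +-identityˡ)
  open import Data.List using (List; []; _∷_)
  open import Data.Bool using (Bool; true; false; _∧_)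
  open import Data.Product using (proj₁; proj₂)
  open import Relation.Binary.PropositionalEquality
  open import Function using (_∘_)

  snoc : ∀ {A : Set} {k} → (Fin k → A) → A → Fin (suc k) → A
  snoc {k = zero}  g x zero    = x
  snoc {k = suc k} g x zero    = g zero
  snoc {k = suc k} g x (suc i) = snoc (g ∘ suc) x i

  snoc-inject₁ : ∀ {A : Set} {k} (g : Fin k → A) x i → snoc g x (inject₁ i) ≡ g i
  snoc-inject₁ {k = suc k} g x zero    = refl
  snoc-inject₁ {k = suc k} g x (suc i) = snoc-inject₁ (g ∘ suc) x i

  snoc-last : ∀ {A : Set} {k} (g : Fin k → A) x → snoc g x (fromℕ k) ≡ x
  snoc-last {k = zero}  g x = refl
  snoc-last {k = suc k} g x = snoc-last (g ∘ suc) x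

  snoc-cong : ∀ {A : Set} {k} {g h : Fin k → A} x → (∀ i → g i ≡ h i) → ∀ i → snoc g x i ≡ snoc h x i
  snoc-cong {k = zero}  x g≡h zero    = refl
  snoc-cong {k = suc k} x g≡h zero    = g≡h zero
  snoc-cong {k = suc k} x g≡h (suc i) = snoc-cong x (g≡h ∘ suc) i

  cons : ∀ {A : Set} {k} → A → (Fin k → A) → Fin (suc k) → A
  cons x g zero    = x
  cons x g (suc i) = g i

  Extensional : ∀ {A : Set} {k} → ((Fin k → A) → ℚ) → Set
  Extensional f = ∀ g h → (∀ i → g i ≡ h i) → f g ≡ f h

  Extensional₂ : ∀ {A : Set} {k n} → ((Fin k → Fin n → A) → ℚ) → Set
  Extensional₂ Φ = ∀ G H → (∀ i j → G i j ≡ H i j) → Φ G ≡ Φ H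

  Σ-allFuns-head : ∀ {A : Set} k (xs : List A) (f : (Fin (suc k) → A) → ℚ) → Extensional f →
    Σl (allFuns (suc k) xs) f ≡ Σl xs (λ x → Σl (allFuns k xs) (λ g → f (cons x g)))
  Σ-allFuns-head k xs f ext = trans (Σ-concatMap xs _ f)
    (Σ-cong xs (λ x → trans (Σ-map (allFuns k xs) _ f)
      (Σ-cong (allFuns k xs) (λ g → ext _ _ (λ { zero → refl ; (suc i) → refl })))))

  Σ-allFuns-last : ∀ {A : Set} k (xs : List A) (f : (Fin (suc k) → A) → ℚ) → Extensional f →
    Σl (allFuns (suc k) xs) f ≡ Σl (allFuns k xs) (λ g → Σl xs (λ x → f (snoc g x)))
  Σ-allFuns-last zero xs f ext = begin
    Σl (allFuns 1 xs) f                                       ≡⟨ Σ-allFuns-head zero xs f ext ⟩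
    Σl xs (λ x → f (cons x (λ ())) + 0ℚ)                      ≡⟨ Σ-cong xs (λ x → +-identityʳ _) ⟩
    Σl xs (λ x → f (cons x (λ ())))                           ≡⟨ Σ-cong xs (λ x → ext _ _ (λ { zero → refl })) ⟩
    Σl xs (λ x → f (snoc (λ ()) x))                           ≡⟨ sym (+-identityʳ _) ⟩
    Σl xs (λ x → f (snoc (λ ()) x)) + 0ℚ                      ∎
    where open ≡-Reasoning
  Σ-allFuns-last (suc k) xs f ext = begin
    Σl (allFuns (suc (suc k)) xs) f
      ≡⟨ Σ-allFuns-head (suc k) xs f ext ⟩
    Σl xs (λ x₀ → Σl (allFuns (suc k) xs) (λ g → f (cons x₀ g)))
      ≡⟨ Σ-cong xs (λ x₀ → Σ-allFuns-last k xs (λ g → f (cons x₀ g)) (λ g h e → ext _ _ (λ { zero → refl ; (suc i) → e i }))) ⟩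
    Σl xs (λ x₀ → Σl (allFuns k xs) (λ g → Σl xs (λ x → f (cons x₀ (snoc g x)))))
      ≡⟨ Σ-cong xs (λ x₀ → Σ-cong (allFuns k xs) (λ g → Σ-cong xs (λ x → ext _ _ (λ { zero → refl ; (suc i) → refl })))) ⟩
    Σl xs (λ x₀ → Σl (allFuns k xs) (λ g → Σl xs (λ x → f (snoc (cons x₀ g) x))))
      ≡⟨ sym (Σ-allFuns-head k xs _ (λ g h e → Σ-cong xs (λ x → ext _ _ (snoc-cong x e)))) ⟩
    Σl (allFuns (suc k) xs) (λ g → Σl xs (λ x → f (snoc g x))) ∎
    where open ≡-Reasoning

  Σ-allFuns-lastColumn : ∀ {A : Set} k n (ys : List A) (Φ : (Fin k → Fin (suc n) → A) → ℚ) → Extensional₂ Φ →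
    Σl (allFuns k (allFuns (suc n) ys)) Φ ≡
    Σl (allFuns k (allFuns n ys)) (λ M → Σl (allFuns k ys) (λ c → Φ (λ i → snoc (M i) (c i))))
  Σ-allFuns-lastColumn zero    n ys Φ ext = cong (_+ 0ℚ) (trans (ext _ _ (λ ())) (sym (+-identityʳ _)))
  Σ-allFuns-lastColumn (suc k) n ys Φ ext = begin
    Σl (allFuns (suc k) Rows) Φ
      ≡⟨ Σ-allFuns-head k Rows Φ (λ g h e → ext g h (λ i j → cong (λ f → f j) (e i))) ⟩
    Σl Rows (λ y → Σl (allFuns k Rows) (λ G → Φ (cons y G)))
      ≡⟨ Σ-cong Rows (λ y → Σ-allFuns-lastColumn k n ys (λ G → Φ (cons y G))
                              (λ G H e → ext _ _ (λ { zero j → refl ; (suc i) j → e i j }))) ⟩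
    Σl Rows (λ y → Σl Mats (λ M → Σl Cols (λ c → Φ (cons y (λ i → snoc (M i) (c i))))))
      ≡⟨ Σ-allFuns-last n ys _ (λ g h e → Σ-cong Mats (λ M → Σ-cong Cols (λ c →
            ext _ _ (λ { zero j → e j ; (suc i) j → refl })))) ⟩
    Σl (allFuns n ys) (λ u → Σl ys (λ w → Σl Mats (λ M → Σl Cols (λ c → Φ (cons (snoc u w) (λ i → snoc (M i) (c i)))))))
      ≡⟨ Σ-cong (allFuns n ys) (λ u → Σ-swap ys Mats _) ⟩
    Σl (allFuns n ys) (λ u → Σl Mats (λ M → Σl ys (λ w → Σl Cols (λ c → Φ (cons (snoc u w) (λ i → snoc (M i) (c i)))))))
      ≡⟨ Σ-cong (allFuns n ys) (λ u → Σ-cong Mats (λ M → Σ-cong ys (λ w → Σ-cong Cols (λ c →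
            ext _ _ (λ { zero j → refl ; (suc i) j → refl }))))) ⟩
    Σl (allFuns n ys) (λ u → Σl Mats (λ M → Σl ys (λ w → Σl Cols (λ c → Φ (λ i → snoc (cons u M i) (cons w c i))))))
      ≡⟨ Σ-cong (allFuns n ys) (λ u → Σ-cong Mats (λ M → sym (Σ-allFuns-head k ys _ (λ g h e →
            ext _ _ (λ i j → cong (λ z → snoc (cons u M i) z j) (e i)))))) ⟩
    Σl (allFuns n ys) (λ u → Σl Mats (λ M → Σl (allFuns (suc k) ys) (λ c → Φ (λ i → snoc (cons u M i) (c i)))))
      ≡⟨ sym (Σ-allFuns-head k (allFuns n ys) _ (λ g h e → Σ-cong (allFuns (suc k) ys) (λ c →
            ext _ _ (λ i j → cong (λ z → snoc z (c i) j) (e i))))) ⟩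
    Σl (allFuns (suc k) (allFuns n ys)) (λ M → Σl (allFuns (suc k) ys) (λ c → Φ (λ i → snoc (M i) (c i)))) ∎
    where
    open ≡-Reasoning
    Rows = allFuns (suc n) ys
    Mats = allFuns k (allFuns n ys)
    Cols = allFuns k ys

  bools : List Bool
  bools = true ∷ false ∷ []

  beq : Bool → Bool → Bool
  beq true  true  = true
  beq false false = true
  beq _     _     = false

  beq-sound : ∀ a b → beq a b ≡ true → a ≡ b
  beq-sound true  true  _ = refl
  beq-sound false false _ = refl

  beq-refl : ∀ a → beq a a ≡ true
  beq-refl true  = refl
  beq-refl false = refl

  eqVec : ∀ {k} → (Fin k → Bool) → (Fin k → Bool) → Bool
  eqVec {zero}  r u = true
  eqVec {suc k} r u = beq (r zero) (u zero) ∧ eqVec (r ∘ suc) (u ∘ suc)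

  eqVec-sound : ∀ {k} (r u : Fin k → Bool) → eqVec r u ≡ true → ∀ i → r i ≡ u i
  eqVec-sound {suc k} r u e zero    = beq-sound _ _ (proj₁ (∧-elim e))
  eqVec-sound {suc k} r u e (suc i) = eqVec-sound (r ∘ suc) (u ∘ suc) (proj₂ (∧-elim {beq (r zero) (u zero)} e)) i

  eqVec-complete : ∀ {k} (r u : Fin k → Bool) → (∀ i → r i ≡ u i) → eqVec r u ≡ true
  eqVec-complete {zero}  r u r≡u = refl
  eqVec-complete {suc k} r u r≡u rewrite r≡u zero =
    ∧-intro (beq-refl (u zero)) (eqVec-complete (r ∘ suc) (u ∘ suc) (r≡u ∘ suc))

  eqVec-congˡ : ∀ {k} {r s w : Fin k → Bool} → (∀ i → r i ≡ s i) → eqVec r w ≡ eqVec s w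
  eqVec-congˡ {zero}                 r≡s = refl
  eqVec-congˡ {suc k} {r} {s} {w} r≡s = cong₂ (λ a b → beq a (w zero) ∧ b) (r≡s zero) (eqVec-congˡ (r≡s ∘ suc))

  Σ-allFuns-eqVec : ∀ k (u : Fin k → Bool) (g : (Fin k → Bool) → ℚ) → Extensional g →
    Σl (allFuns k bools) (λ r → ite (eqVec r u) (g r)) ≡ g u
  Σ-allFuns-eqVec zero    u g ext = trans (+-identityʳ _) (ext _ _ (λ ()))
  Σ-allFuns-eqVec (suc k) u g ext =
    trans (Σ-allFuns-head k bools _ (λ r s e → cong₂ ite (eqVec-congˡ {w = u} e) (ext r s e))) (byHead (u zero) refl)
    where
    headSum : Bool → ℚ
    headSum x = Σl (allFuns k bools) (λ r → ite (eqVec (cons x r) u) (g (cons x r)))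
    headSum-mismatch : ∀ x → beq x (u zero) ≡ false → headSum x ≡ 0ℚ
    headSum-mismatch x mismatch =
      trans (Σ-cong (allFuns k bools) (λ r → cong (λ z → ite (z ∧ eqVec r (u ∘ suc)) (g (cons x r))) mismatch))
            (Σ-0 (allFuns k bools))
    headSum-match : ∀ x → x ≡ u zero → headSum x ≡ g u
    headSum-match x refl = trans
      (Σ-cong (allFuns k bools) (λ r → cong (λ z → ite (z ∧ eqVec r (u ∘ suc)) (g (cons x r))) (beq-refl x)))
      (trans (Σ-allFuns-eqVec k (u ∘ suc) (λ r → g (cons x r)) (λ r s e → ext _ _ (λ { zero → refl ; (suc i) → e i })))
             (ext _ _ (λ { zero → refl ; (suc i) → refl })))
    byHead : ∀ b → b ≡ u zero → headSum true + (headSum false + 0ℚ) ≡ g u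
    byHead true e = begin
      headSum true + (headSum false + 0ℚ)    ≡⟨ cong₂ _+_ (headSum-match true e) (+-identityʳ (headSum false)) ⟩
      g u + headSum false                    ≡⟨ cong (g u +_) (headSum-mismatch false (cong (beq false) (sym e))) ⟩
      g u + 0ℚ                               ≡⟨ +-identityʳ (g u) ⟩
      g u                                    ∎
      where open ≡-Reasoning
    byHead false e = begin
      headSum true + (headSum false + 0ℚ)    ≡⟨ cong₂ _+_ (headSum-mismatch true (cong (beq true) (sym e))) (+-identityʳ (headSum false)) ⟩
      0ℚ + headSum false                     ≡⟨ +-identityˡ (headSum false) ⟩
      headSum false                          ≡⟨ headSum-match false e ⟩
      g u                                    ∎
      where open ≡-Reasoning

module GeometricSums where

  open ℚAlgebra
  open import Defs
  open import Data.Nat as ℕ using (ℕ; zero; suc)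
  import Data.Nat.Properties as NP
  open import Data.Rational using (ℚ; 0ℚ; 1ℚ; _+_; _*_; _-_)
  open import Data.Rational.Properties using (+-identityˡ; +-identityʳ; +-assoc; *-zeroʳ; *-distribˡ-+)
  open import Relation.Binary.PropositionalEquality
  open import Tactic.RingSolver using (solve-∀)

  rangeSum : ℕ → ℕ → (ℕ → ℚ) → ℚ
  rangeSum a zero    f = 0ℚ
  rangeSum a (suc d) f = rangeSum a d f + f (a ℕ.+ d)

  rangeSum-cong : ∀ a d {f g : ℕ → ℚ} → (∀ r → f r ≡ g r) → rangeSum a d f ≡ rangeSum a d g
  rangeSum-cong a zero    f≡g = refl
  rangeSum-cong a (suc d) f≡g = cong₂ _+_ (rangeSum-cong a d f≡g) (f≡g _)

  rangeSum-* : ∀ a d c f → rangeSum a d (λ r → c * f r) ≡ c * rangeSum a d f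
  rangeSum-* a zero    c f = sym (*-zeroʳ c)
  rangeSum-* a (suc d) c f =
    trans (cong (_+ c * f (a ℕ.+ d)) (rangeSum-* a d c f)) (sym (*-distribˡ-+ c (rangeSum a d f) (f (a ℕ.+ d))))

  rangeSum-head : ∀ a d g → rangeSum a (suc d) g ≡ g a + rangeSum (suc a) d g
  rangeSum-head a zero g = trans (+-identityˡ _) (trans (cong g (NP.+-identityʳ a)) (sym (+-identityʳ _)))
  rangeSum-head a (suc d) g = trans (cong (_+ g (a ℕ.+ suc d)) (rangeSum-head a d g))
    (trans (+-assoc (g a) _ _) (cong (λ z → g a + (rangeSum (suc a) d g + g z)) (NP.+-suc a d)))

  rangeSum-shift : ∀ a d g → rangeSum a d (λ r → g (r ℕ.+ 1)) ≡ rangeSum (suc a) d g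
  rangeSum-shift a zero    g = refl
  rangeSum-shift a (suc d) g = cong₂ _+_ (rangeSum-shift a d g) (cong g (NP.+-comm (a ℕ.+ d) 1))

  -≢0 : ∀ x y → x ≢ y → x - y ≢ 0ℚ
  -≢0 x y x≢y x-y≡0 = x≢y (begin
    x              ≡⟨ shift x y ⟩
    (x - y) + y    ≡⟨ cong (_+ y) x-y≡0 ⟩
    0ℚ + y         ≡⟨ +-identityˡ y ⟩
    y              ∎)
    where
    open ≡-Reasoning
    shift : ∀ x y → x ≡ (x - y) + y
    shift = solve-∀ ℚring

  geometric-step : ∀ x y → x ≢ 0ℚ → y ≢ 0ℚ → x ≢ y → inv x * (x * inv y) ≡ inv (x - y) * (x * inv y - 1ℚ)
  geometric-step x y x≢0 y≢0 x≢y = begin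
    inv x * (x * inv y)                     ≡⟨ sym (*-assoc′ (inv x) x (inv y)) ⟩
    (inv x * x) * inv y                     ≡⟨ cong (_* inv y) (inv-inverseˡ x x≢0) ⟩
    1ℚ * inv y                              ≡⟨ cong (_* inv y) (sym (inv-inverseˡ (x - y) (-≢0 x y x≢y))) ⟩
    (inv (x - y) * (x - y)) * inv y         ≡⟨ sym (distrib (inv (x - y)) x y (inv y)) ⟩
    inv (x - y) * (x * inv y - y * inv y)   ≡⟨ cong (λ z → inv (x - y) * (x * inv y - z)) (inv-inverseʳ y y≢0) ⟩
    inv (x - y) * (x * inv y - 1ℚ)          ∎
    where
    open ≡-Reasoning
    *-assoc′ : ∀ a b c → (a * b) * c ≡ a * (b * c)
    *-assoc′ = solve-∀ ℚring
    distrib : ∀ i x y iy → i * (x * iy - y * iy) ≡ (i * (x - y)) * iy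
    distrib = solve-∀ ℚring

  -- Termwise (x/y)^(r+1) / x = ((x/y)^(r+1) - (x/y)^r) / (x - y), so the sum telescopes.
  geometric-sum : ∀ x y → x ≢ 0ℚ → y ≢ 0ℚ → x ≢ y → ∀ a d →
    inv x * rangeSum a d (λ r → powℕ (x * inv y) (suc r))
      ≡ inv (x - y) * (powℕ (x * inv y) (a ℕ.+ d) - powℕ (x * inv y) a)
  geometric-sum x y x≢0 y≢0 x≢y a zero rewrite NP.+-identityʳ a =
    trans (*-zeroʳ (inv x)) (sym (cancel (inv (x - y)) (powℕ (x * inv y) a)))
    where
    cancel : ∀ i P → i * (P - P) ≡ 0ℚ
    cancel = solve-∀ ℚring
  geometric-sum x y x≢0 y≢0 x≢y a (suc d) rewrite NP.+-suc a d =
    step (inv x) _ (powℕ ρ (a ℕ.+ d)) (inv (x - y)) ρ _ (geometric-sum x y x≢0 y≢0 x≢y a d) (geometric-step x y x≢0 y≢0 x≢y)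
    where
    ρ = x * inv y
    step : ∀ ix S P i ρ a → ix * S ≡ i * (P - a) → ix * ρ ≡ i * (ρ - 1ℚ) → ix * (S + ρ * P) ≡ i * (ρ * P - a)
    step ix S P i ρ a hS hρ = begin
      ix * (S + ρ * P)                   ≡⟨ expand ix S ρ P ⟩
      ix * S + (ix * ρ) * P              ≡⟨ cong₂ (λ u w → u + w * P) hS hρ ⟩
      i * (P - a) + (i * (ρ - 1ℚ)) * P   ≡⟨ collect i P a ρ ⟩
      i * (ρ * P - a)                    ∎
      where
      open ≡-Reasoning
      expand : ∀ ix S ρ P → ix * (S + ρ * P) ≡ ix * S + (ix * ρ) * P
      expand = solve-∀ ℚring
      collect : ∀ i P a ρ → i * (P - a) + (i * (ρ - 1ℚ)) * P ≡ i * (ρ * P - a)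
      collect = solve-∀ ℚring

module ParentIdentity where

  open Booleans
  open ℚAlgebra
  open StatisticWeights
  open ListSums
  open GeometricSums
  open import Defs
  open import Data.Nat as ℕ using (ℕ; zero; suc; _<ᵇ_; _≤_; _∸_)
  import Data.Nat.Properties as NP
  open import Data.Fin as Fin using (Fin; zero; suc; toℕ; inject₁; fromℕ)
  import Data.Fin.Properties as FP
  open import Data.Rational using (ℚ; 0ℚ; 1ℚ; _+_; _*_; _-_)
  open import Data.Rational.Properties using (*-identityˡ; *-assoc)
  open import Data.List using (allFin)
  open import Data.Bool using (true; false; if_then_else_)
  open import Relation.Binary.PropositionalEquality
  open import Relation.Nullary using (yes; no)
  open import Tactic.RingSolver using (solve-∀)

  NonZeroPoint : ∀ {m} → (Fin (suc m) → ℚ) → Set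
  NonZeroPoint v = ∀ i → v i ≢ 0ℚ

  DistinctSteps : ∀ {m} → (Fin (suc m) → ℚ) → Set
  DistinctSteps {m} v = ∀ (J : Fin m) → v (inject₁ J) ≢ v (suc J)

  incrementTo : (ℕ → ℕ) → ℕ → (ℕ → ℕ)
  incrementTo A p zero    = A zero
  incrementTo A p (suc k) = if k <ᵇ p then suc (A (suc k)) else A (suc k)

  incrementTo-0 : ∀ A k → incrementTo A 0 k ≡ A k
  incrementTo-0 A zero    = refl
  incrementTo-0 A (suc k) = refl

  incrementTo-suc : ∀ B p k → incrementTo B (suc p) k ≡ update (incrementTo B p) (suc p) (suc (B (suc p))) k
  incrementTo-suc B p zero = refl
  incrementTo-suc B p (suc k) with k ℕ.≟ p
  ... | yes refl rewrite <ᵇ-suc-self k | ≡ᵇ-refl k = refl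
  ... | no k≢p   rewrite <ᵇ-suc-≢ k p k≢p | ≡ᵇ-false k≢p = refl

  update-self : ∀ A k x → update A k (A k) x ≡ A x
  update-self A k x with x ℕ.≟ k
  ... | yes refl = update-here A x (A x)
  ... | no x≢k   = update-there A k (A k) x x≢k

  update-incrementTo : ∀ A p c x → update (incrementTo A p) (suc p) c x ≡ incrementTo (update A (suc p) c) p x
  update-incrementTo A p c zero = refl
  update-incrementTo A p c (suc k) with k ℕ.≟ p
  ... | yes refl rewrite ≡ᵇ-refl k | <ᵇ-self k = refl
  ... | no k≢p rewrite ≡ᵇ-false k≢p with k <ᵇ p
  ...   | true  = refl
  ...   | false = refl

  -- The factors v_J / v_{J+1} telescope to v_1 / v_{p+1}.
  statWeight-incrementTo : ∀ (m n : ℕ) (v : Fin (suc m) → ℚ) → NonZeroPoint v → ∀ B p (P : Fin (suc m)) → toℕ P ≡ p →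
    statWeight m n v (incrementTo B p) ≡ (v zero * inv (v P)) * statWeight m n v B
  statWeight-incrementTo m n v v≢0 B zero zero refl = begin
    statWeight m n v (incrementTo B 0)              ≡⟨ statWeight-cong m n v (incrementTo-0 B) ⟩
    statWeight m n v B                              ≡⟨ sym (*-identityˡ _) ⟩
    1ℚ * statWeight m n v B                         ≡⟨ cong (_* statWeight m n v B) (sym (inv-inverseʳ (v zero) (v≢0 zero))) ⟩
    (v zero * inv (v zero)) * statWeight m n v B    ∎
    where open ≡-Reasoning
  statWeight-incrementTo m n v v≢0 B (suc p) (suc J) e = begin
    statWeight m n v (incrementTo B (suc p))
      ≡⟨ statWeight-cong m n v (incrementTo-suc B p) ⟩
    statWeight m n v (update X (suc p) (suc (B (suc p))))
      ≡⟨ cong (λ q → statWeight m n v (update X (suc q) (suc (B (suc q))))) (sym J≡p) ⟩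
    statWeight m n v (update X (suc (toℕ J)) (suc (B (suc (toℕ J)))))
      ≡⟨ statWeight-update-suc m n v X J (B (suc (toℕ J))) (v≢0 _) (v≢0 _) ⟩
    ρ * statWeight m n v (update X (suc (toℕ J)) (B (suc (toℕ J))))
      ≡⟨ cong (λ z → ρ * statWeight m n v (update X (suc (toℕ J)) z)) (sym X[J+1]) ⟩
    ρ * statWeight m n v (update X (suc (toℕ J)) (X (suc (toℕ J))))
      ≡⟨ cong (ρ *_) (statWeight-cong m n v (update-self X (suc (toℕ J)))) ⟩
    ρ * statWeight m n v X
      ≡⟨ cong (ρ *_) (statWeight-incrementTo m n v v≢0 B p (inject₁ J) (trans (FP.toℕ-inject₁ J) J≡p)) ⟩
    ρ * ((v zero * inv (v (inject₁ J))) * statWeight m n v B)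
      ≡⟨ sym (*-assoc ρ _ _) ⟩
    (ρ * (v zero * inv (v (inject₁ J)))) * statWeight m n v B
      ≡⟨ cong (_* statWeight m n v B) telescope ⟩
    (v zero * inv (v (suc J))) * statWeight m n v B ∎
    where
    open ≡-Reasoning
    X = incrementTo B p
    J≡p : toℕ J ≡ p
    J≡p = NP.suc-injective e
    ρ = v (inject₁ J) * inv (v (suc J))
    X[J+1] : X (suc (toℕ J)) ≡ B (suc (toℕ J))
    X[J+1] rewrite J≡p | <ᵇ-self p = refl
    swap : ∀ x iy z ix → (x * iy) * (z * ix) ≡ (x * ix) * (z * iy)
    swap = solve-∀ ℚring
    telescope : ρ * (v zero * inv (v (inject₁ J))) ≡ v zero * inv (v (suc J))
    telescope = begin
      ρ * (v zero * inv (v (inject₁ J)))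
        ≡⟨ swap (v (inject₁ J)) (inv (v (suc J))) (v zero) (inv (v (inject₁ J))) ⟩
      (v (inject₁ J) * inv (v (inject₁ J))) * (v zero * inv (v (suc J)))
        ≡⟨ cong (_* (v zero * inv (v (suc J)))) (inv-inverseʳ _ (v≢0 (inject₁ J))) ⟩
      1ℚ * (v zero * inv (v (suc J)))
        ≡⟨ *-identityˡ _ ⟩
      v zero * inv (v (suc J)) ∎

  statWeight-update-powℕ : ∀ m n v → NonZeroPoint v → ∀ A (J : Fin m) c →
    statWeight m n v (update A (suc (toℕ J)) c)
      ≡ powℕ (v (inject₁ J) * inv (v (suc J))) c * statWeight m n v (update A (suc (toℕ J)) 0)
  statWeight-update-powℕ m n v v≢0 A J zero    = sym (*-identityˡ _)
  statWeight-update-powℕ m n v v≢0 A J (suc c) = begin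
    statWeight m n v (update A (suc (toℕ J)) (suc c))               ≡⟨ statWeight-update-suc m n v A J c (v≢0 _) (v≢0 _) ⟩
    ρ * statWeight m n v (update A (suc (toℕ J)) c)                 ≡⟨ cong (ρ *_) (statWeight-update-powℕ m n v v≢0 A J c) ⟩
    ρ * (powℕ ρ c * statWeight m n v (update A (suc (toℕ J)) 0))   ≡⟨ sym (*-assoc ρ _ _) ⟩
    (ρ * powℕ ρ c) * statWeight m n v (update A (suc (toℕ J)) 0)   ∎
    where
    open ≡-Reasoning
    ρ = v (inject₁ J) * inv (v (suc J))

  statWeight-factor : ∀ m n v → NonZeroPoint v → ∀ A (J : Fin m) →
    statWeight m n v A ≡ powℕ (v (inject₁ J) * inv (v (suc J))) (A (suc (toℕ J))) * statWeight m n v (update A (suc (toℕ J)) 0)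
  statWeight-factor m n v v≢0 A J =
    trans (sym (statWeight-cong m n v (update-self A (suc (toℕ J))))) (statWeight-update-powℕ m n v v≢0 A J _)

  -- The weight of the child in which n+1 joins a block of type J whose maximum has rank r (see ChildStatistics).
  blockChildWeight : ∀ (m n : ℕ) (v : Fin (suc m) → ℚ) (A : ℕ → ℕ) (J : Fin m) (r : ℕ) → ℚ
  blockChildWeight m n v A J r = statWeight m (suc n) v (update (incrementTo A (toℕ J)) (suc (toℕ J)) (suc r))

  blockChildWeight-factor : ∀ m n v → NonZeroPoint v → ∀ A (J : Fin m) r →
    blockChildWeight m n v A J r
      ≡ (v (fromℕ m) * (v zero * statWeight m n v (update A (suc (toℕ J)) 0)))
        * (inv (v (inject₁ J)) * powℕ (v (inject₁ J) * inv (v (suc J))) (suc r))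
  blockChildWeight-factor m n v v≢0 A J r = begin
    blockChildWeight m n v A J r
      ≡⟨ statWeight-size-suc m n v _ (v≢0 _) ⟩
    vₗ * statWeight m n v (update (incrementTo A (toℕ J)) k (suc r))
      ≡⟨ cong (vₗ *_) (statWeight-cong m n v (update-incrementTo A (toℕ J) (suc r))) ⟩
    vₗ * statWeight m n v (incrementTo (update A k (suc r)) (toℕ J))
      ≡⟨ cong (vₗ *_) (statWeight-incrementTo m n v v≢0 _ (toℕ J) (inject₁ J) (FP.toℕ-inject₁ J)) ⟩
    vₗ * ((v zero * inv (v (inject₁ J))) * statWeight m n v (update A k (suc r)))
      ≡⟨ cong (λ z → vₗ * ((v zero * inv (v (inject₁ J))) * z)) (statWeight-update-powℕ m n v v≢0 A J (suc r)) ⟩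
    vₗ * ((v zero * inv (v (inject₁ J))) * (powℕ ρ (suc r) * Z))
      ≡⟨ regroup vₗ (v zero) (inv (v (inject₁ J))) (powℕ ρ (suc r)) Z ⟩
    (vₗ * (v zero * Z)) * (inv (v (inject₁ J)) * powℕ ρ (suc r)) ∎
    where
    open ≡-Reasoning
    vₗ = v (fromℕ m)
    k = suc (toℕ J)
    ρ = v (inject₁ J) * inv (v (suc J))
    Z = statWeight m n v (update A k 0)
    regroup : ∀ L o ix P Z → L * ((o * ix) * (P * Z)) ≡ (L * (o * Z)) * (ix * P)
    regroup = solve-∀ ℚring

  rangeSum-blockChildWeight : ∀ m n v → NonZeroPoint v → DistinctSteps v → ∀ A (J : Fin m) a d →
    rangeSum a d (blockChildWeight m n v A J)
      ≡ (v (fromℕ m) * (v zero * statWeight m n v (update A (suc (toℕ J)) 0)))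
        * (inv (v (inject₁ J) - v (suc J)) * (powℕ (v (inject₁ J) * inv (v (suc J))) (a ℕ.+ d) - powℕ (v (inject₁ J) * inv (v (suc J))) a))
  rangeSum-blockChildWeight m n v v≢0 distinct A J a d = begin
    rangeSum a d (blockChildWeight m n v A J)              ≡⟨ rangeSum-cong a d (blockChildWeight-factor m n v v≢0 A J) ⟩
    rangeSum a d (λ r → K * (inv x * powℕ ρ (suc r)))     ≡⟨ rangeSum-* a d K _ ⟩
    K * rangeSum a d (λ r → inv x * powℕ ρ (suc r))       ≡⟨ cong (K *_) (rangeSum-* a d (inv x) _) ⟩
    K * (inv x * rangeSum a d (λ r → powℕ ρ (suc r)))     ≡⟨ cong (K *_) (geometric-sum x y (v≢0 _) (v≢0 _) (distinct J) a d) ⟩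
    K * (inv (x - y) * (powℕ ρ (a ℕ.+ d) - powℕ ρ a))     ∎
    where
    open ≡-Reasoning
    x = v (inject₁ J)
    y = v (suc J)
    ρ = x * inv y
    K = v (fromℕ m) * (v zero * statWeight m n v (update A (suc (toℕ J)) 0))

  -- Children of type J have a_{J+1} ranging over [rankFloor A J, A (J+1)).
  rankFloor : ∀ {m : ℕ} → (ℕ → ℕ) → Fin m → ℕ
  rankFloor A zero    = 1
  rankFloor A (suc J) = A (suc (toℕ J))

  lastTermWeight : ∀ (m n : ℕ) (v : Fin (suc m) → ℚ) (A : ℕ → ℕ) → Fin m → ℚ
  lastTermWeight m n v A zero    = ((v zero ÷ v (suc zero)) ÷ (v zero - v (suc zero))) * statWeight m n (substNext v zero) A
  lastTermWeight m n v A (suc j) = inv (v (inject₁ (suc j)) - v (suc (suc j))) * statWeight m n (substNext v (suc j)) A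

  typeSum-closed : ∀ m n v → NonZeroPoint v → ∀ A → A 0 ≡ 0 → ∀ (J : Fin m) →
    (v (fromℕ m) * (v zero * statWeight m n v (update A (suc (toℕ J)) 0)))
      * (inv (v (inject₁ J) - v (suc J))
         * (powℕ (v (inject₁ J) * inv (v (suc J))) (A (suc (toℕ J))) - powℕ (v (inject₁ J) * inv (v (suc J))) (rankFloor A J)))
    ≡ v zero * (v (fromℕ m) * (inv (v (inject₁ J) - v (suc J)) * statWeight m n v A))
      - v (fromℕ m) * (v zero * lastTermWeight m n v A J)
  typeSum-closed (suc m) n v v≢0 A A0≡0 zero = begin
    (L * (o * Z)) * (i * (P - ρ * 1ℚ))
      ≡⟨ expand L o Z i P ρ ⟩
    o * (L * (i * (P * Z))) - L * (o * ((ρ * i) * Z))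
      ≡⟨ cong₂ (λ a b → o * (L * (i * a)) - L * (o * ((ρ * i) * b)))
               (sym (statWeight-factor (suc m) n v v≢0 A zero)) (sym merged) ⟩
    o * (L * (i * statWeight (suc m) n v A)) - L * (o * ((ρ * i) * statWeight (suc m) n (substNext v zero) A)) ∎
    where
    open ≡-Reasoning
    L = v (fromℕ (suc m))
    o = v zero
    Z = statWeight (suc m) n v (update A 1 0)
    i = inv (v zero - v (suc zero))
    ρ = v zero * inv (v (suc zero))
    P = powℕ ρ (A 1)
    expand : ∀ L o Z i P ρ → (L * (o * Z)) * (i * (P - ρ * 1ℚ)) ≡ o * (L * (i * (P * Z))) - L * (o * ((ρ * i) * Z))
    expand = solve-∀ ℚring
    merged : statWeight (suc m) n (substNext v zero) A ≡ Z
    merged = trans (statWeight-substNext (suc m) n v A zero (v≢0 _)) (cong (λ c → statWeight (suc m) n v (update A 1 c)) A0≡0)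
  typeSum-closed (suc m) n v v≢0 A A0≡0 (suc J) = begin
    (L * (o * Z)) * (i * (P - Q))
      ≡⟨ expand L o Z i P Q ⟩
    o * (L * (i * (P * Z))) - L * (o * (i * (Q * Z)))
      ≡⟨ cong₂ (λ a b → o * (L * (i * a)) - L * (o * (i * b)))
               (sym (statWeight-factor (suc m) n v v≢0 A (suc J))) (sym merged) ⟩
    o * (L * (i * statWeight (suc m) n v A)) - L * (o * (i * statWeight (suc m) n (substNext v (suc J)) A)) ∎
    where
    open ≡-Reasoning
    k = suc (toℕ (suc J))
    L = v (fromℕ (suc m))
    o = v zero
    Z = statWeight (suc m) n v (update A k 0)
    i = inv (v (inject₁ (suc J)) - v (suc (suc J)))
    ρ = v (inject₁ (suc J)) * inv (v (suc (suc J)))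
    P = powℕ ρ (A k)
    Q = powℕ ρ (A (toℕ (suc J)))
    expand : ∀ L o Z i P Q → (L * (o * Z)) * (i * (P - Q)) ≡ o * (L * (i * (P * Z))) - L * (o * (i * (Q * Z)))
    expand = solve-∀ ℚring
    merged : statWeight (suc m) n (substNext v (suc J)) A ≡ Q * Z
    merged = trans (statWeight-substNext (suc m) n v A (suc J) (v≢0 _)) (statWeight-update-powℕ (suc m) n v v≢0 A (suc J) _)

  typeSum : ∀ m n v → NonZeroPoint v → DistinctSteps v → ∀ A → A 0 ≡ 0 → ∀ (J : Fin m) →
    rankFloor A J ≤ A (suc (toℕ J)) →
    rangeSum (rankFloor A J) (A (suc (toℕ J)) ∸ rankFloor A J) (blockChildWeight m n v A J)
      ≡ v zero * (v (fromℕ m) * (inv (v (inject₁ J) - v (suc J)) * statWeight m n v A))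
        - v (fromℕ m) * (v zero * lastTermWeight m n v A J)
  typeSum m n v v≢0 distinct A A0≡0 J floor≤ = begin
    rangeSum lo (A k ∸ lo) (blockChildWeight m n v A J)
      ≡⟨ rangeSum-blockChildWeight m n v v≢0 distinct A J lo (A k ∸ lo) ⟩
    K * (i * (powℕ ρ (lo ℕ.+ (A k ∸ lo)) - powℕ ρ lo))
      ≡⟨ cong (λ e → K * (i * (powℕ ρ e - powℕ ρ lo))) (NP.m+[n∸m]≡n floor≤) ⟩
    K * (i * (powℕ ρ (A k) - powℕ ρ lo))
      ≡⟨ typeSum-closed m n v v≢0 A A0≡0 J ⟩
    v zero * (v (fromℕ m) * (i * statWeight m n v A)) - v (fromℕ m) * (v zero * lastTermWeight m n v A J) ∎
    where
    open ≡-Reasoning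
    lo = rankFloor A J
    k = suc (toℕ J)
    ρ = v (inject₁ J) * inv (v (suc J))
    i = inv (v (inject₁ J) - v (suc J))
    K = v (fromℕ m) * (v zero * statWeight m n v (update A k 0))

  childrenSum : ∀ (m n : ℕ) (v : Fin (suc m) → ℚ) (A : ℕ → ℕ) → ℚ
  childrenSum m n v A = statWeight m (suc n) v (incrementTo A m)
    + Σl (allFin m) (λ J → rangeSum (rankFloor A J) (A (suc (toℕ J)) ∸ rankFloor A J) (blockChildWeight m n v A J))

  parentRHS : ∀ (m n : ℕ) (v : Fin (suc m) → ℚ) (A : ℕ → ℕ) → ℚ
  parentRHS m n v A =
    v zero * (statWeight m n v A + v (fromℕ m) * Σl (allFin m) (λ J → inv (v (inject₁ J) - v (suc J)) * statWeight m n v A))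
    - v (fromℕ m) * (v zero * Σl (allFin m) (lastTermWeight m n v A))

  singletonChild-statWeight : ∀ m n v → NonZeroPoint v → ∀ A →
    statWeight m (suc n) v (incrementTo A m) ≡ v zero * statWeight m n v A
  singletonChild-statWeight m n v v≢0 A = begin
    statWeight m (suc n) v (incrementTo A m)
      ≡⟨ statWeight-size-suc m n v _ (v≢0 _) ⟩
    vₗ * statWeight m n v (incrementTo A m)
      ≡⟨ cong (vₗ *_) (statWeight-incrementTo m n v v≢0 A m (fromℕ m) (FP.toℕ-fromℕ m)) ⟩
    vₗ * ((v zero * inv vₗ) * statWeight m n v A)
      ≡⟨ regroup vₗ (v zero) (inv vₗ) (statWeight m n v A) ⟩
    (vₗ * inv vₗ) * (v zero * statWeight m n v A)
      ≡⟨ cong (_* (v zero * statWeight m n v A)) (inv-inverseʳ _ (v≢0 _)) ⟩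
    1ℚ * (v zero * statWeight m n v A)
      ≡⟨ *-identityˡ _ ⟩
    v zero * statWeight m n v A ∎
    where
    open ≡-Reasoning
    vₗ = v (fromℕ m)
    regroup : ∀ L o iL W → L * ((o * iL) * W) ≡ (L * iL) * (o * W)
    regroup = solve-∀ ℚring

  parent-identity : ∀ m n v → NonZeroPoint v → DistinctSteps v → ∀ A → A 0 ≡ 0 →
    (∀ (J : Fin m) → rankFloor A J ≤ A (suc (toℕ J))) → childrenSum m n v A ≡ parentRHS m n v A
  parent-identity m n v v≢0 distinct A A0≡0 floor≤ = begin
    childrenSum m n v A
      ≡⟨ cong₂ _+_ (singletonChild-statWeight m n v v≢0 A)
                   (Σ-cong (allFin m) (λ J → typeSum m n v v≢0 distinct A A0≡0 J (floor≤ J))) ⟩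
    o * W + Σl (allFin m) (λ J → o * (L * (iJ J * W)) - L * (o * T J))
      ≡⟨ cong (o * W +_) (Σ-- (allFin m) _ _) ⟩
    o * W + (Σl (allFin m) (λ J → o * (L * (iJ J * W))) - Σl (allFin m) (λ J → L * (o * T J)))
      ≡⟨ cong₂ (λ a b → o * W + (a - b)) (Σ-* (allFin m) o _) (Σ-* (allFin m) L _) ⟩
    o * W + (o * Σl (allFin m) (λ J → L * (iJ J * W)) - L * Σl (allFin m) (λ J → o * T J))
      ≡⟨ cong₂ (λ a b → o * W + (o * a - L * b)) (Σ-* (allFin m) L _) (Σ-* (allFin m) o _) ⟩
    o * W + (o * (L * Σl (allFin m) (λ J → iJ J * W)) - L * (o * Σl (allFin m) T))
      ≡⟨ collect o W L (Σl (allFin m) (λ J → iJ J * W)) (Σl (allFin m) T) ⟩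
    parentRHS m n v A ∎
    where
    open ≡-Reasoning
    o = v zero
    L = v (fromℕ m)
    W = statWeight m n v A
    T = lastTermWeight m n v A
    iJ : Fin m → ℚ
    iJ J = inv (v (inject₁ J) - v (suc J))
    collect : ∀ o W L S T → o * W + (o * (L * S) - L * (o * T)) ≡ o * (W + L * S) - L * (o * T)
    collect = solve-∀ ℚring

module Nestings where

  open Booleans
  open FunctionSums using (cons)
  open FinPredicates using (count; count-cong)
  open import Defs
  open import Data.Nat as ℕ using (ℕ; zero; suc; _≤_; _≤ᵇ_)
  import Data.Nat.Properties as NP
  open import Data.Fin as Fin using (Fin; zero; suc; toℕ)
  import Data.Fin.Properties as FP
  open import Data.List using (List; []; _∷_; map; tabulate; allFin; concatMap; filterᵇ; null)
  open import Data.List.Properties using (tabulate-cong)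
  open import Data.Bool using (Bool; true; false; _∧_; if_then_else_)
  open import Data.Bool.Properties using (∧-identityʳ)
  open import Data.Product using (_×_; _,_; proj₁; proj₂; Σ; ∃-syntax)
  open import Data.Sum using (_⊎_; inj₁; inj₂)
  open import Relation.Binary.PropositionalEquality
  open import Relation.Nullary using (¬_)
  open import Data.Empty using (⊥-elim)
  open import Function using (_∘_)
  open import Data.List.Membership.Propositional using (_∈_; find; lose)
  open import Data.List.Relation.Unary.Any using (here; there)
  open import Data.List.Membership.Propositional.Properties using (∈-map⁺; ∈-map⁻; ∈-concatMap⁺; ∈-concatMap⁻; ∈-allFin)

  ∈-filterᵇ⁻ : ∀ {A : Set} (p : A → Bool) {x} (xs : List A) → x ∈ filterᵇ p xs → (x ∈ xs) × (p x ≡ true)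
  ∈-filterᵇ⁻ p (y ∷ ys) x∈ with p y in eq
  ∈-filterᵇ⁻ p (y ∷ ys) (here refl) | true = here refl , eq
  ∈-filterᵇ⁻ p (y ∷ ys) (there x∈)  | true = let x∈ys , px = ∈-filterᵇ⁻ p ys x∈ in there x∈ys , px
  ... | false = let x∈ys , px = ∈-filterᵇ⁻ p ys x∈ in there x∈ys , px

  ∈-filterᵇ⁺ : ∀ {A : Set} (p : A → Bool) {x} (xs : List A) → x ∈ xs → p x ≡ true → x ∈ filterᵇ p xs
  ∈-filterᵇ⁺ p (y ∷ ys) (here refl) px rewrite px = here refl
  ∈-filterᵇ⁺ p (y ∷ ys) (there x∈)  px with p y
  ... | true  = there (∈-filterᵇ⁺ p ys x∈ px)
  ... | false = ∈-filterᵇ⁺ p ys x∈ px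

  allFuns-sound : ∀ {A : Set} k (xs : List A) g → g ∈ allFuns k xs → ∀ i → g i ∈ xs
  allFuns-sound (suc k) xs g g∈ i with find (∈-concatMap⁻ _ {xs = xs} g∈)
  ... | x , x∈ , g∈′ with ∈-map⁻ _ g∈′
  ...   | g′ , g′∈ , refl with i
  ...     | zero   = x∈
  ...     | suc i′ = allFuns-sound k xs g′ g′∈ i′

  allFuns-complete : ∀ {A : Set} k (xs : List A) (f : Fin k → A) → (∀ i → f i ∈ xs) →
    ∃[ g ] (g ∈ allFuns k xs × (∀ i → g i ≡ f i))
  allFuns-complete zero    xs f f∈ = _ , here refl , λ ()
  allFuns-complete (suc k) xs f f∈ with allFuns-complete k xs (f ∘ suc) (f∈ ∘ suc)
  ... | g′ , g′∈ , g′≡ = _ , ∈-concatMap⁺ _ (lose (f∈ zero) (∈-map⁺ _ g′∈)) , λ { zero → refl ; (suc i) → g′≡ i }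

  -- NestingFrom k R i j: R has a (k+1)-nesting whose outermost arc is (i , j).
  NestingFrom : ∀ {n} → ℕ → BRel n → Fin n → Fin n → Set
  NestingFrom zero R i j = IsArcᵇ R (i , j) ≡ true
  NestingFrom {n} (suc k) R i j = (IsArcᵇ R (i , j) ≡ true) ×
    (Σ (Fin n) λ i′ → Σ (Fin n) λ j′ → ((i <ᶠ i′) ≡ true) × ((j′ <ᶠ j) ≡ true) × NestingFrom k R i′ j′)

  NestingFrom-arc : ∀ {n} k (R : BRel n) i j → NestingFrom k R i j → IsArcᵇ R (i , j) ≡ true
  NestingFrom-arc zero    R i j h = h
  NestingFrom-arc (suc k) R i j h = proj₁ h

  NestingFrom-pred : ∀ {n} k (R : BRel n) i j → NestingFrom (suc k) R i j → NestingFrom k R i j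
  NestingFrom-pred zero    R i j h = proj₁ h
  NestingFrom-pred (suc k) R i j (arc , i′ , j′ , i<i′ , j′<j , h) = arc , i′ , j′ , i<i′ , j′<j , NestingFrom-pred k R i′ j′ h

  chain-sound : ∀ {n} k (R : BRel n) (g : Fin (suc k) → Arc n) → (∀ i → IsArcᵇ R (g i) ≡ true) →
    NestedChainᵇ (tabulate g) ≡ true → NestingFrom k R (proj₁ (g zero)) (proj₂ (g zero))
  chain-sound zero    R g arcs chain = arcs zero
  chain-sound (suc k) R g arcs chain =
    let i<i′ , rest = ∧-elim chain in
    let j′<j , chain′ = ∧-elim rest in
    arcs zero , proj₁ (g (suc zero)) , proj₂ (g (suc zero)) , i<i′ , j′<j , chain-sound k R (g ∘ suc) (arcs ∘ suc) chain′

  chain-complete : ∀ {n} k (R : BRel n) i j → NestingFrom k R i j →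
    Σ (Fin (suc k) → Arc n) λ g → (∀ x → IsArcᵇ R (g x) ≡ true) × (NestedChainᵇ (tabulate g) ≡ true) × (g zero ≡ (i , j))
  chain-complete zero    R i j h = (λ _ → (i , j)) , (λ _ → h) , refl , refl
  chain-complete (suc k) R i j (arc , i′ , j′ , i<i′ , j′<j , h) with chain-complete k R i′ j′ h
  ... | g′ , arcs′ , chain′ , g′₀ = cons (i , j) g′ , (λ { zero → arc ; (suc x) → arcs′ x }) , chain , refl
    where
    chain : NestedChainᵇ (tabulate (cons (i , j) g′)) ≡ true
    chain rewrite g′₀ = ∧-intro i<i′ (∧-intro j′<j chain′)

  ∈-arcs : ∀ {n} (R : BRel n) a → IsArcᵇ R a ≡ true → a ∈ arcs R
  ∈-arcs {n} R (i , j) arc = ∈-filterᵇ⁺ (IsArcᵇ R) pairs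
    (∈-concatMap⁺ (λ i → map (λ j → (i , j)) (allFin n)) (lose (∈-allFin i) (∈-map⁺ (λ j → (i , j)) (∈-allFin j)))) arc
    where pairs = concatMap (λ i → map (λ j → (i , j)) (allFin n)) (allFin n)

  nestings-sound : ∀ {n} k (R : BRel n) L → L ∈ nestings (suc k) R →
    ∃[ i ] ∃[ j ] (NestingFrom k R i j × smallestVertex L ≡ toℕ i)
  nestings-sound {n} k R L L∈ with ∈-filterᵇ⁻ NestedChainᵇ (map tabulate (allFuns (suc k) (arcs R))) L∈
  ... | L∈′ , chain with ∈-map⁻ tabulate L∈′
  ...   | g , g∈ , L≡ = proj₁ (g zero) , proj₂ (g zero) ,
            chain-sound k R g (λ x → proj₂ (∈-filterᵇ⁻ (IsArcᵇ R) pairs (allFuns-sound (suc k) (arcs R) g g∈ x)))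
                        (trans (cong NestedChainᵇ (sym L≡)) chain) ,
            cong smallestVertex L≡
    where pairs = concatMap (λ i → map (λ j → (i , j)) (allFin n)) (allFin n)

  nestings-complete : ∀ {n} k (R : BRel n) i j → NestingFrom k R i j →
    ∃[ L ] (L ∈ nestings (suc k) R × smallestVertex L ≡ toℕ i)
  nestings-complete k R i j h with chain-complete k R i j h
  ... | g , arcs′ , chain , g₀ with allFuns-complete (suc k) (arcs R) g (λ x → ∈-arcs R (g x) (arcs′ x))
  ...   | g′ , g′∈ , g′≡ = tabulate g′ ,
            ∈-filterᵇ⁺ NestedChainᵇ (map tabulate (allFuns (suc k) (arcs R))) (∈-map⁺ tabulate g′∈)
                       (trans (cong NestedChainᵇ (tabulate-cong g′≡)) chain) ,
            cong (λ a → toℕ (proj₁ a)) (trans (g′≡ zero) g₀)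

  noNesting-true : ∀ {n} m (R : BRel n) → (∀ i j → ¬ NestingFrom m R i j) → NoNestingᵇ m R ≡ true
  noNesting-true m R none with nestings (suc m) R in eq
  ... | [] = refl
  ... | L ∷ Ls with nestings-sound m R L (subst (L ∈_) (sym eq) (here refl))
  ...   | i , j , h , _ = ⊥-elim (none i j h)

  noNesting-false : ∀ {n} m (R : BRel n) i j → NestingFrom m R i j → NoNestingᵇ m R ≡ false
  noNesting-false m R i j h with nestings-complete m R i j h
  ... | L , L∈ , _ with nestings (suc m) R
  ...   | L′ ∷ Ls = refl

  noNesting-false⁻ : ∀ {n} m (R : BRel n) → NoNestingᵇ m R ≡ false → Σ (Fin n) λ i → Σ (Fin n) λ j → NestingFrom m R i j
  noNesting-false⁻ m R e with nestings (suc m) R in eq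
  ... | L ∷ Ls with nestings-sound m R L (subst (L ∈_) (sym eq) (here refl))
  ...   | i , j , h , _ = i , j , h

  maxℕ-ub : ∀ {X : Set} (f : X → ℕ) (L : List X) x → x ∈ L → f x ≤ maxℕ (map f L)
  maxℕ-ub f (y ∷ L) x (here refl) = NP.m≤m⊔n (f x) _
  maxℕ-ub f (y ∷ L) x (there x∈)  = NP.≤-trans (maxℕ-ub f L x x∈) (NP.m≤n⊔m (f y) _)

  maxℕ-attained : ∀ {X : Set} (f : X → ℕ) (y : X) (L : List X) → ∃[ x ] (x ∈ (y ∷ L) × f x ≡ maxℕ (map f (y ∷ L)))
  maxℕ-attained f y [] = y , here refl , sym (NP.⊔-identityʳ (f y))
  maxℕ-attained f y (z ∷ L) with maxℕ-attained f z L | NP.⊔-sel (f y) (maxℕ (map f (z ∷ L)))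
  ... | x , x∈ , e | inj₁ s = y , here refl , sym s
  ... | x , x∈ , e | inj₂ s = x , there x∈ , trans e (sym s)

  -- threshold k R is 0 if R has no (k+1)-nesting, and otherwise 1 + the largest (0-based) smallest vertex of one,
  -- so that a_{k+1}(R) = 1 + #{block maxima b with threshold k R ≤ b}.
  threshold : ∀ {n} → ℕ → BRel n → ℕ
  threshold k R = if null (nestings (suc k) R) then 0 else suc (maxℕ (map smallestVertex (nestings (suc k) R)))

  aStat-threshold : ∀ {n} k (R : BRel n) →
    aStat (suc k) R ≡ suc (count (λ i → IsBlockMaxᵇ R i ∧ (threshold k R ≤ᵇ toℕ i)))
  aStat-threshold k R with null (nestings (suc k) R)
  ... | true  = cong suc (count-cong (λ i → sym (∧-identityʳ (IsBlockMaxᵇ R i))))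
  ... | false = refl

  IsThreshold : ∀ {n} → ℕ → BRel n → ℕ → Set
  IsThreshold {n} k R t = ((t ≡ 0) × (∀ i j → ¬ NestingFrom k R i j))
    ⊎ (Σ ℕ λ μ → (t ≡ suc μ) × (Σ (Fin n) λ i → Σ (Fin n) λ j → (toℕ i ≡ μ) × NestingFrom k R i j)
                             × (∀ i j → NestingFrom k R i j → toℕ i ≤ μ))

  threshold-isThreshold : ∀ {n} k (R : BRel n) → IsThreshold k R (threshold k R)
  threshold-isThreshold k R with null (nestings (suc k) R) in eq
  ... | true  = inj₁ (refl , λ i j h → let L , L∈ , _ = nestings-complete k R i j h in ∉[] (subst (L ∈_) (null⇒[] _ eq) L∈))
    where
    null⇒[] : ∀ {A : Set} (L : List A) → null L ≡ true → L ≡ []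
    null⇒[] [] _ = refl
    ∉[] : ∀ {A : Set} {x : A} → ¬ x ∈ []
    ∉[] ()
  ... | false = inj₂ (_ , refl , attained (nestings (suc k) R) eq refl , bound)
    where
    μ = maxℕ (map smallestVertex (nestings (suc k) R))
    attained : ∀ Ls → null Ls ≡ false → Ls ≡ nestings (suc k) R →
      Σ (Fin _) λ i → Σ (Fin _) λ j → (toℕ i ≡ μ) × NestingFrom k R i j
    attained (L₀ ∷ Ls) _ e with maxℕ-attained smallestVertex L₀ Ls
    ... | L , L∈ , L-max with nestings-sound k R L (subst (L ∈_) e L∈)
    ...   | i , j , h , s = i , j , trans (sym s) (trans L-max (cong (maxℕ ∘ map smallestVertex) e)) , h
    bound : ∀ i j → NestingFrom k R i j → toℕ i ≤ μ
    bound i j h with nestings-complete k R i j h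
    ... | L , L∈ , s = subst (_≤ _) s (maxℕ-ub smallestVertex _ L L∈)

  IsThreshold-unique : ∀ {n} k (R : BRel n) t t′ → IsThreshold k R t → IsThreshold k R t′ → t ≡ t′
  IsThreshold-unique k R t t′ (inj₁ (t≡0 , _)) (inj₁ (t′≡0 , _)) = trans t≡0 (sym t′≡0)
  IsThreshold-unique k R t t′ (inj₁ (_ , none)) (inj₂ (_ , _ , (i , j , _ , h) , _)) = ⊥-elim (none i j h)
  IsThreshold-unique k R t t′ (inj₂ (_ , _ , (i , j , _ , h) , _)) (inj₁ (_ , none)) = ⊥-elim (none i j h)
  IsThreshold-unique k R t t′ (inj₂ (μ , t≡ , (i , j , i≡ , h) , ub)) (inj₂ (μ′ , t′≡ , (i′ , j′ , i′≡ , h′) , ub′)) =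
    trans t≡ (trans (cong suc (NP.≤-antisym (subst (_≤ μ′) i≡ (ub′ i j h)) (subst (_≤ μ) i′≡ (ub i′ j′ h′)))) (sym t′≡))

  IsThreshold⇒threshold : ∀ {n} k (R : BRel n) t → IsThreshold k R t → threshold k R ≡ t
  IsThreshold⇒threshold k R t = IsThreshold-unique k R _ _ (threshold-isThreshold k R)

  threshold-suc-≤ : ∀ {n} k (R : BRel n) → threshold (suc k) R ≤ threshold k R
  threshold-suc-≤ k R with threshold-isThreshold (suc k) R | threshold-isThreshold k R
  ... | inj₁ (e , _) | _ rewrite e = ℕ.z≤n
  ... | inj₂ (_ , _ , (i , j , _ , h) , _) | inj₁ (_ , none) = ⊥-elim (none i j (NestingFrom-pred k R i j h))
  ... | inj₂ (μ′ , e′ , (i , j , i≡ , h) , _) | inj₂ (μ , e , _ , ub) rewrite e′ | e =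
    ℕ.s≤s (subst (_≤ μ) i≡ (ub i j (NestingFrom-pred k R i j h)))

  threshold-≤ : ∀ {n} k (R : BRel n) → threshold k R ≤ n
  threshold-≤ {n} k R with threshold-isThreshold k R
  ... | inj₁ (e , _) rewrite e = ℕ.z≤n
  ... | inj₂ (μ , e , (i , j , i≡ , h) , _) rewrite e = subst (λ z → suc z ≤ n) i≡ (FP.toℕ<n i)

module Extension where

  open Booleans
  open FunctionSums
  open FinPredicates
  open import Defs
  open import Data.Nat as ℕ using (ℕ; zero; suc)
  import Data.Nat.Properties as NP
  open import Data.Fin as Fin using (Fin; zero; suc; inject₁; fromℕ)
  import Data.Fin.Properties as FP
  open import Data.List using (allFin)
  open import Data.Bool using (Bool; true; false; _∧_; _∨_; not)
  open import Data.Product using (_×_; _,_)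
  open import Relation.Binary.PropositionalEquality

  -- extend M c r x is the relation on [n+1] which is M on [n], has column c and row r at the new element n+1,
  -- and x on the diagonal there.
  extend : ∀ {n} → BRel n → (Fin n → Bool) → (Fin n → Bool) → Bool → BRel (suc n)
  extend M c r x = snoc (λ i → snoc (M i) (c i)) (snoc r x)

  module _ {n} (M : BRel n) (c r : Fin n → Bool) (x : Bool) where
    extend-old-old : ∀ i j → extend M c r x (inject₁ i) (inject₁ j) ≡ M i j
    extend-old-old i j =
      trans (cong (λ f → f (inject₁ j)) (snoc-inject₁ (λ i → snoc (M i) (c i)) (snoc r x) i)) (snoc-inject₁ (M i) (c i) j)
    extend-old-new : ∀ i → extend M c r x (inject₁ i) (fromℕ n) ≡ c i
    extend-old-new i =
      trans (cong (λ f → f (fromℕ n)) (snoc-inject₁ (λ i → snoc (M i) (c i)) (snoc r x) i)) (snoc-last (M i) (c i))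
    extend-new-old : ∀ j → extend M c r x (fromℕ n) (inject₁ j) ≡ r j
    extend-new-old j =
      trans (cong (λ f → f (inject₁ j)) (snoc-last (λ i → snoc (M i) (c i)) (snoc r x))) (snoc-inject₁ r x j)
    extend-new-new : extend M c r x (fromℕ n) (fromℕ n) ≡ x
    extend-new-new =
      trans (cong (λ f → f (fromℕ n)) (snoc-last (λ i → snoc (M i) (c i)) (snoc r x))) (snoc-last r x)

  data View {n} : Fin (suc n) → Set where
    old : (i : Fin n) → View (inject₁ i)
    new : View (fromℕ n)

  view : ∀ {n} (i : Fin (suc n)) → View i
  view {zero}  zero    = new
  view {suc n} zero    = old zero
  view {suc n} (suc i) with view i
  ... | old j = old (suc j)
  ... | new   = new

  <ᶠ-inject₁ : ∀ {n} (i j : Fin n) → (inject₁ i <ᶠ inject₁ j) ≡ (i <ᶠ j)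
  <ᶠ-inject₁ i j rewrite FP.toℕ-inject₁ i | FP.toℕ-inject₁ j = refl

  inject₁-<ᶠ-last : ∀ {n} (i : Fin n) → (inject₁ i <ᶠ fromℕ n) ≡ true
  inject₁-<ᶠ-last {n} i rewrite FP.toℕ-inject₁ i | FP.toℕ-fromℕ n = <ᵇ-true (FP.toℕ<n i)

  last-<ᶠ : ∀ {n} (j : Fin (suc n)) → (fromℕ n <ᶠ j) ≡ false
  last-<ᶠ {n} j rewrite FP.toℕ-fromℕ n = <ᵇ-false (NP.≤⇒≯ (ℕ.s≤s⁻¹ (FP.toℕ<n j)))

  ≮ᶠ-antisym : ∀ {n} (a b : Fin n) → (a <ᶠ b) ≡ false → (b <ᶠ a) ≡ false → a ≡ b
  ≮ᶠ-antisym a b a≮b b≮a = FP.toℕ-injective (NP.≤-antisym (NP.≮⇒≥ (<ᵇ-false⇒ b≮a)) (NP.≮⇒≥ (<ᵇ-false⇒ a≮b)))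

  Equivalence : ∀ {n} → BRel n → Set
  Equivalence R = (∀ i → R i i ≡ true)
                × (∀ i j → R i j ≡ true → R j i ≡ true)
                × (∀ i j k → R i j ≡ true → R j k ≡ true → R i k ≡ true)

  module _ {n} (R : BRel n) where
    private
      fs = allFin n
      Refl = λ (i : Fin n) → R i i
      Sym = λ (i : Fin n) → all (λ j → not (R i j) ∨ R j i) fs
      Trans = λ (i : Fin n) → all (λ j → all (λ k → not (R i j ∧ R j k) ∨ R i k) fs) fs

    isEquivᵇ-sound : IsEquivᵇ R ≡ true → Equivalence R
    isEquivᵇ-sound e =
      let refl′ , rest = ∧-elim {all Refl fs} {all Sym fs ∧ all Trans fs} e in
      let sym′ , trans′ = ∧-elim {all Sym fs} {all Trans fs} rest in
      (λ i → all-allFin-true Refl refl′ i) ,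
      (λ i j h → impl-elim (R i j) (R j i) (all-allFin-true (λ j → not (R i j) ∨ R j i) (all-allFin-true Sym sym′ i) j) h) ,
      (λ i j k h₁ h₂ → impl-elim (R i j ∧ R j k) (R i k)
        (all-allFin-true (λ k → not (R i j ∧ R j k) ∨ R i k)
          (all-allFin-true (λ j → all (λ k → not (R i j ∧ R j k) ∨ R i k) fs) (all-allFin-true Trans trans′ i) j) k)
        (∧-intro h₁ h₂))

    isEquivᵇ-complete : Equivalence R → IsEquivᵇ R ≡ true
    isEquivᵇ-complete (rf , sy , tr) =
      ∧-intro (all-allFin-intro Refl rf)
        (∧-intro (all-allFin-intro Sym (λ i → all-allFin-intro _ (λ j → impl-intro (R i j) (R j i) (sy i j))))
          (all-allFin-intro Trans (λ i → all-allFin-intro (λ j → all (λ k → not (R i j ∧ R j k) ∨ R i k) fs)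
            (λ j → all-allFin-intro (λ k → not (R i j ∧ R j k) ∨ R i k)
              (λ k → impl-intro (R i j ∧ R j k) (R i k) (λ h → let a , b = ∧-elim {R i j} {R j k} h in tr i j k a b))))))

  -- c is a union of blocks of M.
  Closed : ∀ {n} → BRel n → (Fin n → Bool) → Set
  Closed M c = (∀ i j → c i ≡ true → c j ≡ true → M i j ≡ true) × (∀ i j → M i j ≡ true → c j ≡ true → c i ≡ true)

  private
    transport : ∀ {a b : Bool} → a ≡ b → a ≡ true → b ≡ true
    transport e h = trans (sym e) h

  extend-Equivalence⁻ : ∀ {n} (M : BRel n) c r x →
    Equivalence (extend M c r x) → Equivalence M × (x ≡ true) × (∀ i → r i ≡ c i) × Closed M c
  extend-Equivalence⁻ {n} M c r x (rf , sy , tr) =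
    ((λ i → transport (oo i i) (rf _)) ,
     (λ i j h → transport (oo j i) (sy _ _ (transport (sym (oo i j)) h))) ,
     (λ i j k h₁ h₂ → transport (oo i k) (tr _ _ _ (transport (sym (oo i j)) h₁) (transport (sym (oo j k)) h₂)))) ,
    transport nn (rf _) ,
    (λ i → Bool-ext (λ h → transport (on i) (sy _ _ (transport (sym (no i)) h)))
                    (λ h → transport (no i) (sy _ _ (transport (sym (on i)) h)))) ,
    ((λ i j ci cj → transport (oo i j) (tr _ (fromℕ n) _ (transport (sym (on i)) ci) (transport (sym (no j)) (transport (c≡r j) cj)))) ,
     (λ i j mij cj → transport (on i) (tr _ _ (fromℕ n) (transport (sym (oo i j)) mij) (transport (sym (on j)) cj))))
    where
    oo = extend-old-old M c r x
    on = extend-old-new M c r x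
    no = extend-new-old M c r x
    nn = extend-new-new M c r x
    c≡r : ∀ j → c j ≡ r j
    c≡r j = Bool-ext (λ h → transport (no j) (sy _ _ (transport (sym (on j)) h)))
                     (λ h → transport (on j) (sy _ _ (transport (sym (no j)) h)))

  extend-Equivalence⁺ : ∀ {n} (M : BRel n) c → Equivalence M → Closed M c → Equivalence (extend M c c true)
  extend-Equivalence⁺ {n} M c (rf , sy , tr) (closed₁ , closed₂) = reflexive , symmetric , transitive
    where
    R = extend M c c true
    oo = extend-old-old M c c true
    on = extend-old-new M c c true
    no = extend-new-old M c c true
    nn = extend-new-new M c c true
    back : ∀ {a b : Bool} → a ≡ b → b ≡ true → a ≡ true
    back e h = trans e h
    reflexive : ∀ i → R i i ≡ true
    reflexive i with view i
    ... | old i′ = back (oo i′ i′) (rf i′)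
    ... | new    = nn
    symmetric : ∀ i j → R i j ≡ true → R j i ≡ true
    symmetric i j h with view i | view j
    ... | old i′ | old j′ = back (oo j′ i′) (sy _ _ (transport (oo i′ j′) h))
    ... | old i′ | new    = back (no i′) (transport (on i′) h)
    ... | new    | old j′ = back (on j′) (transport (no j′) h)
    ... | new    | new    = h
    transitive : ∀ i j k → R i j ≡ true → R j k ≡ true → R i k ≡ true
    transitive i j k h₁ h₂ with view i | view j | view k
    ... | old i′ | old j′ | old k′ = back (oo i′ k′) (tr _ _ _ (transport (oo i′ j′) h₁) (transport (oo j′ k′) h₂))
    ... | old i′ | old j′ | new    = back (on i′) (closed₂ i′ j′ (transport (oo i′ j′) h₁) (transport (on j′) h₂))
    ... | old i′ | new    | old k′ = back (oo i′ k′) (closed₁ i′ k′ (transport (on i′) h₁) (transport (no k′) h₂))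
    ... | old i′ | new    | new    = h₁
    ... | new    | old j′ | old k′ = back (no k′) (closed₂ k′ j′ (sy _ _ (transport (oo j′ k′) h₂)) (transport (no j′) h₁))
    ... | new    | old j′ | new    = nn
    ... | new    | new    | old k′ = h₂
    ... | new    | new    | new    = nn

module Blocks where

  open Booleans
  open ListSums
  open FunctionSums
  open FinPredicates
  open Extension
  open import Defs
  open import Data.Nat as ℕ using (ℕ; zero; suc; _≤_)
  import Data.Nat.Properties as NP
  open import Data.Fin as Fin using (Fin; zero; suc; toℕ; inject₁; fromℕ)
  import Data.Fin.Properties as FP
  open import Data.List using (allFin)
  open import Data.Bool using (Bool; true; false; _∧_; not)
  open import Data.Bool.Properties using (∧-zeroʳ)
  open import Data.Product using (_×_; _,_; proj₁; proj₂; Σ)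
  open import Data.Sum using (_⊎_; inj₁; inj₂)
  open import Data.Rational using (0ℚ; _+_)
  open import Data.Rational.Properties using (+-identityʳ; +-identityˡ)
  open import Relation.Binary.PropositionalEquality
  open import Data.Empty using (⊥-elim)
  open import Function using (_∘_)

  blockMax-elim : ∀ {n} (M : BRel n) b k → IsBlockMaxᵇ M b ≡ true → M b k ≡ true → (b <ᶠ k) ≡ false
  blockMax-elim M b k max Mbk =
    not-true (subst (λ z → not (z ∧ (b <ᶠ k)) ≡ true) Mbk (all-allFin-true (λ k → not (M b k ∧ (b <ᶠ k))) max k))

  blockMax-intro : ∀ {n} (M : BRel n) b → (∀ k → M b k ≡ true → (b <ᶠ k) ≡ false) → IsBlockMaxᵇ M b ≡ true
  blockMax-intro M b max = all-allFin-intro (λ k → not (M b k ∧ (b <ᶠ k))) (λ k → atK k (M b k) refl)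
    where
    atK : ∀ k a → M b k ≡ a → not (a ∧ (b <ᶠ k)) ≡ true
    atK k true  e rewrite max k e = refl
    atK k false e = refl

  lastTrue : ∀ {n} (p : Fin n → Bool) i₀ → p i₀ ≡ true →
    Σ (Fin n) λ b → (p b ≡ true) × (∀ k → p k ≡ true → toℕ k ≤ toℕ b)
  lastTrue {suc n} p i₀ pi₀ with p (fromℕ n) in eq
  ... | true = fromℕ n , eq , λ k _ → subst (toℕ k ≤_) (sym (FP.toℕ-fromℕ n)) (ℕ.s≤s⁻¹ (FP.toℕ<n k))
  ... | false with view i₀
  ...   | new = ⊥-elim (true≢false (trans (sym pi₀) eq))
  ...   | old i′ with lastTrue (p ∘ inject₁) i′ pi₀
  ...     | b , pb , b-max = inject₁ b , pb , bound
    where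
    bound : ∀ k → p k ≡ true → toℕ k ≤ toℕ (inject₁ b)
    bound k pk with view k
    ... | old k′ = subst₂ _≤_ (sym (FP.toℕ-inject₁ k′)) (sym (FP.toℕ-inject₁ b)) (b-max k′ pk)
    ... | new    = ⊥-elim (true≢false (trans (sym pk) eq))

  ∅ : ∀ {n} → Fin n → Bool
  ∅ _ = false

  module ClosedSets {n} (M : BRel n) (eqM : Equivalence M) where
    private
      rf = proj₁ eqM
      sy = proj₁ (proj₂ eqM)
      tr = proj₂ (proj₂ eqM)

    block-closed : ∀ b → Closed M (M b)
    block-closed b = (λ i j ci cj → tr _ _ _ (sy _ _ ci) cj) , (λ i j mij cj → tr _ _ _ cj (sy _ _ mij))

    ∅-closed : Closed M ∅
    ∅-closed = (λ i j ()) , (λ i j _ ())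

    closed-resp : ∀ {c c′ : Fin n → Bool} → (∀ i → c i ≡ c′ i) → Closed M c → Closed M c′
    closed-resp c≡c′ (closed₁ , closed₂) =
      (λ i j a b → closed₁ i j (trans (c≡c′ i) a) (trans (c≡c′ j) b)) ,
      (λ i j m b → trans (sym (c≡c′ i)) (closed₂ i j m (trans (c≡c′ j) b)))

    blockOf : ∀ c i₀ → Closed M c → c i₀ ≡ true → Σ (Fin n) λ b → (IsBlockMaxᵇ M b ≡ true) × (∀ j → c j ≡ M b j)
    blockOf c i₀ (closed₁ , closed₂) ci₀ with lastTrue (M i₀) i₀ (rf i₀)
    ... | b , Mi₀b , b-max =
      b , blockMax-intro M b isMax , λ j → Bool-ext (λ cj → sy _ _ (closed₁ j b cj cb)) (λ Mbj → closed₂ j b (sy _ _ Mbj) cb)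
      where
      cb : c b ≡ true
      cb = closed₂ b i₀ (sy _ _ Mi₀b) ci₀
      isMax : ∀ k → M b k ≡ true → (b <ᶠ k) ≡ false
      isMax k Mbk with b <ᶠ k in eq
      ... | false = refl
      ... | true  = ⊥-elim (NP.<⇒≱ (<ᵇ-true⇒ (toℕ b) (toℕ k) eq) (b-max k (tr _ _ _ Mi₀b Mbk)))

    closed-cases : ∀ c → Closed M c →
      (∀ j → c j ≡ false) ⊎ (Σ (Fin n) λ b → (IsBlockMaxᵇ M b ≡ true) × (∀ j → c j ≡ M b j))
    closed-cases c closed with all (λ j → not (c j)) (allFin n) in eq
    ... | true  = inj₁ (λ j → not-true (all-allFin-true (λ j → not (c j)) eq j))
    ... | false with all-allFin-false (λ j → not (c j)) eq
    ...   | j , not-cj = inj₂ (blockOf c j closed (not-false not-cj))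
      where
      not-false : ∀ {a} → not a ≡ false → a ≡ true
      not-false {true} _ = refl

    blockMax-unique : ∀ (c : Fin n → Bool) b b₀ → IsBlockMaxᵇ M b ≡ true → IsBlockMaxᵇ M b₀ ≡ true →
      (∀ j → c j ≡ M b j) → (∀ j → c j ≡ M b₀ j) → b ≡ b₀
    blockMax-unique c b b₀ max max₀ c≡ c≡₀ =
      ≮ᶠ-antisym b b₀ (blockMax-elim M b b₀ max Mbb₀) (blockMax-elim M b₀ b max₀ Mb₀b)
      where
      Mbb₀ : M b b₀ ≡ true
      Mbb₀ = trans (sym (c≡ b₀)) (trans (c≡₀ b₀) (rf b₀))
      Mb₀b : M b₀ b ≡ true
      Mb₀b = trans (sym (c≡₀ b)) (trans (c≡ b) (rf b))

    extend-isEquivᵇ⁻ : ∀ c → IsEquivᵇ (extend M c c true) ≡ true → Closed M c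
    extend-isEquivᵇ⁻ c h = proj₂ (proj₂ (proj₂ (extend-Equivalence⁻ M c c true (isEquivᵇ-sound _ h))))

    extend-isEquivᵇ⁺ : ∀ c → Closed M c → IsEquivᵇ (extend M c c true) ≡ true
    extend-isEquivᵇ⁺ c closed = isEquivᵇ-complete _ (extend-Equivalence⁺ M c eqM closed)

    -- The column of an equivalence extension is empty or exactly one block.
    isEquivᵇ-extend-split : ∀ c y → ite (IsEquivᵇ (extend M c c true)) y
      ≡ ite (eqVec c ∅) y + Σl (allFin n) (λ b → ite (IsBlockMaxᵇ M b ∧ eqVec c (M b)) y)
    isEquivᵇ-extend-split c y with IsEquivᵇ (extend M c c true) in eq
    ... | true with closed-cases c (extend-isEquivᵇ⁻ c eq)
    ...   | inj₁ c-empty rewrite eqVec-complete c ∅ c-empty =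
      sym (trans (cong (y +_) (Σ-ite-none n _ (λ _ → y) notBlock)) (+-identityʳ y))
      where
      notBlock : ∀ b → (IsBlockMaxᵇ M b ∧ eqVec c (M b)) ≡ false
      notBlock b with eqVec c (M b) in e
      ... | false = ∧-zeroʳ _
      ... | true  = ⊥-elim (true≢false (sym (trans (sym (c-empty b)) (trans (eqVec-sound c (M b) e b) (rf b)))))
    ...   | inj₂ (b₀ , max₀ , c≡₀) =
      sym (trans (cong₂ _+_ notEmpty (Σ-ite-unique n _ (λ _ → y) b₀ (∧-intro max₀ (eqVec-complete c (M b₀) c≡₀)) unique))
                 (+-identityˡ y))
      where
      notEmpty : ite (eqVec c ∅) y ≡ 0ℚ
      notEmpty with eqVec c ∅ in e
      ... | false = refl
      ... | true  = ⊥-elim (true≢false (sym (trans (sym (eqVec-sound c ∅ e b₀)) (trans (c≡₀ b₀) (rf b₀)))))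
      unique : ∀ b → (IsBlockMaxᵇ M b ∧ eqVec c (M b)) ≡ true → b ≡ b₀
      unique b h = let max , c≡ = ∧-elim {IsBlockMaxᵇ M b} h in blockMax-unique c b b₀ max max₀ (eqVec-sound c (M b) c≡) c≡₀
    isEquivᵇ-extend-split c y | false =
      sym (trans (cong₂ _+_ notEmpty (Σ-ite-none n (λ b → IsBlockMaxᵇ M b ∧ eqVec c (M b)) (λ _ → y) notBlock)) (+-identityʳ 0ℚ))
      where
      notEmpty : ite (eqVec c ∅) y ≡ 0ℚ
      notEmpty with eqVec c ∅ in e
      ... | false = refl
      ... | true  = ⊥-elim (true≢false (trans (sym (extend-isEquivᵇ⁺ c (closed-resp (λ i → sym (eqVec-sound c ∅ e i)) ∅-closed))) eq))
      notBlock : ∀ b → (IsBlockMaxᵇ M b ∧ eqVec c (M b)) ≡ false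
      notBlock b with IsBlockMaxᵇ M b | eqVec c (M b) in e
      ... | false | _     = refl
      ... | true  | false = refl
      ... | true  | true  =
        ⊥-elim (true≢false (trans (sym (extend-isEquivᵇ⁺ c (closed-resp (λ i → sym (eqVec-sound c (M b) e i)) (block-closed b)))) eq))

module PointwiseEqual where

  open Booleans
  open FinPredicates
  open Nestings
  open Extension
  open import Defs
  open import Data.Nat as ℕ using (zero; suc; _≤ᵇ_)
  open import Data.Fin as Fin using (toℕ)
  open import Data.List using (List; []; _∷_; map; tabulate; allFin; concatMap; filterᵇ; null)
  open import Data.Bool using (Bool; true; false; _∧_; not; if_then_else_)
  open import Data.Product using (_,_)
  open import Relation.Binary.PropositionalEquality

  _≐_ : ∀ {n} → BRel n → BRel n → Set
  R ≐ R′ = ∀ i j → R i j ≡ R′ i j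

  filterᵇ-cong : ∀ {A : Set} {p q : A → Bool} (xs : List A) → (∀ x → p x ≡ q x) → filterᵇ p xs ≡ filterᵇ q xs
  filterᵇ-cong [] p≡q = refl
  filterᵇ-cong {p = p} {q} (x ∷ xs) p≡q rewrite p≡q x with q x
  ... | true  = cong (x ∷_) (filterᵇ-cong xs p≡q)
  ... | false = filterᵇ-cong xs p≡q

  module _ {n} {R R′ : BRel n} (R≐R′ : R ≐ R′) where
    isArc-resp : ∀ a → IsArcᵇ R a ≡ IsArcᵇ R′ a
    isArc-resp (i , j) = cong₂ (λ u w → (i <ᶠ j) ∧ u ∧ w) (R≐R′ i j)
      (all-cong (allFin n) (λ k → cong (λ z → not ((i <ᶠ k) ∧ (k <ᶠ j) ∧ z)) (R≐R′ i k)))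

    arcs-resp : arcs R ≡ arcs R′
    arcs-resp = filterᵇ-cong (concatMap (λ i → map (λ j → (i , j)) (allFin n)) (allFin n)) isArc-resp

    nestings-resp : ∀ k → nestings k R ≡ nestings k R′
    nestings-resp k = cong (λ L → filterᵇ NestedChainᵇ (map tabulate (allFuns k L))) arcs-resp

    blockMax-resp : ∀ i → IsBlockMaxᵇ R i ≡ IsBlockMaxᵇ R′ i
    blockMax-resp i = all-cong (allFin n) (λ k → cong (λ z → not (z ∧ (i <ᶠ k))) (R≐R′ i k))

    threshold-resp : ∀ k → threshold k R ≡ threshold k R′
    threshold-resp k = cong (λ L → if null L then 0 else suc (maxℕ (map smallestVertex L))) (nestings-resp (suc k))

    aStat-resp : ∀ k → aStat (suc k) R ≡ aStat (suc k) R′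
    aStat-resp k = trans (aStat-threshold k R)
      (trans (cong suc (count-cong (λ i → cong₂ (λ a b → a ∧ (b ≤ᵇ toℕ i)) (blockMax-resp i) (threshold-resp k))))
             (sym (aStat-threshold k R′)))

    noNesting-resp : ∀ m → NoNestingᵇ m R ≡ NoNestingᵇ m R′
    noNesting-resp m = cong null (nestings-resp (suc m))

    aExt-resp : ∀ k → aExt R k ≡ aExt R′ k
    aExt-resp zero    = refl
    aExt-resp (suc k) = aStat-resp k

  Equivalence-resp : ∀ {n} {R R′ : BRel n} → R ≐ R′ → Equivalence R → Equivalence R′
  Equivalence-resp R≐R′ (rf , sy , tr) =
    (λ i → move (R≐R′ i i) (rf i)) ,
    (λ i j h → move (R≐R′ j i) (sy i j (move (sym (R≐R′ i j)) h))) ,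
    (λ i j k h₁ h₂ → move (R≐R′ i k) (tr i j k (move (sym (R≐R′ i j)) h₁) (move (sym (R≐R′ j k)) h₂)))
    where
    move : ∀ {a b : Bool} → a ≡ b → a ≡ true → b ≡ true
    move e h = trans (sym e) h

  isEquivᵇ-resp : ∀ {n} {R R′ : BRel n} → R ≐ R′ → IsEquivᵇ R ≡ IsEquivᵇ R′
  isEquivᵇ-resp {R = R} {R′} R≐R′ =
    Bool-ext (λ h → isEquivᵇ-complete R′ (Equivalence-resp R≐R′ (isEquivᵇ-sound R h)))
             (λ h → isEquivᵇ-complete R (Equivalence-resp (λ i j → sym (R≐R′ i j)) (isEquivᵇ-sound R′ h)))

module ExtensionNestings where

  open Booleans
  open FinPredicates
  open Nestings
  open Extension
  open Blocks using (blockMax-elim)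
  open import Defs
  open import Data.Nat as ℕ using (ℕ; zero; suc; _≤_; _<_; _⊔_)
  import Data.Nat.Properties as NP
  open import Data.Fin as Fin using (Fin; zero; suc; toℕ; inject₁; fromℕ)
  import Data.Fin.Properties as FP
  open import Data.List using (allFin)
  open import Data.Bool using (Bool; true; false; _∧_; not)
  open import Data.Bool.Properties using (∧-identityʳ; ∧-zeroʳ; ∧-comm)
  open import Data.Product using (_×_; _,_; proj₁; proj₂; Σ)
  open import Data.Sum using (_⊎_; inj₁; inj₂)
  open import Data.Unit using (⊤)
  open import Relation.Binary.PropositionalEquality
  open import Relation.Nullary using (yes; no; ¬_)
  open import Data.Empty using (⊥; ⊥-elim)

  NestingRightOf : ∀ {n} → ℕ → BRel n → Fin n → Set
  NestingRightOf {n} k M b = Σ (Fin n) λ i′ → Σ (Fin n) λ j′ → ((b <ᶠ i′) ≡ true) × NestingFrom k M i′ j′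

  module ExtArcs {n} (M : BRel n) (c r : Fin n → Bool) (x : Bool) where
    R = extend M c r x
    oo = extend-old-old M c r x
    on = extend-old-new M c r x

    arc-old-old : ∀ i j → IsArcᵇ R (inject₁ i , inject₁ j) ≡ IsArcᵇ M (i , j)
    arc-old-old i j = cong₂ _∧_ (<ᶠ-inject₁ i j)
      (cong₂ _∧_ (oo i j) (trans (all-allFin-last n P) (trans (cong₂ _∧_ (all-cong (allFin n) onOld) atNew) (∧-identityʳ _))))
      where
      P : Fin (suc n) → Bool
      P k = not ((inject₁ i <ᶠ k) ∧ (k <ᶠ inject₁ j) ∧ R (inject₁ i) k)
      onOld : ∀ k → P (inject₁ k) ≡ not ((i <ᶠ k) ∧ (k <ᶠ j) ∧ M i k)
      onOld k rewrite <ᶠ-inject₁ i k | <ᶠ-inject₁ k j | oo i k = refl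
      atNew : P (fromℕ n) ≡ true
      atNew rewrite last-<ᶠ (inject₁ j) = cong not (∧-zeroʳ (inject₁ i <ᶠ fromℕ n))

    arc-old-new : ∀ i → IsArcᵇ R (inject₁ i , fromℕ n) ≡ (c i ∧ IsBlockMaxᵇ M i)
    arc-old-new i rewrite inject₁-<ᶠ-last i =
      cong₂ _∧_ (on i) (trans (all-allFin-last n P) (trans (cong₂ _∧_ (all-cong (allFin n) onOld) atNew) (∧-identityʳ _)))
      where
      P : Fin (suc n) → Bool
      P k = not ((inject₁ i <ᶠ k) ∧ (k <ᶠ fromℕ n) ∧ R (inject₁ i) k)
      onOld : ∀ k → P (inject₁ k) ≡ not (M i k ∧ (i <ᶠ k))
      onOld k rewrite <ᶠ-inject₁ i k | inject₁-<ᶠ-last k | oo i k = cong not (∧-comm (i <ᶠ k) (M i k))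
      atNew : P (fromℕ n) ≡ true
      atNew rewrite last-<ᶠ (fromℕ n) = cong not (∧-zeroʳ (inject₁ i <ᶠ fromℕ n))

    arc-new : ∀ j → IsArcᵇ R (fromℕ n , j) ≡ false
    arc-new j rewrite last-<ᶠ j = refl

    blockMax-old : ∀ i → IsBlockMaxᵇ R (inject₁ i) ≡ (IsBlockMaxᵇ M i ∧ not (c i))
    blockMax-old i = trans (all-allFin-last n P) (cong₂ _∧_ (all-cong (allFin n) onOld) atNew)
      where
      P : Fin (suc n) → Bool
      P k = not (R (inject₁ i) k ∧ (inject₁ i <ᶠ k))
      onOld : ∀ k → P (inject₁ k) ≡ not (M i k ∧ (i <ᶠ k))
      onOld k rewrite <ᶠ-inject₁ i k | oo i k = refl
      atNew : P (fromℕ n) ≡ not (c i)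
      atNew rewrite inject₁-<ᶠ-last i | on i = cong not (∧-identityʳ (c i))

    blockMax-new : IsBlockMaxᵇ R (fromℕ n) ≡ true
    blockMax-new = all-allFin-intro _ (λ k → trans (cong (λ z → not (R (fromℕ n) k ∧ z)) (last-<ᶠ k)) (cong not (∧-zeroʳ _)))

    Nesting-new : ∀ k j → ¬ NestingFrom k R (fromℕ n) j
    Nesting-new k j h = true≢false (trans (sym (NestingFrom-arc k R _ _ h)) (arc-new j))

    Nesting-old⁻ : ∀ k i j → NestingFrom k R (inject₁ i) (inject₁ j) → NestingFrom k M i j
    Nesting-old⁻ zero i j h = trans (sym (arc-old-old i j)) h
    Nesting-old⁻ (suc k) i j (arc , i′ , j′ , i<i′ , j′<j , h) with view i′ | view j′
    ... | _      | new    = ⊥-elim (true≢false (trans (sym j′<j) (last-<ᶠ (inject₁ j))))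
    ... | new    | old j″ = ⊥-elim (Nesting-new k _ h)
    ... | old i″ | old j″ =
      trans (sym (arc-old-old i j)) arc , i″ , j″ , trans (sym (<ᶠ-inject₁ i i″)) i<i′ , trans (sym (<ᶠ-inject₁ j″ j)) j′<j ,
      Nesting-old⁻ k i″ j″ h

    Nesting-old⁺ : ∀ k i j → NestingFrom k M i j → NestingFrom k R (inject₁ i) (inject₁ j)
    Nesting-old⁺ zero i j h = trans (arc-old-old i j) h
    Nesting-old⁺ (suc k) i j (arc , i′ , j′ , i<i′ , j′<j , h) =
      trans (arc-old-old i j) arc , inject₁ i′ , inject₁ j′ , trans (<ᶠ-inject₁ i i′) i<i′ , trans (<ᶠ-inject₁ j′ j) j′<j ,
      Nesting-old⁺ k i′ j′ h

    -- What a (k+1)-nesting of R with outer arc ending at the new element needs inside that arc.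
    Inner : ℕ → Fin n → Set
    Inner zero    i = ⊤
    Inner (suc k) i = NestingRightOf k M i

    Nesting-toNew⁻ : ∀ k i → NestingFrom k R (inject₁ i) (fromℕ n) → (IsArcᵇ R (inject₁ i , fromℕ n) ≡ true) × Inner k i
    Nesting-toNew⁻ zero i h = h , _
    Nesting-toNew⁻ (suc k) i (arc , i′ , j′ , i<i′ , j′<j , h) with view i′ | view j′
    ... | _      | new    = ⊥-elim (true≢false (trans (sym j′<j) (last-<ᶠ (fromℕ n))))
    ... | new    | old j″ = ⊥-elim (Nesting-new k _ h)
    ... | old i″ | old j″ = arc , i″ , j″ , trans (sym (<ᶠ-inject₁ i i″)) i<i′ , Nesting-old⁻ k i″ j″ h

    Nesting-toNew⁺ : ∀ k i → IsArcᵇ R (inject₁ i , fromℕ n) ≡ true → Inner k i → NestingFrom k R (inject₁ i) (fromℕ n)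
    Nesting-toNew⁺ zero    i arc _ = arc
    Nesting-toNew⁺ (suc k) i arc (i′ , j′ , i<i′ , h) =
      arc , inject₁ i′ , inject₁ j′ , trans (<ᶠ-inject₁ i i′) i<i′ , inject₁-<ᶠ-last j′ , Nesting-old⁺ k i′ j′ h

  module ChildThresholds {n} (M : BRel n) (c : Fin n → Bool) where
    open ExtArcs M c c true public

    NewArc : Fin n → Set
    NewArc i = IsArcᵇ R (inject₁ i , fromℕ n) ≡ true

    classify : ∀ k I J → NestingFrom k R I J →
      (Σ (Fin n) λ i → Σ (Fin n) λ j → (I ≡ inject₁ i) × NestingFrom k M i j) ⊎
      (Σ (Fin n) λ i → (I ≡ inject₁ i) × NewArc i × Inner k i)
    classify k I J h with view I
    ... | new = ⊥-elim (Nesting-new k J h)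
    ... | old i with view J
    ...   | old j = inj₁ (i , j , refl , Nesting-old⁻ k i j h)
    ...   | new   = inj₂ (i , refl , Nesting-toNew⁻ k i h)

    threshold-unchanged : ∀ k t → (∀ i → NewArc i → Inner k i → ⊥) → IsThreshold k M t → IsThreshold k R t
    threshold-unchanged k t noNew (inj₁ (t≡0 , none)) = inj₁ (t≡0 , none′)
      where
      none′ : ∀ I J → ¬ NestingFrom k R I J
      none′ I J h with classify k I J h
      ... | inj₁ (i , j , _ , h′)   = none i j h′
      ... | inj₂ (i , _ , arc , inn) = noNew i arc inn
    threshold-unchanged k t noNew (inj₂ (μ , t≡ , (i , j , i≡ , h) , bound)) =
      inj₂ (μ , t≡ , (inject₁ i , inject₁ j , trans (FP.toℕ-inject₁ i) i≡ , Nesting-old⁺ k i j h) , bound′)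
      where
      bound′ : ∀ I J → NestingFrom k R I J → toℕ I ≤ μ
      bound′ I J h′ with classify k I J h′
      ... | inj₁ (i′ , j′ , refl , h″)  = subst (_≤ μ) (sym (FP.toℕ-inject₁ i′)) (bound i′ j′ h″)
      ... | inj₂ (i′ , refl , arc , inn) = ⊥-elim (noNew i′ arc inn)

    threshold-newArc : ∀ k t b → NewArc b → Inner k b → (∀ i → NewArc i → i ≡ b) →
      IsThreshold k M t → IsThreshold k R (t ⊔ suc (toℕ b))
    threshold-newArc k t b arc inn unique (inj₁ (refl , none)) =
      inj₂ (toℕ b , refl , (inject₁ b , fromℕ n , FP.toℕ-inject₁ b , Nesting-toNew⁺ k b arc inn) , bound′)
      where
      bound′ : ∀ I J → NestingFrom k R I J → toℕ I ≤ toℕ b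
      bound′ I J h′ with classify k I J h′
      ... | inj₁ (i′ , j′ , refl , h″) = ⊥-elim (none i′ j′ h″)
      ... | inj₂ (i′ , refl , arc′ , _) rewrite unique i′ arc′ = NP.≤-reflexive (FP.toℕ-inject₁ b)
    threshold-newArc k t b arc inn unique (inj₂ (μ , refl , (i , j , i≡ , h) , bound)) =
      inj₂ (μ ⊔ toℕ b , refl , witness (NP.⊔-sel μ (toℕ b)) , bound′)
      where
      witness : (μ ⊔ toℕ b ≡ μ) ⊎ (μ ⊔ toℕ b ≡ toℕ b) →
        Σ (Fin (suc n)) λ I → Σ (Fin (suc n)) λ J → (toℕ I ≡ μ ⊔ toℕ b) × NestingFrom k R I J
      witness (inj₁ s) = inject₁ i , inject₁ j , trans (FP.toℕ-inject₁ i) (trans i≡ (sym s)) , Nesting-old⁺ k i j h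
      witness (inj₂ s) = inject₁ b , fromℕ n , trans (FP.toℕ-inject₁ b) (sym s) , Nesting-toNew⁺ k b arc inn
      bound′ : ∀ I J → NestingFrom k R I J → toℕ I ≤ μ ⊔ toℕ b
      bound′ I J h′ with classify k I J h′
      ... | inj₁ (i′ , j′ , refl , h″) =
        NP.≤-trans (subst (_≤ μ) (sym (FP.toℕ-inject₁ i′)) (bound i′ j′ h″)) (NP.m≤m⊔n μ (toℕ b))
      ... | inj₂ (i′ , refl , arc′ , _) rewrite unique i′ arc′ =
        NP.≤-trans (NP.≤-reflexive (FP.toℕ-inject₁ b)) (NP.m≤n⊔m μ (toℕ b))

  NestingRightOf⇒threshold : ∀ {n} (M : BRel n) k t b → IsThreshold k M t → NestingRightOf k M b → suc (toℕ b) < t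
  NestingRightOf⇒threshold M k t b (inj₁ (_ , none)) (i′ , j′ , b<i′ , h) = ⊥-elim (none i′ j′ h)
  NestingRightOf⇒threshold M k t b (inj₂ (μ , refl , _ , bound)) (i′ , j′ , b<i′ , h) =
    ℕ.s≤s (NP.<-≤-trans (<ᵇ-true⇒ _ _ b<i′) (bound i′ j′ h))

  threshold⇒NestingRightOf : ∀ {n} (M : BRel n) k t b → IsThreshold k M t → suc (toℕ b) < t → NestingRightOf k M b
  threshold⇒NestingRightOf M k t b (inj₁ (refl , _)) ()
  threshold⇒NestingRightOf M k t b (inj₂ (μ , refl , (i , j , i≡ , h) , _)) b+1<t =
    i , j , <ᵇ-true (subst (toℕ b <_) (sym i≡) (ℕ.s≤s⁻¹ b+1<t)) , h

  -- The smallest vertex of a nesting is the start of an arc, hence never a block maximum.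
  threshold-blockMax : ∀ {n} (M : BRel n) k t b → IsThreshold k M t → IsBlockMaxᵇ M b ≡ true → toℕ b < t → suc (toℕ b) < t
  threshold-blockMax M k t b (inj₁ (refl , _)) max ()
  threshold-blockMax M k t b (inj₂ (μ , refl , (i , j , i≡ , h) , _)) max b<t with toℕ b ℕ.≟ μ
  ... | no b≢μ  = ℕ.s≤s (NP.≤∧≢⇒< (ℕ.s≤s⁻¹ b<t) b≢μ)
  ... | yes b≡μ =
    ⊥-elim (true≢false (sym (trans (sym (blockMax-elim M b j max (subst (λ z → M z j ≡ true) (sym b≡i) Mij)))
                                   (subst (λ z → (z <ᶠ j) ≡ true) (sym b≡i) i<j))))
    where
    arc = ∧-elim {i <ᶠ j} (NestingFrom-arc k M i j h)
    i<j = proj₁ arc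
    Mij = proj₁ (∧-elim {M i j} (proj₂ arc))
    b≡i : b ≡ i
    b≡i = FP.toℕ-injective (trans b≡μ (sym i≡))

module RankSums where

  open Booleans
  open ListSums
  open FinPredicates
  open GeometricSums using (rangeSum; rangeSum-cong; rangeSum-head; rangeSum-shift)
  open import Data.Nat as ℕ using (ℕ; zero; suc; _≤_; _≤ᵇ_; _<ᵇ_; _∸_)
  import Data.Nat.Properties as NP
  open import Data.Fin as Fin using (Fin; zero; suc; toℕ; inject₁; fromℕ)
  import Data.Fin.Properties as FP
  open import Data.List using (allFin)
  open import Data.Bool using (Bool; true; false; _∧_)
  open import Data.Bool.Properties using (∧-identityʳ; ∧-zeroʳ)
  open import Data.Rational using (ℚ; 0ℚ; _+_)
  open import Data.Rational.Properties using (+-identityʳ; +-comm)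
  open import Relation.Binary.PropositionalEquality
  open import Relation.Nullary using (yes; no)
  open import Function using (_∘_)

  rankFrom : ∀ {n} → (Fin n → Bool) → ℕ → ℕ
  rankFrom P x = count (λ i → P i ∧ (x ≤ᵇ toℕ i))

  rankFrom-≥ : ∀ {n} (P : Fin n → Bool) x → n ≤ x → rankFrom P x ≡ 0
  rankFrom-≥ P x n≤x =
    count-none _ (λ i → trans (cong (P i ∧_) (≤ᵇ-false (λ x≤i → NP.<⇒≱ (FP.toℕ<n i) (NP.≤-trans n≤x x≤i)))) (∧-zeroʳ (P i)))

  rankFrom-last : ∀ n (P : Fin (suc n) → Bool) x →
    rankFrom P x ≡ rankFrom (P ∘ inject₁) x ℕ.+ boolToℕ (P (fromℕ n) ∧ (x ≤ᵇ n))
  rankFrom-last n P x = trans (count-last n (λ i → P i ∧ (x ≤ᵇ toℕ i)))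
    (cong₂ ℕ._+_ (count-cong (λ i → cong (λ z → P (inject₁ i) ∧ (x ≤ᵇ z)) (FP.toℕ-inject₁ i)))
                 (cong (λ z → boolToℕ (P (fromℕ n) ∧ (x ≤ᵇ z))) (FP.toℕ-fromℕ n)))

  inWindow : ∀ {n} → (Fin n → Bool) → ℕ → ℕ → Fin n → Bool
  inWindow P lo hi b = P b ∧ (lo ≤ᵇ toℕ b) ∧ (toℕ b <ᵇ hi)

  rank-sum-last-false : ∀ n (P : Fin (suc n) → Bool) lo hi (g : ℕ → ℚ) → P (fromℕ n) ≡ false →
    rangeSum (suc (rankFrom (P ∘ inject₁) hi)) (rankFrom (P ∘ inject₁) lo ∸ rankFrom (P ∘ inject₁) hi)
             (λ r → g (r ℕ.+ boolToℕ (P (fromℕ n))))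
      + ite (inWindow P lo hi (fromℕ n)) (g (rankFrom P (toℕ (fromℕ n))))
    ≡ rangeSum (suc (rankFrom P hi)) (rankFrom P lo ∸ rankFrom P hi) g
  rank-sum-last-false n P lo hi g Pn≡false
    rewrite rankFrom-last n P hi | rankFrom-last n P lo | Pn≡false
          | NP.+-identityʳ (rankFrom (P ∘ inject₁) hi) | NP.+-identityʳ (rankFrom (P ∘ inject₁) lo) =
    trans (+-identityʳ _) (rangeSum-cong (suc (c hi)) (c lo ∸ c hi) (λ r → cong g (NP.+-identityʳ r)))
    where c = rankFrom (P ∘ inject₁)

  rank-sum-last-true : ∀ n (P : Fin (suc n) → Bool) lo hi (g : ℕ → ℚ) → lo ≤ hi → P (fromℕ n) ≡ true →
    rangeSum (suc (rankFrom (P ∘ inject₁) hi)) (rankFrom (P ∘ inject₁) lo ∸ rankFrom (P ∘ inject₁) hi)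
             (λ r → g (r ℕ.+ boolToℕ (P (fromℕ n))))
      + ite (inWindow P lo hi (fromℕ n)) (g (rankFrom P (toℕ (fromℕ n))))
    ≡ rangeSum (suc (rankFrom P hi)) (rankFrom P lo ∸ rankFrom P hi) g
  rank-sum-last-true n P lo hi g lo≤hi Pn≡true
    rewrite rankFrom-last n P hi | rankFrom-last n P lo | rankFrom-last n P (toℕ (fromℕ n)) | Pn≡true | FP.toℕ-fromℕ n
    with hi ℕ.≤? n
  ... | yes hi≤n rewrite ≤ᵇ-true hi≤n | ≤ᵇ-true (NP.≤-trans lo≤hi hi≤n) | <ᵇ-false (NP.≤⇒≯ hi≤n)
                       | cong₂ _∸_ (NP.+-comm (rankFrom (P ∘ inject₁) lo) 1) (NP.+-comm (rankFrom (P ∘ inject₁) hi) 1) =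
    trans (+-identityʳ _)
      (trans (rangeSum-shift (suc (c hi)) (c lo ∸ c hi) g) (cong (λ z → rangeSum (suc z) (c lo ∸ c hi) g) (NP.+-comm 1 (c hi))))
    where c = rankFrom (P ∘ inject₁)
  ... | no hi≰n rewrite rankFrom-≥ (P ∘ inject₁) hi (NP.≰⇒≥ hi≰n) | ≤ᵇ-false hi≰n | <ᵇ-true (NP.≰⇒> hi≰n)
    with lo ℕ.≤? n
  ...   | yes lo≤n rewrite ≤ᵇ-true lo≤n | ≤ᵇ-true (NP.≤-refl {n}) | rankFrom-≥ (P ∘ inject₁) n NP.≤-refl =
    trans (cong (_+ g 1) (rangeSum-shift 1 (c lo) g))
      (trans (+-comm _ (g 1)) (trans (sym (rangeSum-head 1 (c lo) g)) (cong (λ z → rangeSum 1 z g) (NP.+-comm 1 (c lo)))))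
    where c = rankFrom (P ∘ inject₁)
  ...   | no lo≰n rewrite rankFrom-≥ (P ∘ inject₁) lo (NP.≰⇒≥ lo≰n) | ≤ᵇ-false lo≰n = +-identityʳ 0ℚ

  -- As b runs over the P-elements in [lo, hi), its rank rankFrom P b runs over rankFrom P hi + 1, …, rankFrom P lo.
  rank-sum : ∀ n (P : Fin n → Bool) lo hi (g : ℕ → ℚ) → lo ≤ hi →
    Σl (allFin n) (λ b → ite (inWindow P lo hi b) (g (rankFrom P (toℕ b))))
      ≡ rangeSum (suc (rankFrom P hi)) (rankFrom P lo ∸ rankFrom P hi) g
  rank-sum zero    P lo hi g lo≤hi = refl
  rank-sum (suc n) P lo hi g lo≤hi = begin
    Σl (allFin (suc n)) term
      ≡⟨ Σ-allFin-last n term ⟩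
    Σl (allFin n) (term ∘ inject₁) + term (fromℕ n)
      ≡⟨ cong (_+ term (fromℕ n)) (Σ-cong (allFin n) term-inject₁) ⟩
    Σl (allFin n) (λ b → ite (inWindow P′ lo hi b) (g (rankFrom P′ (toℕ b) ℕ.+ δ))) + term (fromℕ n)
      ≡⟨ cong (_+ term (fromℕ n)) (rank-sum n P′ lo hi (λ r → g (r ℕ.+ δ)) lo≤hi) ⟩
    rangeSum (suc (rankFrom P′ hi)) (rankFrom P′ lo ∸ rankFrom P′ hi) (λ r → g (r ℕ.+ δ)) + term (fromℕ n)
      ≡⟨ lastStep (P (fromℕ n)) refl ⟩
    rangeSum (suc (rankFrom P hi)) (rankFrom P lo ∸ rankFrom P hi) g ∎
    where
    open ≡-Reasoning
    P′ = P ∘ inject₁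
    term = λ b → ite (inWindow P lo hi b) (g (rankFrom P (toℕ b)))
    δ = boolToℕ (P (fromℕ n))
    rank-inject₁ : ∀ b → rankFrom P (toℕ (inject₁ b)) ≡ rankFrom P′ (toℕ b) ℕ.+ δ
    rank-inject₁ b = trans (cong (rankFrom P) (FP.toℕ-inject₁ b)) (trans (rankFrom-last n P (toℕ b))
      (cong (λ z → rankFrom P′ (toℕ b) ℕ.+ boolToℕ z)
        (trans (cong (P (fromℕ n) ∧_) (≤ᵇ-true (ℕ.s≤s⁻¹ (NP.m≤n⇒m≤1+n (FP.toℕ<n b))))) (∧-identityʳ (P (fromℕ n))))))
    term-inject₁ : ∀ b → term (inject₁ b) ≡ ite (inWindow P′ lo hi b) (g (rankFrom P′ (toℕ b) ℕ.+ δ))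
    term-inject₁ b rewrite FP.toℕ-inject₁ b =
      cong (λ z → ite (inWindow P′ lo hi b) (g z)) (trans (cong (rankFrom P) (sym (FP.toℕ-inject₁ b))) (rank-inject₁ b))
    lastStep : ∀ p → P (fromℕ n) ≡ p →
      rangeSum (suc (rankFrom P′ hi)) (rankFrom P′ lo ∸ rankFrom P′ hi) (λ r → g (r ℕ.+ δ)) + term (fromℕ n)
        ≡ rangeSum (suc (rankFrom P hi)) (rankFrom P lo ∸ rankFrom P hi) g
    lastStep false e = rank-sum-last-false n P lo hi g e
    lastStep true  e = rank-sum-last-true n P lo hi g lo≤hi e

module Children where

  open Booleans
  open import Defs
  open FinPredicates
  open Nestings
  open Extension
  open Blocks
  open ExtensionNestings
  open StatisticWeights using (statWeight; weight≡statWeight; statWeight-cong≤; update; update-here; update-there)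
  open ParentIdentity using (incrementTo; blockChildWeight)
  open RankSums using (rankFrom)
  open import Data.Nat as ℕ using (ℕ; zero; suc; _≤_; _<_; _≤ᵇ_)
  import Data.Nat.Properties as NP
  open import Data.Fin as Fin using (Fin; toℕ; inject₁; fromℕ)
  import Data.Fin.Properties as FP
  open import Data.Bool using (Bool; true; false; _∧_; not)
  open import Data.Bool.Properties using (∧-identityʳ; ∧-zeroʳ)
  open import Data.Product using (_,_; proj₁; proj₂)
  open import Data.Sum using (inj₁; inj₂)
  open import Relation.Binary.PropositionalEquality
  open import Relation.Nullary using (yes; no; ¬_)
  open import Data.Empty using (⊥; ⊥-elim)
  open import Function using (_∘_)

  module ChildStatistics {n} (m : ℕ) (M : BRel n) (eqM : Equivalence M) (noNesting : NoNestingᵇ m M ≡ true) where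

    private
      rf = proj₁ eqM
      sy = proj₁ (proj₂ eqM)

    t : ℕ → ℕ
    t k = threshold k M

    maxFrom : ℕ → Fin n → Bool
    maxFrom x i = IsBlockMaxᵇ M i ∧ (x ≤ᵇ toℕ i)

    aStat-M : ∀ k → aStat (suc k) M ≡ suc (count (maxFrom (t k)))
    aStat-M k = aStat-threshold k M

    M-noNesting : ∀ i j → ¬ NestingFrom m M i j
    M-noNesting i j h = true≢false (trans (sym noNesting) (noNesting-false m M i j h))

    t-antitone : ∀ k k′ → k ≤ k′ → t k′ ≤ t k
    t-antitone k k′ k≤k′ with NP.m≤n⇒∃[o]m+o≡n k≤k′
    ... | d , refl = go k d
      where
      go : ∀ k d → t (k ℕ.+ d) ≤ t k
      go k zero    rewrite NP.+-identityʳ k = NP.≤-refl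
      go k (suc d) rewrite NP.+-suc k d = NP.≤-trans (threshold-suc-≤ (k ℕ.+ d) M) (go k d)

    count-blockMax-extend : ∀ (c : Fin n → Bool) x → x ≤ n →
      count (λ I → IsBlockMaxᵇ (extend M c c true) I ∧ (x ≤ᵇ toℕ I))
        ≡ count (λ i → (IsBlockMaxᵇ M i ∧ not (c i)) ∧ (x ≤ᵇ toℕ i)) ℕ.+ 1
    count-blockMax-extend c x x≤n = trans (count-last n (λ I → IsBlockMaxᵇ (extend M c c true) I ∧ (x ≤ᵇ toℕ I)))
      (cong₂ ℕ._+_
        (count-cong (λ i → cong₂ _∧_ (ExtArcs.blockMax-old M c c true i) (cong (x ≤ᵇ_) (FP.toℕ-inject₁ i))))
        (cong boolToℕ (trans (cong₂ _∧_ (ExtArcs.blockMax-new M c c true) (cong (x ≤ᵇ_) (FP.toℕ-fromℕ n))) (≤ᵇ-true x≤n))))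

    R∅ : BRel (suc n)
    R∅ = extend M ∅ ∅ true

    private module Singleton = ChildThresholds M ∅

    noNewArc-singletonChild : ∀ k i → Singleton.NewArc i → Singleton.Inner k i → ⊥
    noNewArc-singletonChild k i arc _ = true≢false (trans (sym arc) (Singleton.arc-old-new i))

    threshold-singletonChild : ∀ k → threshold k R∅ ≡ t k
    threshold-singletonChild k = IsThreshold⇒threshold k R∅ (t k)
      (Singleton.threshold-unchanged k (t k) (noNewArc-singletonChild k) (threshold-isThreshold k M))

    noNesting-singletonChild : NoNestingᵇ m R∅ ≡ true
    noNesting-singletonChild = noNesting-true m R∅ none
      where
      none : ∀ I J → ¬ NestingFrom m R∅ I J
      none I J h with Singleton.classify m I J h
      ... | inj₁ (i , j , _ , h′)    = M-noNesting i j h′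
      ... | inj₂ (i , _ , arc , inn) = noNewArc-singletonChild m i arc inn

    aStat-singletonChild : ∀ k → aStat (suc k) R∅ ≡ suc (aStat (suc k) M)
    aStat-singletonChild k = begin
      aStat (suc k) R∅
        ≡⟨ aStat-threshold k R∅ ⟩
      suc (count (λ I → IsBlockMaxᵇ R∅ I ∧ (threshold k R∅ ≤ᵇ toℕ I)))
        ≡⟨ cong (λ z → suc (count (λ I → IsBlockMaxᵇ R∅ I ∧ (z ≤ᵇ toℕ I)))) (threshold-singletonChild k) ⟩
      suc (count (λ I → IsBlockMaxᵇ R∅ I ∧ (t k ≤ᵇ toℕ I)))
        ≡⟨ cong suc (count-blockMax-extend ∅ (t k) (threshold-≤ k M)) ⟩
      suc (count (λ i → (IsBlockMaxᵇ M i ∧ true) ∧ (t k ≤ᵇ toℕ i)) ℕ.+ 1)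
        ≡⟨ cong (λ z → suc (z ℕ.+ 1)) (count-cong (λ i → cong (_∧ (t k ≤ᵇ toℕ i)) (∧-identityʳ (IsBlockMaxᵇ M i)))) ⟩
      suc (count (maxFrom (t k)) ℕ.+ 1)
        ≡⟨ cong suc (NP.+-comm _ 1) ⟩
      suc (suc (count (maxFrom (t k))))
        ≡⟨ cong suc (sym (aStat-M k)) ⟩
      suc (aStat (suc k) M) ∎
      where open ≡-Reasoning

    weight-singletonChild : ∀ v → weight m (suc n) v R∅ ≡ statWeight m (suc n) v (incrementTo (aExt M) m)
    weight-singletonChild v = trans (weight≡statWeight m (suc n) v R∅) (statWeight-cong≤ m (suc n) v stats)
      where
      stats : ∀ x → x ≤ m → aExt R∅ x ≡ incrementTo (aExt M) m x
      stats zero    _   = refl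
      stats (suc k) k<m rewrite <ᵇ-true k<m = aStat-singletonChild k

    -- Type K means t K ≤ b < rankCeiling K, where rankCeiling K = t (K - 1) and t (-1) = n.
    rankCeiling : ℕ → ℕ
    rankCeiling zero    = n
    rankCeiling (suc k) = t k

    module BlockChild (b : Fin n) (b-max : IsBlockMaxᵇ M b ≡ true) where
      Rb = extend M (M b) (M b) true
      module B = ChildThresholds M (M b)

      newArc : B.NewArc b
      newArc = trans (B.arc-old-new b) (cong₂ _∧_ (rf b) b-max)

      newArc-unique : ∀ i → B.NewArc i → i ≡ b
      newArc-unique i arc = let Mbi , i-max = ∧-elim {M b i} (trans (sym (B.arc-old-new i)) arc) in
        ≮ᶠ-antisym i b (blockMax-elim M i b i-max (sy b i Mbi)) (blockMax-elim M b i b-max Mbi)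

      othersFrom : ℕ → ℕ
      othersFrom x = count (λ i → maxFrom x i ∧ not (i ==ᶠ b))

      othersFrom-extend : ∀ x i → ((IsBlockMaxᵇ M i ∧ not (M b i)) ∧ (x ≤ᵇ toℕ i)) ≡ (maxFrom x i ∧ not (i ==ᶠ b))
      othersFrom-extend x i with i FP.≟ b
      ... | yes refl rewrite rf i = trans (cong (_∧ (x ≤ᵇ toℕ i)) (∧-zeroʳ (IsBlockMaxᵇ M i))) (sym (∧-zeroʳ (maxFrom x i)))
      ... | no i≢b with IsBlockMaxᵇ M i in i-max
      ...   | false = refl
      ...   | true with M b i in Mbi
      ...     | true  = ⊥-elim (i≢b (newArc-unique i (trans (B.arc-old-new i) (cong₂ _∧_ Mbi i-max))))
      ...     | false = sym (∧-identityʳ (x ≤ᵇ toℕ i))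

      aStat-Rb : ∀ k x → threshold k Rb ≡ x → x ≤ n → aStat (suc k) Rb ≡ suc (othersFrom x ℕ.+ 1)
      aStat-Rb k x t≡x x≤n = trans (aStat-threshold k Rb) (cong suc
        (trans (count-cong (λ I → cong (λ z → IsBlockMaxᵇ Rb I ∧ (z ≤ᵇ toℕ I)) t≡x))
               (trans (count-blockMax-extend (M b) x x≤n) (cong (ℕ._+ 1) (count-cong (othersFrom-extend x))))))

      count-split : ∀ x → count (maxFrom x) ≡ othersFrom x ℕ.+ boolToℕ (maxFrom x b)
      count-split x = count-remove n (maxFrom x) b

      -- The new arc (b, n+1) extends exactly the k-nestings to the right of b, and these exist iff k ≤ K.
      module OfType (K : ℕ) (K<m : K < m) (t≤b : t K ≤ toℕ b) (b<ceiling : toℕ b < rankCeiling K) where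
        t-above-b : ∀ k → k < K → suc (toℕ b) < t k
        t-above-b = go K b<ceiling
          where
          go : ∀ K′ → toℕ b < rankCeiling K′ → ∀ k → k < K′ → suc (toℕ b) < t k
          go (suc K′) b<t k k<K′ =
            NP.<-≤-trans (threshold-blockMax M K′ (t K′) b (threshold-isThreshold K′ M) b-max b<t) (t-antitone k K′ (ℕ.s≤s⁻¹ k<K′))

        Inner-below : ∀ k → k ≤ K → B.Inner k b
        Inner-below zero    _   = _
        Inner-below (suc k) k<K = threshold⇒NestingRightOf M k (t k) b (threshold-isThreshold k M) (t-above-b k k<K)

        Inner-above : ∀ k → K < k → ¬ B.Inner k b
        Inner-above (suc k) K<k inn = NP.<-irrefl refl (NP.<-≤-trans
          (NestingRightOf⇒threshold M k (t k) b (threshold-isThreshold k M) inn)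
          (NP.≤-trans (t-antitone K k (ℕ.s≤s⁻¹ K<k)) (NP.≤-trans t≤b (NP.n≤1+n _))))

        threshold-below : ∀ k → k < K → threshold k Rb ≡ t k
        threshold-below k k<K = IsThreshold⇒threshold k Rb (t k)
          (subst (IsThreshold k Rb) (NP.m≥n⇒m⊔n≡m (NP.<⇒≤ (t-above-b k k<K)))
            (B.threshold-newArc k (t k) b newArc (Inner-below k (NP.<⇒≤ k<K)) newArc-unique (threshold-isThreshold k M)))

        threshold-at : threshold K Rb ≡ suc (toℕ b)
        threshold-at = IsThreshold⇒threshold K Rb (suc (toℕ b))
          (subst (IsThreshold K Rb) (NP.m≤n⇒m⊔n≡n (NP.≤-trans t≤b (NP.n≤1+n _)))
            (B.threshold-newArc K (t K) b newArc (Inner-below K NP.≤-refl) newArc-unique (threshold-isThreshold K M)))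

        threshold-above : ∀ k → K < k → threshold k Rb ≡ t k
        threshold-above k K<k = IsThreshold⇒threshold k Rb (t k)
          (B.threshold-unchanged k (t k) (λ i arc inn → Inner-above k K<k (subst (B.Inner k) (newArc-unique i arc) inn))
            (threshold-isThreshold k M))

        noNesting-Rb : NoNestingᵇ m Rb ≡ true
        noNesting-Rb = noNesting-true m Rb none
          where
          none : ∀ I J → ¬ NestingFrom m Rb I J
          none I J h with B.classify m I J h
          ... | inj₁ (i , j , _ , h′)    = M-noNesting i j h′
          ... | inj₂ (i , _ , arc , inn) = Inner-above m K<m (subst (B.Inner m) (newArc-unique i arc) inn)

        aStat-below : ∀ k → k < K → aStat (suc k) Rb ≡ suc (aStat (suc k) M)
        aStat-below k k<K = begin
          aStat (suc k) Rb                                          ≡⟨ aStat-Rb k (t k) (threshold-below k k<K) (threshold-≤ k M) ⟩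
          suc (othersFrom (t k) ℕ.+ 1)                              ≡⟨ cong suc (NP.+-comm (othersFrom (t k)) 1) ⟩
          suc (suc (othersFrom (t k)))                              ≡⟨ cong (λ z → suc (suc z)) (sym (NP.+-identityʳ _)) ⟩
          suc (suc (othersFrom (t k) ℕ.+ 0))                        ≡⟨ cong (λ z → suc (suc (othersFrom (t k) ℕ.+ boolToℕ z))) (sym b-below) ⟩
          suc (suc (othersFrom (t k) ℕ.+ boolToℕ (maxFrom (t k) b))) ≡⟨ cong (λ z → suc (suc z)) (sym (count-split (t k))) ⟩
          suc (suc (count (maxFrom (t k))))                         ≡⟨ cong suc (sym (aStat-M k)) ⟩
          suc (aStat (suc k) M)                                     ∎
          where
          open ≡-Reasoning
          b-below : maxFrom (t k) b ≡ false
          b-below = trans (cong (_∧ (t k ≤ᵇ toℕ b)) b-max)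
            (≤ᵇ-false (λ t≤b′ → NP.<⇒≱ (t-above-b k k<K) (NP.≤-trans t≤b′ (NP.n≤1+n _))))

        aStat-above : ∀ k → K < k → aStat (suc k) Rb ≡ aStat (suc k) M
        aStat-above k K<k = begin
          aStat (suc k) Rb                                          ≡⟨ aStat-Rb k (t k) (threshold-above k K<k) (threshold-≤ k M) ⟩
          suc (othersFrom (t k) ℕ.+ 1)                              ≡⟨ cong (λ z → suc (othersFrom (t k) ℕ.+ boolToℕ z)) (sym b-above) ⟩
          suc (othersFrom (t k) ℕ.+ boolToℕ (maxFrom (t k) b))      ≡⟨ cong suc (sym (count-split (t k))) ⟩
          suc (count (maxFrom (t k)))                               ≡⟨ sym (aStat-M k) ⟩
          aStat (suc k) M                                           ∎
          where
          open ≡-Reasoning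
          b-above : maxFrom (t k) b ≡ true
          b-above = trans (cong (_∧ (t k ≤ᵇ toℕ b)) b-max) (≤ᵇ-true (NP.≤-trans (t-antitone K k (NP.<⇒≤ K<k)) t≤b))

        othersFrom-suc : othersFrom (suc (toℕ b)) ≡ count (λ i → maxFrom (toℕ b) i ∧ not (i ==ᶠ b))
        othersFrom-suc = count-cong pointwise
          where
          pointwise : ∀ i → (maxFrom (suc (toℕ b)) i ∧ not (i ==ᶠ b)) ≡ (maxFrom (toℕ b) i ∧ not (i ==ᶠ b))
          pointwise i with i FP.≟ b
          ... | yes refl = trans (∧-zeroʳ _) (sym (∧-zeroʳ _))
          ... | no i≢b = cong (λ z → (IsBlockMaxᵇ M i ∧ z) ∧ true) (Bool-ext weaken strengthen)
            where
            weaken : (suc (toℕ b) ≤ᵇ toℕ i) ≡ true → (toℕ b ≤ᵇ toℕ i) ≡ true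
            weaken h = ≤ᵇ-true (NP.<⇒≤ (<ᵇ-true⇒ (toℕ b) (toℕ i) h))
            strengthen : (toℕ b ≤ᵇ toℕ i) ≡ true → (suc (toℕ b) ≤ᵇ toℕ i) ≡ true
            strengthen h = <ᵇ-true (NP.≤∧≢⇒< (≤ᵇ-true⇒ (toℕ b) (toℕ i) h) (λ e → i≢b (sym (FP.toℕ-injective e))))

        aStat-at : aStat (suc K) Rb ≡ suc (rankFrom (IsBlockMaxᵇ M) (toℕ b))
        aStat-at = begin
          aStat (suc K) Rb                                         ≡⟨ aStat-Rb K (suc (toℕ b)) threshold-at (FP.toℕ<n b) ⟩
          suc (othersFrom (suc (toℕ b)) ℕ.+ 1)                     ≡⟨ cong (λ z → suc (z ℕ.+ 1)) othersFrom-suc ⟩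
          suc (others ℕ.+ 1)                                       ≡⟨ cong (λ z → suc (others ℕ.+ boolToℕ z)) (sym b-at) ⟩
          suc (others ℕ.+ boolToℕ (maxFrom (toℕ b) b))             ≡⟨ cong suc (sym (count-split (toℕ b))) ⟩
          suc (count (maxFrom (toℕ b)))                            ∎
          where
          open ≡-Reasoning
          others = count (λ i → maxFrom (toℕ b) i ∧ not (i ==ᶠ b))
          b-at : maxFrom (toℕ b) b ≡ true
          b-at = trans (cong (_∧ (toℕ b ≤ᵇ toℕ b)) b-max) (≤ᵇ-true (NP.≤-refl {toℕ b}))

        weight-Rb : ∀ v (J : Fin m) → toℕ J ≡ K →
          weight m (suc n) v Rb ≡ blockChildWeight m n v (aExt M) J (rankFrom (IsBlockMaxᵇ M) (toℕ b))
        weight-Rb v J refl = trans (weight≡statWeight m (suc n) v Rb) (statWeight-cong≤ m (suc n) v stats)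
          where
          rank = rankFrom (IsBlockMaxᵇ M) (toℕ b)
          stats : ∀ x → x ≤ m → aExt Rb x ≡ update (incrementTo (aExt M) (toℕ J)) (suc (toℕ J)) (suc rank) x
          stats zero _ = refl
          stats (suc k) _ with k ℕ.≟ toℕ J
          ... | yes refl = trans aStat-at (sym (update-here (incrementTo (aExt M) k) (suc k) (suc rank)))
          ... | no k≢J rewrite update-there (incrementTo (aExt M) (toℕ J)) (suc (toℕ J)) (suc rank) (suc k) (k≢J ∘ NP.suc-injective)
            with k ℕ.<? toℕ J
          ...   | yes k<J rewrite <ᵇ-true k<J = aStat-below k k<J
          ...   | no k≮J  rewrite <ᵇ-false k≮J = aStat-above k (NP.≤∧≢⇒< (NP.≮⇒≥ k≮J) (k≢J ∘ sym))

      -- Below the m-th threshold, the new arc closes an (m+1)-nesting.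
      nesting-Rb : ∀ m′ → m ≡ suc m′ → toℕ b < t m′ → NoNestingᵇ m Rb ≡ false
      nesting-Rb m′ refl b<t = noNesting-false m Rb (inject₁ b) (fromℕ n)
        (B.Nesting-toNew⁺ m b newArc (threshold⇒NestingRightOf M m′ (t m′) b (threshold-isThreshold m′ M)
          (threshold-blockMax M m′ (t m′) b (threshold-isThreshold m′ M) b-max b<t)))


module ChildSums where

  open Booleans
  open import Defs
  open ListSums
  open FunctionSums
  open FinPredicates
  open Nestings
  open Extension
  open Blocks
  open PointwiseEqual
  open Children
  open StatisticWeights using (statWeight; weight≡statWeight; statWeight-cong)
  open ParentIdentity using (incrementTo; blockChildWeight; rankFloor; childrenSum)
  open GeometricSums using (rangeSum)
  open RankSums using (rankFrom; inWindow; rankFrom-≥; rank-sum)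
  open import Data.Nat as ℕ using (ℕ; zero; suc; _≤_; _<_; _≤ᵇ_; _<ᵇ_; _∸_)
  import Data.Nat.Properties as NP
  open import Data.Fin as Fin using (Fin; zero; suc; toℕ; fromℕ<)
  import Data.Fin.Properties as FP
  open import Data.List using (List; allFin)
  open import Data.Bool using (Bool; true; false; _∧_)
  open import Data.Product using (_×_; _,_; proj₁; proj₂; Σ)
  open import Data.Rational using (ℚ; 0ℚ; _+_)
  open import Data.Rational.Properties using (+-identityʳ)
  open import Relation.Binary.PropositionalEquality
  open import Relation.Binary.Definitions using (tri<; tri≈; tri>)
  open import Relation.Nullary using (yes; no)
  open import Data.Empty using (⊥; ⊥-elim)

  validWeight : ∀ m n → (Fin (suc m) → ℚ) → BRel n → ℚ
  validWeight m n v R = ite (IsEquivᵇ R) (ite (NoNestingᵇ m R) (weight m n v R))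

  weight-resp : ∀ m N v {R R′ : BRel N} → R ≐ R′ → weight m N v R ≡ weight m N v R′
  weight-resp m N v {R} {R′} R≐R′ =
    trans (weight≡statWeight m N v R) (trans (statWeight-cong m N v (aExt-resp R≐R′)) (sym (weight≡statWeight m N v R′)))

  validWeight-resp : ∀ m N v (R R′ : BRel N) → R ≐ R′ → validWeight m N v R ≡ validWeight m N v R′
  validWeight-resp m N v R R′ R≐R′ =
    cong₂ ite (isEquivᵇ-resp R≐R′) (cong₂ ite (noNesting-resp R≐R′ m) (weight-resp m N v R≐R′))

  ite-∧ : ∀ a b (y : ℚ) → ite (a ∧ b) y ≡ ite a (ite b y)
  ite-∧ true  b y = refl
  ite-∧ false b y = refl

  Σ-ite : ∀ {A : Set} (xs : List A) a (f : A → ℚ) → Σl xs (λ c → ite a (f c)) ≡ ite a (Σl xs f)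
  Σ-ite xs true  f = refl
  Σ-ite xs false f = Σ-0 xs

  module ChildSum {n} (m′ : ℕ) (M : BRel n) (eqM : Equivalence M) (noNesting : NoNestingᵇ (suc m′) M ≡ true)
                  (v : Fin (suc (suc m′)) → ℚ) where
    m = suc m′
    open ChildStatistics m M eqM noNesting

    ofType : Fin m → Fin n → Bool
    ofType J b = inWindow (IsBlockMaxᵇ M) (t (toℕ J)) (rankCeiling (toℕ J)) b

    ofType-intro : ∀ J b → IsBlockMaxᵇ M b ≡ true → t (toℕ J) ≤ toℕ b → toℕ b < rankCeiling (toℕ J) → ofType J b ≡ true
    ofType-intro J b b-max t≤b b<ceiling = ∧-intro b-max (∧-intro (≤ᵇ-true t≤b) (<ᵇ-true b<ceiling))

    ofType-elim : ∀ J b → ofType J b ≡ true →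
      (IsBlockMaxᵇ M b ≡ true) × (t (toℕ J) ≤ toℕ b) × (toℕ b < rankCeiling (toℕ J))
    ofType-elim J b h =
      let b-max , rest = ∧-elim {IsBlockMaxᵇ M b} h in
      let t≤b , b<ceiling = ∧-elim {t (toℕ J) ≤ᵇ toℕ b} rest in
      b-max , ≤ᵇ-true⇒ (t (toℕ J)) (toℕ b) t≤b , <ᵇ-true⇒ (toℕ b) (rankCeiling (toℕ J)) b<ceiling

    type-exists : ∀ b K → K < m → t K ≤ toℕ b → Σ ℕ λ K₀ → (K₀ < m) × (t K₀ ≤ toℕ b) × (toℕ b < rankCeiling K₀)
    type-exists b zero    K<m t≤b = 0 , K<m , t≤b , FP.toℕ<n b
    type-exists b (suc K) K<m t≤b with t K ℕ.≤? toℕ b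
    ... | yes t≤b′ = type-exists b K (NP.<-trans (NP.n<1+n K) K<m) t≤b′
    ... | no t≰b   = suc K , K<m , t≤b , NP.≰⇒> t≰b

    types-disjoint : ∀ {b : Fin n} K₁ K₂ → K₁ < K₂ → t K₁ ≤ toℕ b → toℕ b < rankCeiling K₂ → ⊥
    types-disjoint K₁ (suc K₂) K₁<K₂ t≤b b<t = NP.<⇒≱ b<t (NP.≤-trans (t-antitone K₁ K₂ (ℕ.s≤s⁻¹ K₁<K₂)) t≤b)

    type-unique : ∀ (b : Fin n) K₁ K₂ → t K₁ ≤ toℕ b → toℕ b < rankCeiling K₁ →
      t K₂ ≤ toℕ b → toℕ b < rankCeiling K₂ → K₁ ≡ K₂
    type-unique b K₁ K₂ t≤b₁ b<c₁ t≤b₂ b<c₂ with NP.<-cmp K₁ K₂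
    ... | tri≈ _ K₁≡K₂ _ = K₁≡K₂
    ... | tri< K₁<K₂ _ _ = ⊥-elim (types-disjoint K₁ K₂ K₁<K₂ t≤b₁ b<c₂)
    ... | tri> _ _ K₂<K₁ = ⊥-elim (types-disjoint K₂ K₁ K₂<K₁ t≤b₂ b<c₁)

    blockChild : Fin n → ℚ
    blockChild b = ite (NoNestingᵇ m (extend M (M b) (M b) true)) (weight m (suc n) v (extend M (M b) (M b) true))

    typedChild : Fin m → Fin n → ℚ
    typedChild J b = blockChildWeight m n v (aExt M) J (rankFrom (IsBlockMaxᵇ M) (toℕ b))

    -- Each block maximum either lies below the last threshold (and its child has an (m+1)-nesting) or has exactly one type.
    blockChild-true : ∀ b → IsBlockMaxᵇ M b ≡ true → blockChild b ≡ Σl (allFin m) (λ J → ite (ofType J b) (typedChild J b))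
    blockChild-true b b-max with t m′ ℕ.≤? toℕ b
    ... | no t≰b = trans (cong (λ z → ite z (weight m (suc n) v (extend M (M b) (M b) true))) (BlockChild.nesting-Rb b b-max m′ refl (NP.≰⇒> t≰b)))
                         (sym (Σ-ite-none m (λ J → ofType J b) (λ J → typedChild J b) notOfType))
      where
      notOfType : ∀ J → ofType J b ≡ false
      notOfType J with ofType J b in e
      ... | false = refl
      ... | true  = let _ , t≤b , _ = ofType-elim J b e in
        ⊥-elim (t≰b (NP.≤-trans (t-antitone (toℕ J) m′ (ℕ.s≤s⁻¹ (FP.toℕ<n J))) t≤b))
    ... | yes t≤b with type-exists b m′ NP.≤-refl t≤b
    ...   | K₀ , K₀<m , t≤b₀ , b<c₀ =
      trans (cong (λ z → ite z (weight m (suc n) v (extend M (M b) (M b) true))) Typed.noNesting-Rb)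
        (trans (Typed.weight-Rb v J₀ J₀≡K₀)
          (sym (Σ-ite-unique m (λ J → ofType J b) (λ J → typedChild J b) J₀
                 (ofType-intro J₀ b b-max (subst (λ z → t z ≤ toℕ b) (sym J₀≡K₀) t≤b₀)
                                          (subst (λ z → toℕ b < rankCeiling z) (sym J₀≡K₀) b<c₀))
                 (λ J e → let _ , t≤b′ , b<c′ = ofType-elim J b e in
                   FP.toℕ-injective (trans (type-unique b (toℕ J) K₀ t≤b′ b<c′ t≤b₀ b<c₀) (sym J₀≡K₀))))))
      where
      J₀ : Fin m
      J₀ = fromℕ< K₀<m
      J₀≡K₀ : toℕ J₀ ≡ K₀
      J₀≡K₀ = FP.toℕ-fromℕ< K₀<m
      module Typed = BlockChild.OfType b b-max K₀ K₀<m t≤b₀ b<c₀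

    blockChild-sum : ∀ b → ite (IsBlockMaxᵇ M b) (blockChild b) ≡ Σl (allFin m) (λ J → ite (ofType J b) (typedChild J b))
    blockChild-sum b = bySign (IsBlockMaxᵇ M b) refl
      where
      bySign : ∀ x → IsBlockMaxᵇ M b ≡ x → ite (IsBlockMaxᵇ M b) (blockChild b) ≡ Σl (allFin m) (λ J → ite (ofType J b) (typedChild J b))
      bySign false e = trans (cong (λ z → ite z (blockChild b)) e)
        (sym (Σ-ite-none m (λ J → ofType J b) (λ J → typedChild J b)
                (λ J → cong (_∧ ((t (toℕ J) ≤ᵇ toℕ b) ∧ (toℕ b <ᵇ rankCeiling (toℕ J)))) e)))
      bySign true e = trans (cong (λ z → ite z (blockChild b)) e) (blockChild-true b e)

    extend-resp : ∀ {c c′ r r′ : Fin n → Bool} x → (∀ i → c i ≡ c′ i) → (∀ i → r i ≡ r′ i) → extend M c r x ≐ extend M c′ r′ x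
    extend-resp {c} {c′} {r} {r′} x c≡ r≡ I J with view I | view J
    ... | old i | old j = trans (extend-old-old M c r x i j) (sym (extend-old-old M c′ r′ x i j))
    ... | old i | new   = trans (extend-old-new M c r x i) (trans (c≡ i) (sym (extend-old-new M c′ r′ x i)))
    ... | new   | old j = trans (extend-new-old M c r x j) (trans (r≡ j) (sym (extend-new-old M c′ r′ x j)))
    ... | new   | new   = trans (extend-new-new M c r x) (sym (extend-new-new M c′ r′ x))

    valid : BRel (suc n) → ℚ
    valid = validWeight m (suc n) v

    -- An extension is an equivalence only if its diagonal entry is true and its row equals its column.
    Σ-diagonal : ∀ c r → Σl bools (λ x → valid (extend M c r x)) ≡ valid (extend M c r true)
    Σ-diagonal c r =
      trans (cong (λ z → valid (extend M c r true) + (ite z (ite (NoNestingᵇ m R₀) (weight m (suc n) v R₀)) + 0ℚ)) notEquiv)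
      (trans (cong (valid (extend M c r true) +_) (+-identityʳ 0ℚ)) (+-identityʳ (valid (extend M c r true))))
      where
      R₀ = extend M c r false
      notEquiv : IsEquivᵇ (extend M c r false) ≡ false
      notEquiv with IsEquivᵇ (extend M c r false) in e
      ... | false = refl
      ... | true  = ⊥-elim (true≢false (sym (proj₁ (proj₂ (extend-Equivalence⁻ M c r false (isEquivᵇ-sound _ e))))))

    Σ-row : ∀ c → Σl (allFuns n bools) (λ r → valid (extend M c r true)) ≡ valid (extend M c c true)
    Σ-row c = trans (Σ-cong (allFuns n bools) onlyDiagonal)
      (Σ-allFuns-eqVec n c (λ r → valid (extend M c r true))
        (λ r r′ e → validWeight-resp m (suc n) v _ _ (extend-resp true (λ _ → refl) e)))
      where
      onlyDiagonal : ∀ r → valid (extend M c r true) ≡ ite (eqVec r c) (valid (extend M c r true))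
      onlyDiagonal r with eqVec r c in e
      ... | true = refl
      ... | false with IsEquivᵇ (extend M c r true) in e′
      ...   | false = refl
      ...   | true  = ⊥-elim (true≢false (trans (sym (eqVec-complete r c
                        (proj₁ (proj₂ (proj₂ (extend-Equivalence⁻ M c r true (isEquivᵇ-sound _ e′))))))) e))

    symmetricChild : (Fin n → Bool) → ℚ
    symmetricChild c = ite (NoNestingᵇ m (extend M c c true)) (weight m (suc n) v (extend M c c true))

    symmetricChild-resp : ∀ c c′ → (∀ i → c i ≡ c′ i) → symmetricChild c ≡ symmetricChild c′
    symmetricChild-resp c c′ c≡c′ =
      cong₂ ite (noNesting-resp (extend-resp true c≡c′ c≡c′) m) (weight-resp m (suc n) v (extend-resp true c≡c′ c≡c′))

    open ClosedSets M eqM using (isEquivᵇ-extend-split)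

    rankFloor-aExt : ∀ (J : Fin m) → rankFloor (aExt M) J ≡ suc (rankFrom (IsBlockMaxᵇ M) (rankCeiling (toℕ J)))
    rankFloor-aExt zero    = cong suc (sym (rankFrom-≥ (IsBlockMaxᵇ M) n NP.≤-refl))
    rankFloor-aExt (suc J) = aStat-M (toℕ J)

    t≤rankCeiling : ∀ K → t K ≤ rankCeiling K
    t≤rankCeiling zero    = threshold-≤ 0 M
    t≤rankCeiling (suc K) = threshold-suc-≤ K M

    Σ-ofType : ∀ (J : Fin m) → Σl (allFin n) (λ b → ite (ofType J b) (typedChild J b))
      ≡ rangeSum (rankFloor (aExt M) J) (aExt M (suc (toℕ J)) ∸ rankFloor (aExt M) J) (blockChildWeight m n v (aExt M) J)
    Σ-ofType J rewrite rankFloor-aExt J | aStat-M (toℕ J) =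
      rank-sum n (IsBlockMaxᵇ M) (t (toℕ J)) (rankCeiling (toℕ J)) (blockChildWeight m n v (aExt M) J) (t≤rankCeiling (toℕ J))

    Σ-column : Σl (allFuns n bools) (λ c → valid (extend M c c true)) ≡ childrenSum m n v (aExt M)
    Σ-column = begin
      Σl Cols (λ c → valid (extend M c c true))
        ≡⟨ Σ-cong Cols (λ c → isEquivᵇ-extend-split c (H c)) ⟩
      Σl Cols (λ c → ite (eqVec c ∅) (H c) + Σl (allFin n) (λ b → ite (IsBlockMaxᵇ M b ∧ eqVec c (M b)) (H c)))
        ≡⟨ Σ-+ Cols _ _ ⟩
      Σl Cols (λ c → ite (eqVec c ∅) (H c)) + Σl Cols (λ c → Σl (allFin n) (λ b → ite (IsBlockMaxᵇ M b ∧ eqVec c (M b)) (H c)))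
        ≡⟨ cong₂ _+_ (Σ-allFuns-eqVec n ∅ H symmetricChild-resp) (Σ-swap Cols (allFin n) _) ⟩
      H ∅ + Σl (allFin n) (λ b → Σl Cols (λ c → ite (IsBlockMaxᵇ M b ∧ eqVec c (M b)) (H c)))
        ≡⟨ cong (H ∅ +_) (Σ-cong (allFin n) (λ b → trans (Σ-cong Cols (λ c → ite-∧ (IsBlockMaxᵇ M b) (eqVec c (M b)) (H c)))
             (trans (Σ-ite Cols (IsBlockMaxᵇ M b) _) (cong (ite (IsBlockMaxᵇ M b)) (Σ-allFuns-eqVec n (M b) H symmetricChild-resp))))) ⟩
      H ∅ + Σl (allFin n) (λ b → ite (IsBlockMaxᵇ M b) (blockChild b))
        ≡⟨ cong₂ _+_ singleton (Σ-cong (allFin n) blockChild-sum) ⟩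
      W∅ + Σl (allFin n) (λ b → Σl (allFin m) (λ J → ite (ofType J b) (typedChild J b)))
        ≡⟨ cong (W∅ +_) (Σ-swap (allFin n) (allFin m) _) ⟩
      W∅ + Σl (allFin m) (λ J → Σl (allFin n) (λ b → ite (ofType J b) (typedChild J b)))
        ≡⟨ cong (W∅ +_) (Σ-cong (allFin m) Σ-ofType) ⟩
      childrenSum m n v (aExt M) ∎
      where
      open ≡-Reasoning
      Cols = allFuns n bools
      H = symmetricChild
      W∅ = statWeight m (suc n) v (incrementTo (aExt M) m)
      singleton : H ∅ ≡ W∅
      singleton = trans (cong (λ z → ite z (weight m (suc n) v R∅)) noNesting-singletonChild) (weight-singletonChild v)

    Σ-children : Σl (allFuns n bools) (λ c → Σl (allFuns n bools) (λ r → Σl bools (λ x → valid (extend M c r x))))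
      ≡ childrenSum m n v (aExt M)
    Σ-children = trans (Σ-cong (allFuns n bools) (λ c → trans (Σ-cong (allFuns n bools) (Σ-diagonal c)) (Σ-row c))) Σ-column

    rankFloor≤aExt : ∀ (J : Fin m) → rankFloor (aExt M) J ≤ aExt M (suc (toℕ J))
    rankFloor≤aExt zero rewrite aStat-M 0 = ℕ.s≤s ℕ.z≤n
    rankFloor≤aExt (suc J) rewrite aStat-M (toℕ J) | aStat-M (suc (toℕ J)) =
      ℕ.s≤s (count-mono (maxFrom (t (toℕ J))) (maxFrom (t (suc (toℕ J))))
        (λ i h → let i-max , t≤i = ∧-elim {IsBlockMaxᵇ M i} h in
          ∧-intro i-max (≤ᵇ-true (NP.≤-trans (threshold-suc-≤ (toℕ J) M) (≤ᵇ-true⇒ (t (toℕ J)) (toℕ i) t≤i)))))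

module Recurrence where

  open Booleans
  open ℚAlgebra
  open import Defs
  open ListSums
  open FunctionSums
  open Nestings
  open Extension
  open PointwiseEqual
  open ExtensionNestings
  open ChildSums
  open StatisticWeights using (statWeight; weight≡statWeight; statWeight-cong≤; statExponent; prodFin)
  open ParentIdentity using (incrementTo; childrenSum; parentRHS; lastTermWeight; parent-identity; statWeight-incrementTo;
                             NonZeroPoint; DistinctSteps)
  open import Data.Nat as ℕ using (ℕ; zero; suc; _≤_; _<ᵇ_)
  open import Data.Fin as Fin using (Fin; zero; suc; toℕ; inject₁; fromℕ)
  import Data.Fin.Properties as FP
  open import Data.List using (allFin; filterᵇ)
  open import Data.Bool using (Bool; true; false)
  open import Data.Product using (_,_; proj₁)
  open import Data.Rational using (ℚ; 0ℚ; 1ℚ; _+_; _*_; _-_)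
  open import Data.Rational.Properties using (+-identityˡ)
  open import Relation.Binary.PropositionalEquality
  open import Data.Empty using (⊥-elim)
  open import Function using (_∘_)
  open import Tactic.RingSolver using (solve-∀)

  snoc-rows-resp : ∀ {n} (G H : Fin n → Fin (suc n) → Bool) y → (∀ i j → G i j ≡ H i j) → snoc G y ≐ snoc H y
  snoc-rows-resp {n} G H y G≡H I J with view I
  ... | old i = trans (cong (λ f → f J) (snoc-inject₁ G y i)) (trans (G≡H i J) (sym (cong (λ f → f J) (snoc-inject₁ H y i))))
  ... | new   = trans (cong (λ f → f J) (snoc-last G y)) (sym (cong (λ f → f J) (snoc-last H y)))

  snoc-lastRow-resp : ∀ {n} (G : Fin n → Fin (suc n) → Bool) (y y′ : Fin (suc n) → Bool) → (∀ j → y j ≡ y′ j) → snoc G y ≐ snoc G y′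
  snoc-lastRow-resp {n} G y y′ y≡y′ I J with view I
  ... | old i = trans (cong (λ f → f J) (snoc-inject₁ G y i)) (sym (cong (λ f → f J) (snoc-inject₁ G y′ i)))
  ... | new   = trans (cong (λ f → f J) (snoc-last G y)) (trans (y≡y′ J) (sym (cong (λ f → f J) (snoc-last G y′))))

  -- Every relation on [n+1] is uniquely `extend M c r x` for a relation M on [n].
  Σ-BRel-extend : ∀ n (f : BRel (suc n) → ℚ) → (∀ R R′ → R ≐ R′ → f R ≡ f R′) →
    Σl (allFuns (suc n) (allFuns (suc n) bools)) f ≡
    Σl (allFuns n (allFuns n bools)) (λ M → Σl (allFuns n bools) (λ c → Σl (allFuns n bools) (λ r → Σl bools (λ x → f (extend M c r x)))))
  Σ-BRel-extend n f f-resp = begin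
    Σl (allFuns (suc n) Rows) f
      ≡⟨ Σ-allFuns-last n Rows f (λ g h e → f-resp g h (λ i j → cong (λ z → z j) (e i))) ⟩
    Σl (allFuns n Rows) (λ G → Σl Rows (λ y → f (snoc G y)))
      ≡⟨ Σ-allFuns-lastColumn n n bools (λ G → Σl Rows (λ y → f (snoc G y)))
           (λ G H e → Σ-cong Rows (λ y → f-resp _ _ (snoc-rows-resp G H y e))) ⟩
    Σl (allFuns n (allFuns n bools)) (λ M → Σl (allFuns n bools) (λ c → Σl Rows (λ y → f (snoc (λ i → snoc (M i) (c i)) y))))
      ≡⟨ Σ-cong (allFuns n (allFuns n bools)) (λ M → Σ-cong (allFuns n bools) (λ c →
           Σ-allFuns-last n bools (λ y → f (snoc (λ i → snoc (M i) (c i)) y))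
             (λ y y′ e → f-resp _ _ (snoc-lastRow-resp (λ i → snoc (M i) (c i)) y y′ e)))) ⟩
    Σl (allFuns n (allFuns n bools)) (λ M → Σl (allFuns n bools) (λ c → Σl (allFuns n bools) (λ r → Σl bools (λ x → f (extend M c r x))))) ∎
    where
    open ≡-Reasoning
    Rows = allFuns (suc n) bools

  ite-0 : ∀ b → ite b 0ℚ ≡ 0ℚ
  ite-0 true  = refl
  ite-0 false = refl

  Σ³-0 : ∀ n (g : (Fin n → Bool) → (Fin n → Bool) → Bool → ℚ) → (∀ c r x → g c r x ≡ 0ℚ) →
    Σl (allFuns n bools) (λ c → Σl (allFuns n bools) (λ r → Σl bools (λ x → g c r x))) ≡ 0ℚ
  Σ³-0 n g g≡0 = trans (Σ-cong (allFuns n bools) (λ c →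
    trans (Σ-cong (allFuns n bools) (λ r → trans (Σ-cong bools (λ x → g≡0 c r x)) (Σ-0 bools))) (Σ-0 (allFuns n bools))))
    (Σ-0 (allFuns n bools))

  -- Only extensions of a set partition in Π^(m) can be set partitions in Π^(m).
  Σ-extensions : ∀ m′ n (v : Fin (suc (suc m′)) → ℚ) (M : BRel n) →
    Σl (allFuns n bools) (λ c → Σl (allFuns n bools) (λ r → Σl bools (λ x → validWeight (suc m′) (suc n) v (extend M c r x))))
    ≡ ite (IsEquivᵇ M) (ite (NoNestingᵇ (suc m′) M) (childrenSum (suc m′) n v (aExt M)))
  Σ-extensions m′ n v M with IsEquivᵇ M in M-equiv
  ... | false = Σ³-0 n _ notEquiv
    where
    notEquiv : ∀ c r x → validWeight (suc m′) (suc n) v (extend M c r x) ≡ 0ℚ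
    notEquiv c r x with IsEquivᵇ (extend M c r x) in e
    ... | false = refl
    ... | true  = ⊥-elim (true≢false (trans (sym (isEquivᵇ-complete M (proj₁ (extend-Equivalence⁻ M c r x (isEquivᵇ-sound _ e))))) M-equiv))
  ... | true with NoNestingᵇ (suc m′) M in M-noNesting
  ...   | true  = ChildSum.Σ-children m′ M (isEquivᵇ-sound M M-equiv) M-noNesting v
  ...   | false with noNesting-false⁻ (suc m′) M M-noNesting
  ...     | i , j , h = Σ³-0 n _ (λ c r x → trans
    (cong (λ z → ite (IsEquivᵇ (extend M c r x)) (ite z (weight (suc m′) (suc n) v (extend M c r x))))
      (noNesting-false (suc m′) (extend M c r x) (inject₁ i) (inject₁ j) (ExtArcs.Nesting-old⁺ M c r x (suc m′) i j h)))
    (ite-0 (IsEquivᵇ (extend M c r x))))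

  F-size-suc : ∀ m′ n (v : Fin (suc (suc m′)) → ℚ) →
    F (suc m′) v (suc n) ≡ Σl (PiM (suc m′) n) (λ M → childrenSum (suc m′) n v (aExt M))
  F-size-suc m′ n v = begin
    F m v (suc n)
      ≡⟨ Σ-filter (NoNestingᵇ m) (filterᵇ IsEquivᵇ Rels′) (weight m (suc n) v) ⟩
    Σl (filterᵇ IsEquivᵇ Rels′) (λ R → ite (NoNestingᵇ m R) (weight m (suc n) v R))
      ≡⟨ Σ-filter IsEquivᵇ Rels′ _ ⟩
    Σl Rels′ (validWeight m (suc n) v)
      ≡⟨ Σ-BRel-extend n (validWeight m (suc n) v) (validWeight-resp m (suc n) v) ⟩
    Σl Rels (λ M → Σl (allFuns n bools) (λ c → Σl (allFuns n bools) (λ r → Σl bools (λ x → validWeight m (suc n) v (extend M c r x)))))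
      ≡⟨ Σ-cong Rels (Σ-extensions m′ n v) ⟩
    Σl Rels (λ M → ite (IsEquivᵇ M) (ite (NoNestingᵇ m M) (childrenSum m n v (aExt M))))
      ≡⟨ sym (Σ-filter IsEquivᵇ Rels _) ⟩
    Σl (filterᵇ IsEquivᵇ Rels) (λ M → ite (NoNestingᵇ m M) (childrenSum m n v (aExt M)))
      ≡⟨ sym (Σ-filter (NoNestingᵇ m) (filterᵇ IsEquivᵇ Rels) _) ⟩
    Σl (PiM (suc m′) n) (λ M → childrenSum (suc m′) n v (aExt M)) ∎
    where
    open ≡-Reasoning
    m = suc m′
    Rels′ = allFuns (suc n) (allFuns (suc n) bools)
    Rels = allFuns n (allFuns n bools)

  module RHSExpansion (m′ n : ℕ) (v : Fin (suc (suc m′)) → ℚ) where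
    m = suc m′
    P = PiM m n
    W : BRel n → ℚ
    W M = statWeight m n v (aExt M)
    o = v zero
    L = v (fromℕ m)
    iJ : Fin m → ℚ
    iJ J = inv (v (inject₁ J) - v (suc J))
    T : BRel n → Fin m → ℚ
    T M = lastTermWeight m n v (aExt M)

    F≡Σ : F m v n ≡ Σl P W
    F≡Σ = Σ-cong P (weight≡statWeight m n v)

    Σ-lastTermWeight : ∀ J → Σl P (λ M → T M J) ≡ lastTerm m v J n
    Σ-lastTermWeight zero = trans (Σ-* P c (λ M → statWeight m n (substNext v zero) (aExt M)))
      (cong (c *_) (sym (Σ-cong P (weight≡statWeight m n (substNext v zero)))))
      where c = (v zero ÷ v (suc zero)) ÷ (v zero - v (suc zero))
    Σ-lastTermWeight (suc j) = trans (Σ-* P c (λ M → statWeight m n (substNext v (suc j)) (aExt M)))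
      (cong (c *_) (sym (Σ-cong P (weight≡statWeight m n (substNext v (suc j))))))
      where c = inv (v (inject₁ (suc j)) - v (suc (suc j)))

    RHS≡Σ : RHS m v (suc n) ≡ Σl P (λ M → parentRHS m n v (aExt M))
    RHS≡Σ = begin
      (0ℚ + o * (F m v n + L * Σl (allFin m) (λ J → iJ J * F m v n))) - L * (o * Σl (allFin m) (λ J → lastTerm m v J n))
        ≡⟨ cong (_- L * (o * Σl (allFin m) (λ J → lastTerm m v J n))) (+-identityˡ (o * (F m v n + L * Σl (allFin m) (λ J → iJ J * F m v n)))) ⟩
      o * (F m v n + L * Σl (allFin m) (λ J → iJ J * F m v n)) - L * (o * Σl (allFin m) (λ J → lastTerm m v J n))
        ≡⟨ cong₂ (λ a b → o * (a + L * Σl (allFin m) (λ J → iJ J * a)) - L * (o * b)) F≡Σ (sym (Σ-cong (allFin m) Σ-lastTermWeight)) ⟩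
      o * (Σl P W + L * Σl (allFin m) (λ J → iJ J * Σl P W)) - L * (o * Σl (allFin m) (λ J → Σl P (λ M → T M J)))
        ≡⟨ cong₂ (λ a b → o * (Σl P W + L * a) - L * (o * b)) swapInner (sym (Σ-swap P (allFin m) T)) ⟩
      o * (Σl P W + L * Σl P (λ M → Σl (allFin m) (λ J → iJ J * W M))) - L * (o * Σl P (λ M → Σl (allFin m) (T M)))
        ≡⟨ cong₂ (λ a b → o * (Σl P W + a) - L * b) (sym (Σ-* P L _)) (sym (Σ-* P o _)) ⟩
      o * (Σl P W + Σl P (λ M → L * Σl (allFin m) (λ J → iJ J * W M))) - L * Σl P (λ M → o * Σl (allFin m) (T M))
        ≡⟨ cong₂ (λ a b → o * a - b) (sym (Σ-+ P W _)) (sym (Σ-* P L _)) ⟩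
      o * Σl P (λ M → W M + L * Σl (allFin m) (λ J → iJ J * W M)) - Σl P (λ M → L * (o * Σl (allFin m) (T M)))
        ≡⟨ cong (_- Σl P (λ M → L * (o * Σl (allFin m) (T M)))) (sym (Σ-* P o _)) ⟩
      Σl P (λ M → o * (W M + L * Σl (allFin m) (λ J → iJ J * W M))) - Σl P (λ M → L * (o * Σl (allFin m) (T M)))
        ≡⟨ sym (Σ-- P _ _) ⟩
      Σl P (λ M → parentRHS m n v (aExt M)) ∎
      where
      open ≡-Reasoning
      swapInner : Σl (allFin m) (λ J → iJ J * Σl P W) ≡ Σl P (λ M → Σl (allFin m) (λ J → iJ J * W M))
      swapInner = trans (Σ-cong (allFin m) (λ J → sym (Σ-* P (iJ J) W))) (Σ-swap (allFin m) P (λ J M → iJ J * W M))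

    Σ-parent-identity : NonZeroPoint v → DistinctSteps v →
      Σl P (λ M → parentRHS m n v (aExt M)) ≡ Σl P (λ M → childrenSum m n v (aExt M))
    Σ-parent-identity v≢0 distinct =
      trans (Σ-filter (NoNestingᵇ m) (filterᵇ IsEquivᵇ Rels) _) (trans (Σ-filter IsEquivᵇ Rels _)
        (trans (Σ-cong Rels perParent) (sym (trans (Σ-filter (NoNestingᵇ m) (filterᵇ IsEquivᵇ Rels) _) (Σ-filter IsEquivᵇ Rels _)))))
      where
      Rels = allFuns n (allFuns n bools)
      perParent : ∀ M → ite (IsEquivᵇ M) (ite (NoNestingᵇ m M) (parentRHS m n v (aExt M)))
                      ≡ ite (IsEquivᵇ M) (ite (NoNestingᵇ m M) (childrenSum m n v (aExt M)))
      perParent M with IsEquivᵇ M in M-equiv | NoNestingᵇ m M in M-noNesting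
      ... | false | _     = refl
      ... | true  | false = refl
      ... | true  | true  = sym (parent-identity m n v v≢0 distinct (aExt M) refl
                                  (ChildSum.rankFloor≤aExt m′ M (isEquivᵇ-sound M M-equiv) M-noNesting v))

  prodFin-1 : ∀ {k} (f : Fin k → ℚ) → (∀ i → f i ≡ 1ℚ) → prodFin f ≡ 1ℚ
  prodFin-1 {zero}  f f≡1 = refl
  prodFin-1 {suc k} f f≡1 = cong₂ _*_ (f≡1 zero) (prodFin-1 (f ∘ suc) (f≡1 ∘ suc))

  weight-size-zero : ∀ m (v : Fin (suc m) → ℚ) → NonZeroPoint v → (R : BRel 0) →
    weight m 0 v R ≡ (v zero * inv (v (fromℕ m))) * 1ℚ
  weight-size-zero m v v≢0 R = trans (weight≡statWeight m 0 v R) (trans (statWeight-cong≤ m 0 v stats)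
    (trans (statWeight-incrementTo m 0 v v≢0 (λ _ → 0) m (fromℕ m) (FP.toℕ-fromℕ m))
           (cong ((v zero * inv (v (fromℕ m))) *_) (prodFin-1 _ trivial))))
    where
    stats : ∀ k → k ≤ m → aExt R k ≡ incrementTo (λ _ → 0) m k
    stats zero    _   = refl
    stats (suc k) k<m rewrite <ᵇ-true k<m = refl
    trivial : ∀ i → zpow (v i) (statExponent m 0 (λ _ → 0) i) ≡ 1ℚ
    trivial i with toℕ i <ᵇ m
    ... | true  = refl
    ... | false = refl

  F-size-zero : ∀ m (v : Fin (suc m) → ℚ) → NonZeroPoint v → F m v 0 ≡ RHS m v 0
  F-size-zero m v v≢0 = trans (cong (_+ 0ℚ) (weight-size-zero m v v≢0 _)) (simplify (v zero * inv (v (fromℕ m))) (v (fromℕ m)))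
    where
    simplify : ∀ a L → a * 1ℚ + 0ℚ ≡ (a + 0ℚ) - L * 0ℚ
    simplify = solve-∀ ℚring

  functional-equation : ∀ m′ (v : Fin (suc (suc m′)) → ℚ) → NonZeroPoint v → DistinctSteps v → ∀ n →
    F (suc m′) v n ≡ RHS (suc m′) v n
  functional-equation m′ v v≢0 distinct zero    = F-size-zero (suc m′) v v≢0
  functional-equation m′ v v≢0 distinct (suc n) = begin
    F (suc m′) v (suc n)                                       ≡⟨ F-size-suc m′ n v ⟩
    Σl (PiM (suc m′) n) (λ M → childrenSum (suc m′) n v (aExt M)) ≡⟨ sym (RHSExpansion.Σ-parent-identity m′ n v v≢0 distinct) ⟩
    Σl (PiM (suc m′) n) (λ M → parentRHS (suc m′) n v (aExt M))   ≡⟨ sym (RHSExpansion.RHS≡Σ m′ n v) ⟩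
    RHS (suc m′) v (suc n)                                     ∎
    where open ≡-Reasoning

module Specialisation where

  open import Defs
  open import Data.Nat as ℕ using (ℕ; zero; suc)
  open import Data.List using (allFin; []; _∷_; map; foldr; length)
  open import Data.Integer as ℤ using (+_; -[1+_])
  import Data.Integer.Properties as ℤP
  open import Data.Rational using (ℚ; 1ℚ; mkℚ; _+_; _*_; _/_)
  open import Data.Rational.Properties using (↥p/↧p≡p; /-cong)
  import Data.Nat.Coprimality as Coprimality
  open import Relation.Binary.PropositionalEquality

  powℕ-1ℚ : ∀ k → powℕ 1ℚ k ≡ 1ℚ
  powℕ-1ℚ zero    = refl
  powℕ-1ℚ (suc k) = cong (1ℚ *_) (powℕ-1ℚ k)

  zpow-1ℚ : ∀ e → zpow 1ℚ e ≡ 1ℚ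
  zpow-1ℚ (+ k)    = powℕ-1ℚ k
  zpow-1ℚ -[1+ k ] = cong inv (powℕ-1ℚ (suc k))

  product-ones : ∀ {A : Set} (f : A → ℚ) → (∀ x → f x ≡ 1ℚ) → ∀ xs → foldr _*_ 1ℚ (map f xs) ≡ 1ℚ
  product-ones f f≡1 []       = refl
  product-ones f f≡1 (x ∷ xs) rewrite f≡1 x | product-ones f f≡1 xs = refl

  weight-1ℚ : ∀ m n R → weight m n (λ _ → 1ℚ) R ≡ 1ℚ
  weight-1ℚ m n R = product-ones _ (λ i → zpow-1ℚ (expo m n R i)) (allFin (suc m))

  1+k/1 : ∀ k → 1ℚ + ((+ k) / 1) ≡ (+ suc k) / 1
  1+k/1 k rewrite ↥p/↧p≡p (mkℚ (+ k) 0 (Coprimality.sym (Coprimality.1-coprimeTo k))) =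
    /-cong {p₁ = (+ 1) ℤ.* (+ 1) ℤ.+ (+ k) ℤ.* (+ 1)} {q₁ = 1} {p₂ = + suc k} {q₂ = 1}
           (cong (λ x → (+ 1) ℤ.+ x) (ℤP.*-identityʳ (+ k))) refl

  sumℚ-ones : ∀ {A : Set} (f : A → ℚ) → (∀ x → f x ≡ 1ℚ) → ∀ xs → sumℚ (map f xs) ≡ (+ length xs) / 1
  sumℚ-ones f f≡1 []       = refl
  sumℚ-ones f f≡1 (x ∷ xs) rewrite f≡1 x | sumℚ-ones f f≡1 xs = 1+k/1 (length xs)

  F-at-ones : ∀ m n → F m (λ _ → 1ℚ) n ≡ countSeries m n
  F-at-ones m n = sumℚ-ones _ (weight-1ℚ m n) (PiM m n)

open import Defs
open import Data.Nat as ℕ using (ℕ; _≤_)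
open import Data.Fin using (Fin; suc; inject₁)
open import Data.Product using (_×_; _,_)
open import Data.Rational using (ℚ; 0ℚ; 1ℚ)
open import Relation.Binary.PropositionalEquality using (_≡_; _≢_)
open Recurrence using (functional-equation)
open Specialisation using (F-at-ones)

proposition3 : (m : ℕ) → 1 ≤ m →
    ((v : Fin (ℕ.suc m) → ℚ) →
      (∀ i → v i ≢ 0ℚ) →
      (∀ (j : Fin m) → v (inject₁ j) ≢ v (suc j)) →
      ∀ n → F m v n ≡ RHS m v n)
    × (∀ n → F m (λ _ → 1ℚ) n ≡ countSeries m n)
proposition3 (ℕ.suc m′) _ = functional-equation m′ , F-at-ones (ℕ.suc m′)
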